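{- Let $q$ be a prime power, $k,m$ positive integers and $1\le i<m$. Let $U$ be an $\mathbb{F}_q$-subspace of $\mathbb{F}_{q^m}^k$ of dimension $n$ such that $L_U$ is an $i$-club in $\mathrm{PG}(k-1,q^m)$, and let $\mathcal{C}$ be a rank-metric code associated with $U^{\perp'}$. Then $\mathcal{C}$ is a $[km-n,k,m-i]_{q^m/q}$ code. Moreover, if $i>1$ its weight distribution is $A_0=1$, $A_{m-i}=q^m-1$, $A_{m-1}=(q^m-1)(q^{n-1}+\cdots+q^i)$, $A_m=q^{mk}-1-A_{m-1}-A_{m-i}$, and $A_j=0$ for $j\notin\{0,m-i,m-1,m\}$; if $i=1$ its weight distribution is $A_0=1$, $A_{m-1}=(q^m-1)(q^{n-1}+\cdots+q+1)$, $A_m=q^{mk}-1-A_{m-1}$, and $A_j=0$ for $j\notin\{0,m-1,m\}$.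
   Context: For an $\mathbb{F}_q$-subspace $U$, $L_U=\{\langle u\rangle_{\mathbb{F}_{q^m}} : u\in U\setminus\{0\}\}$; the weight of a point $\langle v\rangle_{\mathbb{F}_{q^m}}$ is $\dim_{\mathbb{F}_q}(U\cap\langle v\rangle_{\mathbb{F}_{q^m}})$; $L_U$ is an $i$-club if exactly one point has weight $i$ and all others weight $1$ (for $i=1$: all points have weight $1$). Duality: fix a non-degenerate reflexive sesquilinear form $\sigma_0$ on $\mathbb{F}_{q^m}^k$, let $\sigma_0'(u,v)=\mathrm{Tr}_{q^m/q}(\sigma_0(u,v))$ and $U^{\perp'}=\{v:\sigma_0'(u,v)=0\ \forall u\in U\}$. Rank weight of $v=(v_1,\dots,v_N)\in\mathbb{F}_{q^m}^N$: $w(v)=\dim_{\mathbb{F}_q}\langle v_1,\ldots,v_N\rangle_{\mathbb{F}_q}$. An $[N,k,d]_{q^m/q}$ code is a $k$-dimensional $\mathbb{F}_{q^m}$-subspace of $\mathbb{F}_{q^m}^N$ with minimum nonzero rank weight $d$; $A_j$ is the number of codewords of rank weight $j$. If $Y$ is an $N$-dimensional $\mathbb{F}_q$-subspace of $\mathbb{F}_{q^m}^k$ whose $\mathbb{F}_{q^m}$-span is $\mathbb{F}_{q^m}^k$, a code associated with $Y$ is $\{xG : x\in\mathbb{F}_{q^m}^k\}$ where $G$ is a $k\times N$ matrix whose columns form an $\mathbb{F}_q$-basis of $Y$ (here $\langle U^{\perp'}\rangle_{\mathbb{F}_{q^m}}=\mathbb{F}_{q^m}^k$ holds because $i<m$).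 -}

module Defs where

open import Data.Nat as ℕ using (ℕ; zero; suc)
open import Data.Nat.Primality using (Prime)
open import Data.Product using (Σ; ∃; ∃₂; _×_; _,_)
open import Data.Sum using (_⊎_)
open import Data.Unit using (⊤)
open import Data.List using (List; length)
open import Data.List.Relation.Unary.Unique.Propositional using (Unique)
open import Data.List.Membership.Propositional using (_∈_)
open import Data.Vec as V using (Vec; []; _∷_)
open import Data.Vec.Relation.Unary.All using (All)
open import Relation.Binary.PropositionalEquality using (_≡_; _≢_)
open import Algebra.Structures using (IsCommutativeRing)
open import Function using (_⇔_)

IsPrimePower : ℕ → Set
IsPrimePower q = ∃₂ λ p e → Prime p × 1 ℕ.≤ e × q ≡ p ℕ.^ e

geom : ℕ → ℕ → ℕ → ℕ
geom q a zero    = 0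
geom q a (suc l) = q ℕ.^ a ℕ.+ geom q (suc a) l

HasCount : {A : Set} → (A → Set) → ℕ → Set
HasCount {A} P a =
  Σ (List A) λ xs → Unique xs × (∀ x → (x ∈ xs ⇔ P x)) × length xs ≡ a

record Field : Set₁ where
  infixl 6 _+_
  infixl 7 _*_
  field
    Carrier           : Set
    _+_ _*_           : Carrier → Carrier → Carrier
    -_                : Carrier → Carrier
    0# 1#             : Carrier
    isCommutativeRing : IsCommutativeRing _≡_ _+_ _*_ -_ 0# 1#
    0≢1               : 0# ≢ 1#
    inverse           : ∀ x → x ≢ 0# → ∃ λ y → x * y ≡ 1#

record VSpace (K : Field) : Set₁ where
  open Field K
  field
    V    : Set
    _⊕_  : V → V → V
    o    : V
    _·_  : Carrier → V → V

module FieldTheory (K : Field) where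
  open Field K

  _^_ : Carrier → ℕ → Carrier
  x ^ zero  = 1#
  x ^ suc e = x * (x ^ e)

  IsSubfield : (Carrier → Set) → Set
  IsSubfield S =
    S 0# × S 1# × (∀ x y → S x → S y → S (x + y)) × (∀ x y → S x → S y → S (x * y))
    × (∀ x → S x → S (- x)) × (∀ x y → S x → x * y ≡ 1# → S y)

  IsAutomorphism : (Carrier → Carrier) → Set
  IsAutomorphism θ =
    (∀ x y → θ (x + y) ≡ θ x + θ y) × (∀ x y → θ (x * y) ≡ θ x * θ y) × θ 1# ≡ 1#
    × (∀ x y → θ x ≡ θ y → x ≡ y) × (∀ y → ∃ λ x → θ x ≡ y)

  scalars : VSpace K
  scalars = record { V = Carrier ; _⊕_ = _+_ ; o = 0# ; _·_ = _*_ }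

  vecs : ℕ → VSpace K
  vecs t = record { V = Vec Carrier t ; _⊕_ = V.zipWith _+_ ; o = V.replicate t 0#
                  ; _·_ = λ a → V.map (a *_) }

  module Lin (E : VSpace K) where
    open VSpace E

    combo : ∀ {l} → Vec Carrier l → Vec V l → V
    combo []       []       = o
    combo (c ∷ cs) (v ∷ vs) = (c · v) ⊕ combo cs vs

    InSpan : (Carrier → Set) → ∀ {l} → Vec V l → V → Set
    InSpan S {l} vs w = Σ (Vec Carrier l) λ c → All S c × combo c vs ≡ w

    Independent : (Carrier → Set) → ∀ {l} → Vec V l → Set
    Independent S {l} vs =
      ∀ (c : Vec Carrier l) → All S c → combo c vs ≡ o → c ≡ V.replicate l 0#

    IsSubspace : (Carrier → Set) → (V → Set) → Set
    IsSubspace S W = W o × (∀ u v → W u → W v → W (u ⊕ v)) × (∀ a u → S a → W u → W (a · u))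

    IsBasis : (Carrier → Set) → (V → Set) → ∀ {l} → Vec V l → Set
    IsBasis S W vs = All W vs × Independent S vs × (∀ w → W w → InSpan S vs w)

    HasDim : (Carrier → Set) → (V → Set) → ℕ → Set
    HasDim S W d = Σ (Vec V d) λ vs → IsBasis S W vs

  open Lin public

  Tr : ℕ → ℕ → Carrier → Carrier
  Tr q zero    x = 0#
  Tr q (suc m) x = Tr q m x + x ^ (q ℕ.^ m)

  module _ {k : ℕ} where
    Vk = Vec Carrier k
    _⊕k_ = VSpace._⊕_ (vecs k)
    _·k_ = VSpace._·_ (vecs k)
    0k = VSpace.o (vecs k)

    IsSesquilinear : (Carrier → Carrier) → (Vk → Vk → Carrier) → Set
    IsSesquilinear θ σ =
      (∀ u u' v → σ (u ⊕k u') v ≡ σ u v + σ u' v)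
      × (∀ u v v' → σ u (v ⊕k v') ≡ σ u v + σ u v')
      × (∀ a u v → σ (a ·k u) v ≡ a * σ u v)
      × (∀ a u v → σ u (a ·k v) ≡ θ a * σ u v)

    IsReflexive : (Vk → Vk → Carrier) → Set
    IsReflexive σ = ∀ u v → σ u v ≡ 0# → σ v u ≡ 0#

    IsNonDegenerate : (Vk → Vk → Carrier) → Set
    IsNonDegenerate σ = ∀ u → (∀ v → σ u v ≡ 0#) → u ≡ 0k

    Perp' : ℕ → ℕ → (Vk → Vk → Carrier) → (Vk → Set) → Vk → Set
    Perp' q m σ U v = ∀ u → U u → Tr q m (σ u v) ≡ 0#

    PointWeight : (Carrier → Set) → (Vk → Set) → Vk → ℕ → Set
    PointWeight S U v d = HasDim (vecs k) S (λ w → U w × ∃ λ a → w ≡ a ·k v) d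

    IsClub : (Carrier → Set) → (Vk → Set) → ℕ → Set
    IsClub S U i =
      Σ Vk λ u0 → U u0 × u0 ≢ 0k × PointWeight S U u0 i
        × (∀ u → U u → u ≢ 0k → (∃ λ a → u ≡ a ·k u0) ⊎ PointWeight S U u 1)

  RankWeight : (Carrier → Set) → ∀ {N} → Vec Carrier N → ℕ → Set
  RankWeight S c j = HasDim scalars S (InSpan scalars S c) j

  dot : ∀ {k} → Vec Carrier k → Vec Carrier k → Carrier
  dot x y = V.foldr _ _+_ 0# (V.zipWith _*_ x y)

  -- xG, where G is given by its list of N columns (each in K^k)
  codeword : ∀ {k N} → Vec (Vec Carrier k) N → Vec Carrier k → Vec Carrier N
  codeword G x = V.map (dot x) G

  Code : ∀ {k N} → Vec (Vec Carrier k) N → Vec Carrier N → Set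
  Code {k} G c = ∃ λ (x : Vec Carrier k) → codeword G x ≡ c

  NumOfWeight : (Carrier → Set) → ∀ {k N} → Vec (Vec Carrier k) N → ℕ → ℕ → Set
  NumOfWeight S G j a = HasCount (λ c → Code G c × RankWeight S c j) a

  IsCode : (Carrier → Set) → ∀ {k N} → Vec (Vec Carrier k) N → ℕ → ℕ → Set
  IsCode S {N = N} G k d =
    HasDim (vecs N) (λ _ → ⊤) (Code G) k
    × (Σ (Vec Carrier N) λ c → Code G c × c ≢ V.replicate N 0# × RankWeight S c d)
    × (∀ c j → Code G c → c ≢ V.replicate N 0# → RankWeight S c j → d ℕ.≤ j)

{-# OPTIONS --safe #-}

-- Write y = R⁻¹ x for the vector with dot x = θ⁻¹ σ(y, -) on K^k. The codeword xG lists the values of this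
-- form on an F-basis of Y = U^⊥', so its rank weight is the F-dimension of the image of Y. Because Tr σ is a
-- nondegenerate pairing, |W^⊥'| = q^(km - dim W) for every F-subspace W; the kernel in Y is (U + Ky)^⊥', and
-- |U + Ky| = q^(n + m - w) where q^w = |U ∩ Ky|, so xG has rank weight m - w, w the weight of the point ⟨y⟩.
-- Counting the y by the weight of ⟨y⟩ in the club L_U: the q^m - 1 nonzero multiples of the club point give
-- weight m - i, the (q^m - 1)(q^i + … + q^(n-1)) vectors spanning the other points of L_U give m - 1, and the
-- remaining nonzero y give m.

module Submission where

open import Defs
import Relation.Binary
open import Data.Nat using (ℕ)
import Data.Nat as Nat
open import Data.Nat.Primality using (Prime)
open import Data.Unit using (⊤)
open import Relation.Binary.PropositionalEquality using (_≡_)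
open import Data.Vec using (Vec)


module Counting where

  open import Data.Nat using (ℕ; zero; suc; _≤_; _+_; _*_; _^_; _∸_)
  import Data.Nat.Properties as ℕ
  open import Data.Product using (Σ; ∃; _×_; _,_; proj₁; proj₂)
  open import Data.Empty using (⊥; ⊥-elim)
  open import Data.Unit using (⊤; tt)
  open import Data.List using (List; []; _∷_; length; filter; map; _++_; cartesianProduct; foldr)
  import Data.List.Properties as List
  open import Data.List.Relation.Unary.Any using (here; there)
  open import Data.List.Relation.Unary.All as All using (All; []; _∷_)
  open import Data.List.Relation.Unary.AllPairs using ([]; _∷_)
  open import Data.List.Relation.Unary.Unique.Propositional using (Unique)
  import Data.List.Relation.Unary.Unique.Propositional.Properties as Unique
  open import Data.List.Membership.Propositional using (_∈_; _∉_)
  open import Data.List.Membership.Propositional.Properties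
    using (∈-filter⁺; ∈-filter⁻; ∈-map⁺; ∈-map⁻; ∈-cartesianProduct⁺; ∈-cartesianProduct⁻; ∈-++⁺ˡ; ∈-++⁺ʳ; ∈-++⁻)
  open import Data.List.Membership.Propositional.Properties.WithK using (unique∧set⇒bag)
  import Data.List.Membership.DecPropositional as DecMembership
  open import Data.List.Relation.Binary.BagAndSetEquality using (∼bag⇒↭)
  open import Data.List.Relation.Binary.Permutation.Propositional using (_↭_; ↭⇒↭ₛ)
  open import Data.List.Relation.Binary.Permutation.Propositional.Properties using (↭-length)
  import Data.List.Relation.Binary.Permutation.Setoid.Properties as Perm
  open import Data.Vec using (Vec; []; _∷_)
  import Data.Vec.Relation.Unary.All as Vec
  open import Algebra.Structures using (IsCommutativeMonoid)
  open import Relation.Binary.PropositionalEquality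
  open import Relation.Binary using (DecidableEquality)
  open import Relation.Nullary using (¬_; Dec; yes; no; ¬?)
  open import Relation.Unary using (Decidable)
  open import Data.Sum using (_⊎_; inj₁; inj₂)
  open import Function using (_⇔_; mk⇔; Equivalence; _∘_; _∘′_; case_of_)
  open Equivalence

  private
    variable
      A B : Set
      a b : ℕ

  members : {P : A → Set} → HasCount P a → List A
  members (xs , _) = xs

  members⇒ : {P : A → Set} (h : HasCount P a) → ∀ x → x ∈ members h → P x
  members⇒ (_ , _ , ∈⇔ , _) x = to (∈⇔ x)

  members-unique : {P : A → Set} (h : HasCount P a) → Unique (members h)
  members-unique (_ , xs! , _) = xs!

  length-members : {P : A → Set} (h : HasCount P a) → length (members h) ≡ a
  length-members (_ , _ , _ , |xs|) = |xs|

  count-cong : {P Q : A → Set} → (∀ x → P x → Q x) → (∀ x → Q x → P x) → HasCount P a → HasCount Q a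
  count-cong P⊆Q Q⊆P (xs , xs! , ∈⇔ , |xs|) =
    xs , xs! , (λ x → mk⇔ (P⊆Q x ∘′ to (∈⇔ x)) (from (∈⇔ x) ∘′ Q⊆P x)) , |xs|

  ∅-count : {P : A → Set} → (∀ x → ¬ P x) → HasCount P 0
  ∅-count ¬P = [] , [] , (λ x → mk⇔ (λ ()) (⊥-elim ∘ ¬P x)) , refl

  singleton-count : (x : A) → HasCount (_≡ x) 1
  singleton-count x = (x ∷ []) , ([] ∷ []) , (λ y → mk⇔ (λ { (here y≡x) → y≡x ; (there ()) }) here) , refl

  count-nonempty : {P : A → Set} → HasCount P (suc a) → Σ A P
  count-nonempty ((x ∷ _) , _ , ∈⇔ , _) = x , to (∈⇔ x) (here refl)

  count-zero-empty : {P : A → Set} → HasCount P 0 → ∀ x → ¬ P x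
  count-zero-empty ([] , _ , ∈⇔ , _) x Px with () ← from (∈⇔ x) Px

  sameMembers-↭ : {xs ys : List A} → Unique xs → Unique ys → (∀ x → x ∈ xs ⇔ x ∈ ys) → xs ↭ ys
  sameMembers-↭ xs! ys! ∈⇔ = ∼bag⇒↭ (unique∧set⇒bag xs! ys! (λ {x} → ∈⇔ x))

  count-unique : {P Q : A → Set} → HasCount P a → HasCount Q b → (∀ x → P x → Q x) → (∀ x → Q x → P x) → a ≡ b
  count-unique (xs , xs! , ∈xs , refl) (ys , ys! , ∈ys , refl) P⊆Q Q⊆P =
    ↭-length (sameMembers-↭ xs! ys! λ x →
      mk⇔ (from (∈ys x) ∘′ P⊆Q x ∘′ to (∈xs x)) (from (∈xs x) ∘′ Q⊆P x ∘′ to (∈ys x)))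

  ∉⇒All≢ : {x : A} {xs : List A} → x ∉ xs → All (x ≢_) xs
  ∉⇒All≢ x∉xs = All.tabulate (λ y∈xs x≡y → x∉xs (subst (_∈ _) (sym x≡y) y∈xs))

  map-unique : {xs : List A} (f : A → B) → (∀ x y → x ∈ xs → y ∈ xs → f x ≡ f y → x ≡ y) →
               Unique xs → Unique (map f xs)
  map-unique f inj [] = []
  map-unique f inj (x∉xs ∷ xs!) =
    ∉⇒All≢ (λ fx∈ → let (y , y∈xs , fx≡fy) = ∈-map⁻ f fx∈ in
                     All.lookup x∉xs y∈xs (inj _ y (here refl) (there y∈xs) fx≡fy))
    ∷ map-unique f (λ x y x∈ y∈ → inj x y (there x∈) (there y∈)) xs!

  image-count : {P : A → Set} (f : A → B) → HasCount P a → (∀ x y → P x → P y → f x ≡ f y → x ≡ y) →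
                HasCount (λ y → ∃ λ x → P x × f x ≡ y) a
  image-count f (xs , xs! , ∈⇔ , |xs|) inj =
    map f xs ,
    map-unique f (λ x y x∈ y∈ → inj x y (to (∈⇔ x) x∈) (to (∈⇔ y) y∈)) xs! ,
    (λ y → mk⇔ (λ y∈ → let (x , x∈ , y≡fx) = ∈-map⁻ f y∈ in x , to (∈⇔ x) x∈ , sym y≡fx)
                (λ { (x , Px , refl) → ∈-map⁺ f (from (∈⇔ x) Px) })) ,
    trans (List.length-map f xs) |xs|

  length-cartesianProduct : (xs : List A) (ys : List B) →
                            length (cartesianProduct xs ys) ≡ length xs * length ys
  length-cartesianProduct []       ys = refl
  length-cartesianProduct (x ∷ xs) ys = begin
    length (map (x ,_) ys ++ cartesianProduct xs ys)     ≡⟨ List.length-++ (map (x ,_) ys) ⟩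
    length (map (x ,_) ys) + length (cartesianProduct xs ys)
      ≡⟨ cong₂ _+_ (List.length-map (x ,_) ys) (length-cartesianProduct xs ys) ⟩
    length ys + length xs * length ys                    ∎
    where open ≡-Reasoning

  ×-count : {P : A → Set} {Q : B → Set} → HasCount P a → HasCount Q b → HasCount (λ (xy : A × B) → P (proj₁ xy) × Q (proj₂ xy)) (a * b)
  ×-count (xs , xs! , ∈xs , refl) (ys , ys! , ∈ys , refl) =
    cartesianProduct xs ys , Unique.cartesianProduct⁺ xs! ys! ,
    (λ { (x , y) → mk⇔ (λ xy∈ → let (x∈ , y∈) = ∈-cartesianProduct⁻ xs ys xy∈ in to (∈xs x) x∈ , to (∈ys y) y∈)
                       (λ (Px , Qy) → ∈-cartesianProduct⁺ (from (∈xs x) Px) (from (∈ys y) Qy)) }) ,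
    length-cartesianProduct xs ys

  Vec-count : {P : A → Set} → HasCount P a → ∀ n → HasCount (λ (v : Vec A n) → Vec.All P v) (a ^ n)
  Vec-count h zero = count-cong (λ { [] _ → Vec.[] }) (λ { [] _ → refl }) (singleton-count [])
  Vec-count h (suc n) =
    count-cong (λ { _ ((x , v) , (Px , Pv) , refl) → Px Vec.∷ Pv })
               (λ { (x ∷ v) (Px Vec.∷ Pv) → (x , v) , (Px , Pv) , refl })
               (image-count (λ (x , v) → x ∷ v) (×-count h (Vec-count h n)) (λ { _ _ _ _ refl → refl }))

  universe-decEq : HasCount (λ (_ : A) → ⊤) a → DecidableEquality A
  universe-decEq {A = A} (xs , xs! , ∈⇔ , _) x y = go xs xs! (from (∈⇔ x) tt) (from (∈⇔ y) tt)
    where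
      go : (zs : List A) → Unique zs → x ∈ zs → y ∈ zs → Dec (x ≡ y)
      go (z ∷ zs) _          (here x≡z) (here y≡z) = yes (trans x≡z (sym y≡z))
      go (z ∷ zs) (z∉ ∷ _)   (here x≡z) (there y∈) = no λ x≡y → All.lookup z∉ y∈ (trans (sym x≡z) x≡y)
      go (z ∷ zs) (z∉ ∷ _)   (there x∈) (here y≡z) = no λ x≡y → All.lookup z∉ x∈ (trans (sym y≡z) (sym x≡y))
      go (z ∷ zs) (_ ∷ zs!)  (there x∈) (there y∈) = go zs zs! x∈ y∈

  partition-count : {P : A → Set} → HasCount P a → {Q : A → Set} → Decidable Q →
                    Σ ℕ λ b → Σ ℕ λ c → HasCount (λ x → P x × Q x) b × HasCount (λ x → P x × ¬ Q x) c × b + c ≡ a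
  partition-count {A = A} {P = P} (xs , xs! , ∈⇔ , refl) {Q} Q? =
    _ , _ , part Q? , part (¬? ∘ Q?) , length-partition xs
    where
      part : {R : A → Set} (R? : Decidable R) → HasCount (λ x → P x × R x) (length (filter R? xs))
      part R? = filter R? xs , Unique.filter⁺ R? xs! ,
        (λ x → mk⇔ (λ x∈ → let (x∈xs , Rx) = ∈-filter⁻ R? x∈ in to (∈⇔ x) x∈xs , Rx)
                    (λ (Px , Rx) → ∈-filter⁺ R? (from (∈⇔ x) Px) Rx)) , refl
      length-partition : ∀ ys → length (filter Q? ys) + length (filter (¬? ∘ Q?) ys) ≡ length ys
      length-partition [] = refl
      length-partition (y ∷ ys) with Q? y
      ... | yes _ = cong suc (length-partition ys)
      ... | no  _ = trans (ℕ.+-suc _ _) (cong suc (length-partition ys))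

  count-dec : {P : A → Set} → HasCount P a → DecidableEquality A → Decidable P
  count-dec (xs , _ , ∈⇔ , _) _≟_ x with DecMembership._∈?_ _≟_ x xs
  ... | yes x∈ = yes (to (∈⇔ x) x∈)
  ... | no  x∉ = no (x∉ ∘′ from (∈⇔ x))

  difference-count : {P Q : A → Set} → HasCount P a → HasCount (λ x → P x × Q x) b → Decidable Q →
                     HasCount (λ x → P x × ¬ Q x) (a ∸ b)
  difference-count {a = a} {b = b} hP hP∩Q Q? with partition-count hP Q?
  ... | b′ , c , hP∩Q′ , hP∖Q , b′+c≡a = subst (HasCount _) c≡a-b hP∖Q
    where
      c≡a-b : c ≡ a ∸ b
      c≡a-b = begin
        c                ≡⟨ sym (ℕ.m+n∸m≡n b′ c) ⟩
        b′ + c ∸ b′      ≡⟨ cong₂ _∸_ b′+c≡a (count-unique hP∩Q′ hP∩Q (λ _ p → p) (λ _ p → p)) ⟩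
        a ∸ b            ∎
        where open ≡-Reasoning

  delete-count : {P : A → Set} → DecidableEquality A → HasCount P a → ∀ {x₀} → P x₀ →
                 HasCount (λ x → P x × x ≢ x₀) (a ∸ 1)
  delete-count _≟_ hP {x₀} Px₀ =
    difference-count hP (count-cong (λ { _ refl → Px₀ , refl }) (λ _ → proj₂) (singleton-count x₀)) (_≟ x₀)

  module WithDecEq {A : Set} (_≟_ : DecidableEquality A) where

    open DecMembership _≟_ using (_∈?_)

    count-mono : {P Q : A → Set} → HasCount P a → HasCount Q b → (∀ x → P x → Q x) → a ≤ b
    count-mono {P = P} (xs , xs! , ∈xs , refl) (ys , ys! , ∈ys , refl) P⊆Q = begin
      length xs                    ≡⟨ ↭-length (sameMembers-↭ xs! (Unique.filter⁺ (_∈? xs) {ys} ys!) ∈⇔) ⟩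
      length (filter (_∈? xs) ys)  ≤⟨ List.length-filter (_∈? xs) ys ⟩
      length ys                    ∎
      where
        open ℕ.≤-Reasoning
        ∈⇔ : ∀ x → x ∈ xs ⇔ x ∈ filter (_∈? xs) ys
        ∈⇔ x = mk⇔ (λ x∈ → ∈-filter⁺ (_∈? xs) (from (∈ys x) (P⊆Q x (to (∈xs x) x∈))) x∈)
                   (λ x∈ → proj₂ (∈-filter⁻ (_∈? xs) {xs = ys} x∈))

    count-full : {P Q : A → Set} → HasCount P a → HasCount Q b → (∀ x → P x → Q x) → b ≤ a →
                 ∀ x → Q x → P x
    count-full {P = P} {Q = Q} hP@(xs , xs! , ∈xs , refl) hQ P⊆Q b≤a x Qx with count-dec hP _≟_ x
    ... | yes Px = Px
    ... | no ¬Px = ⊥-elim (ℕ.<-irrefl refl (ℕ.≤-trans (count-mono hP⊎x hQ P⊎x⊆Q) b≤a))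
      where
        hP⊎x : HasCount (λ y → y ≡ x ⊎ P y) (suc (length xs))
        hP⊎x = x ∷ xs , ∉⇒All≢ (¬Px ∘′ to (∈xs x)) ∷ xs! ,
               (λ y → mk⇔ (λ { (here y≡x) → inj₁ y≡x ; (there y∈) → inj₂ (to (∈xs y) y∈) })
                          (λ { (inj₁ y≡x) → here y≡x ; (inj₂ Py) → there (from (∈xs y) Py) })) , refl
        P⊎x⊆Q : ∀ y → y ≡ x ⊎ P y → Q y
        P⊎x⊆Q y (inj₁ refl) = Qx
        P⊎x⊆Q y (inj₂ Py)   = P⊆Q y Py

  fibre-count : {P : A → Set} {R : B → Set} {s : ℕ} → DecidableEquality B → (f : A → B) →
                HasCount P a → HasCount R b → (∀ x → P x → R (f x)) →
                (∀ y → R y → HasCount (λ x → P x × f x ≡ y) s) → a ≡ s * b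
  fibre-count {A = A} {B = B} {P = P} {s = s} _≟_ f hP (ys , ys! , ∈ys , refl) P⇒R fibre =
    go ys ys! hP (λ x Px → from (∈ys (f x)) (P⇒R x Px)) (λ y y∈ → fibre y (to (∈ys y) y∈))
    where
      go : ∀ {P : A → Set} {a} (ys : List B) → Unique ys → HasCount P a → (∀ x → P x → f x ∈ ys) →
           (∀ y → y ∈ ys → HasCount (λ x → P x × f x ≡ y) s) → a ≡ s * length ys
      go [] _ hP into _ =
        trans (count-unique hP (∅-count {P = λ _ → ⊥} λ _ ()) (λ x Px → case into x Px of λ ()) λ _ ())
              (sym (ℕ.*-zeroʳ s))
      go (y ∷ ys) (y∉ ∷ ys!) hP into fibres with partition-count hP (λ x → f x ≟ y)
      ... | b , c , hP∩y , hP∖y , b+c≡a = begin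
        _            ≡⟨ sym b+c≡a ⟩
        b + c        ≡⟨ cong₂ _+_ (count-unique hP∩y (fibres y (here refl)) (λ _ p → p) (λ _ p → p))
                                   (go ys ys! hP∖y into′ fibres′) ⟩
        s + s * length ys ≡⟨ sym (ℕ.*-suc s (length ys)) ⟩
        s * suc (length ys) ∎
        where
          open ≡-Reasoning
          into′ : ∀ x → _ → f x ∈ ys
          into′ x (Px , fx≢y) with into x Px
          ... | here fx≡y = ⊥-elim (fx≢y fx≡y)
          ... | there fx∈ = fx∈
          fibres′ : ∀ z → z ∈ ys → HasCount (λ x → (_ × f x ≢ y) × f x ≡ z) s
          fibres′ z z∈ = count-cong (λ x (Px , fx≡z) → (Px , λ fx≡y → All.lookup y∉ z∈ (trans (sym fx≡y) fx≡z)) , fx≡z)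
                                    (λ x ((Px , _) , fx≡z) → Px , fx≡z) (fibres z (there z∈))


  module _ {_∙_ : A → A → A} {ε : A} (isCM : IsCommutativeMonoid _≡_ _∙_ ε) where

    fold-sameMembers : {xs ys : List A} → Unique xs → Unique ys → (∀ x → x ∈ xs ⇔ x ∈ ys) →
                       foldr _∙_ ε xs ≡ foldr _∙_ ε ys
    fold-sameMembers xs! ys! ∈⇔ = Perm.foldr-commMonoid (setoid _) isCM (↭⇒↭ₛ (sameMembers-↭ xs! ys! ∈⇔))

    fold-map-bijection : {P : A → Set} (h : HasCount P a) (f g : A → A) →
                         (∀ x → P x → P (f x)) → (∀ x → P x → P (g x)) →
                         (∀ x → f (g x) ≡ x) → (∀ x → g (f x) ≡ x) →
                         foldr _∙_ ε (map f (members h)) ≡ foldr _∙_ ε (members h)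
    fold-map-bijection {P = P} (xs , xs! , ∈⇔ , _) f g f-closed g-closed fg≗id gf≗id =
      fold-sameMembers (Unique.map⁺ (λ {x} {y} fx≡fy → trans (sym (gf≗id x)) (trans (cong g fx≡fy) (gf≗id y))) xs!) xs!
        λ y → mk⇔ (λ y∈ → let (x , x∈ , y≡fx) = ∈-map⁻ f y∈ in
                           from (∈⇔ y) (subst P (sym y≡fx) (f-closed x (to (∈⇔ x) x∈))))
                  (λ y∈ → subst (_∈ map f xs) (fg≗id y) (∈-map⁺ f (from (∈⇔ (g y)) (g-closed y (to (∈⇔ y) y∈)))))

  subset-count : {P : A → Set} → HasCount (λ (_ : A) → ⊤) a → Decidable P → Σ ℕ (HasCount P)
  subset-count hA P? with partition-count hA P?
  ... | b , _ , hP , _ = b , count-cong (λ _ → proj₂) (λ _ Px → tt , Px) hP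

  search : {P : A → Set} → HasCount (λ (_ : A) → ⊤) a → Decidable P → Dec (Σ A P)
  search hA P? with subset-count hA P?
  ... | zero  , hP = no λ (x , Px) → count-zero-empty hP x Px
  ... | suc _ , hP = yes (count-nonempty hP)

  disjoint-union-count : {P Q : A → Set} → HasCount P a → HasCount Q b → (∀ x → P x → ¬ Q x) →
                         HasCount (λ x → P x ⊎ Q x) (a + b)
  disjoint-union-count (xs , xs! , ∈xs , refl) (ys , ys! , ∈ys , refl) disjoint =
    xs ++ ys , Unique.++⁺ xs! ys! (λ (x∈xs , x∈ys) → disjoint _ (to (∈xs _) x∈xs) (to (∈ys _) x∈ys)) ,
    (λ x → mk⇔ (λ x∈ → case ∈-++⁻ xs x∈ of λ { (inj₁ x∈xs) → inj₁ (to (∈xs x) x∈xs) ; (inj₂ x∈ys) → inj₂ (to (∈ys x) x∈ys) })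
               (λ { (inj₁ Px) → ∈-++⁺ˡ (from (∈xs x) Px) ; (inj₂ Qx) → ∈-++⁺ʳ xs (from (∈ys x) Qx) })) ,
    List.length-++ xs

module FieldProperties (K : Field) (_≟_ : Relation.Binary.DecidableEquality (Field.Carrier K)) where

  open import Data.Nat as ℕ using (zero; suc)
  open import Data.Product using (proj₁; proj₂)
  open import Relation.Binary.PropositionalEquality
  open import Relation.Nullary using (yes; no; contradiction)
  open import Algebra.Bundles using (CommutativeRing)
  import Algebra.Properties.Ring as RingProperties
  import Algebra.Properties.CommutativeSemigroup as CommutativeSemigroupProperties
  import Algebra.Properties.Semiring.Exp as ExpProperties
  import Algebra.Properties.CommutativeSemiring.Exp as CommExpProperties
  open Field K public
  open ≡-Reasoning

  commutativeRing : CommutativeRing _ _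
  commutativeRing = record { isCommutativeRing = isCommutativeRing }

  open CommutativeRing commutativeRing public
    using ( ring; commutativeSemiring; semiring; +-assoc; +-comm; +-identityˡ; +-identityʳ; -‿inverseˡ; -‿inverseʳ
          ; *-assoc; *-comm; *-identityˡ; *-identityʳ; distribˡ; distribʳ; zeroˡ; zeroʳ )
  open ExpProperties semiring public using () renaming (_^_ to _^′_)
  open RingProperties ring public
  open CommutativeSemigroupProperties (CommutativeRing.+-commutativeSemigroup commutativeRing) public
    using () renaming (interchange to +-interchange)
  open CommutativeSemigroupProperties (CommutativeRing.*-commutativeSemigroup commutativeRing) public
    using () renaming (interchange to *-interchange)

  1≢0 : 1# ≢ 0#
  1≢0 1≡0 = 0≢1 (sym 1≡0)

  -- Total inverse: 0# ⁻¹ is the junk value 0#.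
  infixl 30 _⁻¹

  _⁻¹ : Carrier → Carrier
  x ⁻¹ with x ≟ 0#
  ... | yes _   = 0#
  ... | no  x≢0 = proj₁ (inverse x x≢0)

  x*x⁻¹≡1 : ∀ {x} → x ≢ 0# → x * x ⁻¹ ≡ 1#
  x*x⁻¹≡1 {x} x≢0 with x ≟ 0#
  ... | yes x≡0 = contradiction x≡0 x≢0
  ... | no  x≢0 = proj₂ (inverse x x≢0)

  x⁻¹*x≡1 : ∀ {x} → x ≢ 0# → x ⁻¹ * x ≡ 1#
  x⁻¹*x≡1 {x} x≢0 = trans (*-comm _ x) (x*x⁻¹≡1 x≢0)

  *-cancelˡ-nonZero : ∀ {a} x y → a ≢ 0# → a * x ≡ a * y → x ≡ y
  *-cancelˡ-nonZero {a} x y a≢0 ax≡ay = begin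
    x                ≡⟨ sym (*-identityˡ x) ⟩
    1# * x           ≡⟨ cong (_* x) (sym (x⁻¹*x≡1 a≢0)) ⟩
    (a ⁻¹ * a) * x   ≡⟨ *-assoc _ _ _ ⟩
    a ⁻¹ * (a * x)   ≡⟨ cong (a ⁻¹ *_) ax≡ay ⟩
    a ⁻¹ * (a * y)   ≡⟨ sym (*-assoc _ _ _) ⟩
    (a ⁻¹ * a) * y   ≡⟨ cong (_* y) (x⁻¹*x≡1 a≢0) ⟩
    1# * y           ≡⟨ *-identityˡ y ⟩
    y                ∎

  *-nonZero : ∀ {a b} → a ≢ 0# → b ≢ 0# → a * b ≢ 0#
  *-nonZero {a} {b} a≢0 b≢0 ab≡0 = b≢0 (*-cancelˡ-nonZero b 0# a≢0 (trans ab≡0 (sym (zeroʳ a))))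

  ⁻¹-nonZero : ∀ {x} → x ≢ 0# → x ⁻¹ ≢ 0#
  ⁻¹-nonZero {x} x≢0 x⁻¹≡0 = 1≢0 (trans (sym (x*x⁻¹≡1 x≢0)) (trans (cong (x *_) x⁻¹≡0) (zeroʳ x)))

  ⁻¹-involutive : ∀ {x} → x ≢ 0# → x ⁻¹ ⁻¹ ≡ x
  ⁻¹-involutive {x} x≢0 =
    *-cancelˡ-nonZero _ x (⁻¹-nonZero x≢0) (trans (x*x⁻¹≡1 (⁻¹-nonZero x≢0)) (sym (x⁻¹*x≡1 x≢0)))

  open FieldTheory K public using (_^_)

  ^≗^′ : ∀ x n → x ^ n ≡ x ^′ n
  ^≗^′ x zero    = refl
  ^≗^′ x (suc n) = cong (x *_) (^≗^′ x n)

  ^-homo-* : ∀ x m n → x ^ (m ℕ.+ n) ≡ x ^ m * x ^ n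
  ^-homo-* x m n = begin
    x ^ (m ℕ.+ n)     ≡⟨ ^≗^′ x (m ℕ.+ n) ⟩
    x ^′ (m ℕ.+ n)    ≡⟨ ExpProperties.^-homo-* semiring x m n ⟩
    x ^′ m * x ^′ n   ≡⟨ sym (cong₂ _*_ (^≗^′ x m) (^≗^′ x n)) ⟩
    x ^ m * x ^ n     ∎

  ^-assocʳ : ∀ x m n → (x ^ m) ^ n ≡ x ^ (m ℕ.* n)
  ^-assocʳ x m n = begin
    (x ^ m) ^ n      ≡⟨ ^≗^′ (x ^ m) n ⟩
    (x ^ m) ^′ n     ≡⟨ cong (_^′ n) (^≗^′ x m) ⟩
    (x ^′ m) ^′ n    ≡⟨ ExpProperties.^-assocʳ semiring x m n ⟩
    x ^′ (m ℕ.* n)   ≡⟨ sym (^≗^′ x (m ℕ.* n)) ⟩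
    x ^ (m ℕ.* n)    ∎

  ^-distrib-* : ∀ x y n → (x * y) ^ n ≡ x ^ n * y ^ n
  ^-distrib-* x y n = begin
    (x * y) ^ n      ≡⟨ ^≗^′ (x * y) n ⟩
    (x * y) ^′ n     ≡⟨ CommExpProperties.^-distrib-* commutativeSemiring x y n ⟩
    x ^′ n * y ^′ n  ≡⟨ sym (cong₂ _*_ (^≗^′ x n) (^≗^′ y n)) ⟩
    x ^ n * y ^ n    ∎

  ^-nonZero : ∀ {x} n → x ≢ 0# → x ^ n ≢ 0#
  ^-nonZero zero    x≢0 = 1≢0
  ^-nonZero (suc n) x≢0 = *-nonZero x≢0 (^-nonZero n x≢0)

module NatPowers where

  open import Data.Nat
  open import Data.Nat.Properties
  open import Relation.Binary using (tri<; tri≈; tri>)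
  open import Relation.Binary.PropositionalEquality
  open import Relation.Nullary using (contradiction)

  ^-injectiveʳ : ∀ {s a b} → 2 ≤ s → s ^ a ≡ s ^ b → a ≡ b
  ^-injectiveʳ {s} {a} {b} 2≤s sᵃ≡sᵇ with <-cmp a b
  ... | tri< a<b _ _ = contradiction sᵃ≡sᵇ (<⇒≢ (^-monoʳ-< s 2≤s a<b))
  ... | tri≈ _ a≡b _ = a≡b
  ... | tri> _ _ a>b = contradiction (sym sᵃ≡sᵇ) (<⇒≢ (^-monoʳ-< s 2≤s a>b))

module SubfieldClosure (K : Field) {S : Field.Carrier K → Set} (SF : FieldTheory.IsSubfield K S) where

  open Field K
  open import Data.Product using (proj₁; proj₂)
  open import Relation.Binary.PropositionalEquality using (_≡_)

  0∈ : S 0#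
  0∈ = proj₁ SF

  1∈ : S 1#
  1∈ = proj₁ (proj₂ SF)

  +-closed : ∀ {x y} → S x → S y → S (x + y)
  +-closed = proj₁ (proj₂ (proj₂ SF)) _ _

  *-closed : ∀ {x y} → S x → S y → S (x * y)
  *-closed = proj₁ (proj₂ (proj₂ (proj₂ SF))) _ _

  -‿closed : ∀ {x} → S x → S (- x)
  -‿closed = proj₁ (proj₂ (proj₂ (proj₂ (proj₂ SF)))) _

  inverse-closed : ∀ {x y} → S x → x * y ≡ 1# → S y
  inverse-closed = proj₂ (proj₂ (proj₂ (proj₂ (proj₂ SF)))) _ _

module VectorSpaces (K : Field) (_≟_ : Relation.Binary.DecidableEquality (Field.Carrier K)) where

  open import Data.Nat using (ℕ)
  open import Data.Vec as Vec using (Vec; []; _∷_)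
  import Data.Vec.Properties as Vec
  open import Relation.Binary.PropositionalEquality
  open import Relation.Nullary using (yes; no; contradiction)
  open FieldProperties K _≟_
  open FieldTheory K using (vecs; scalars)
  open ≡-Reasoning

  record VSpaceLaws (E : VSpace K) : Set where
    open VSpace E
    field
      ⊕-assoc     : ∀ u v w → (u ⊕ v) ⊕ w ≡ u ⊕ (v ⊕ w)
      ⊕-comm      : ∀ u v → u ⊕ v ≡ v ⊕ u
      ⊕-identityˡ : ∀ u → o ⊕ u ≡ u
      ·-distribˡ  : ∀ a u v → a · (u ⊕ v) ≡ (a · u) ⊕ (a · v)
      ·-distribʳ  : ∀ a b u → (a + b) · u ≡ (a · u) ⊕ (b · u)
      ·-assoc     : ∀ a b u → (a * b) · u ≡ a · (b · u)
      ·-identityˡ : ∀ u → 1# · u ≡ u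
      ·-zeroˡ     : ∀ u → 0# · u ≡ o
      _≟V_        : Relation.Binary.DecidableEquality V

  scalars-laws : VSpaceLaws scalars
  scalars-laws = record
    { ⊕-assoc = +-assoc ; ⊕-comm = +-comm ; ⊕-identityˡ = +-identityˡ ; ·-distribˡ = distribˡ
    ; ·-distribʳ = λ a b u → distribʳ u a b ; ·-assoc = *-assoc ; ·-identityˡ = *-identityˡ
    ; ·-zeroˡ = zeroˡ ; _≟V_ = _≟_ }

  module _ {t : ℕ} where

    infixl 6 _⊕v_
    infixr 7 _·v_

    _⊕v_ : Vec Carrier t → Vec Carrier t → Vec Carrier t
    _⊕v_ = VSpace._⊕_ (vecs t)

    _·v_ : Carrier → Vec Carrier t → Vec Carrier t
    _·v_ = VSpace._·_ (vecs t)

    0v : Vec Carrier t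
    0v = VSpace.o (vecs t)

  private
    ·v-distribˡ : ∀ {t} a (u v : Vec Carrier t) → a ·v (u ⊕v v) ≡ (a ·v u) ⊕v (a ·v v)
    ·v-distribˡ a []      []      = refl
    ·v-distribˡ a (b ∷ u) (c ∷ v) = cong₂ _∷_ (distribˡ a b c) (·v-distribˡ a u v)

    ·v-distribʳ : ∀ {t} a b (u : Vec Carrier t) → (a + b) ·v u ≡ (a ·v u) ⊕v (b ·v u)
    ·v-distribʳ a b []      = refl
    ·v-distribʳ a b (c ∷ u) = cong₂ _∷_ (distribʳ c a b) (·v-distribʳ a b u)

  vecs-laws : ∀ t → VSpaceLaws (vecs t)
  vecs-laws t = record
    { ⊕-assoc     = Vec.zipWith-assoc +-assoc
    ; ⊕-comm      = Vec.zipWith-comm +-comm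
    ; ⊕-identityˡ = Vec.zipWith-identityˡ +-identityˡ
    ; ·-distribˡ  = ·v-distribˡ
    ; ·-distribʳ  = ·v-distribʳ
    ; ·-assoc     = λ a b u → trans (Vec.map-cong (*-assoc a b) u) (Vec.map-∘ (a *_) (b *_) u)
    ; ·-identityˡ = λ u → trans (Vec.map-cong *-identityˡ u) (Vec.map-id u)
    ; ·-zeroˡ     = λ u → trans (Vec.map-cong zeroˡ u) (Vec.map-const u 0#)
    ; _≟V_        = Vec.≡-dec _≟_ }

  module VSpaceProperties {E : VSpace K} (L : VSpaceLaws E) where

    open VSpace E
    open VSpaceLaws L

    ⊖_ : V → V
    ⊖ v = (- 1#) · v

    ⊕-identityʳ : ∀ u → u ⊕ o ≡ u
    ⊕-identityʳ u = trans (⊕-comm u o) (⊕-identityˡ u)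

    ⊕-inverseʳ : ∀ u → u ⊕ (⊖ u) ≡ o
    ⊕-inverseʳ u = begin
      u ⊕ ((- 1#) · u)          ≡⟨ cong (_⊕ ((- 1#) · u)) (sym (·-identityˡ u)) ⟩
      (1# · u) ⊕ ((- 1#) · u)   ≡⟨ sym (·-distribʳ 1# (- 1#) u) ⟩
      (1# + - 1#) · u           ≡⟨ cong (_· u) (-‿inverseʳ 1#) ⟩
      0# · u                    ≡⟨ ·-zeroˡ u ⟩
      o                         ∎

    ⊕-inverseˡ : ∀ u → (⊖ u) ⊕ u ≡ o
    ⊕-inverseˡ u = trans (⊕-comm _ u) (⊕-inverseʳ u)

    ⊕-cancelʳ : ∀ a x y → x ⊕ a ≡ y ⊕ a → x ≡ y
    ⊕-cancelʳ a x y xa≡ya = begin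
      x                  ≡⟨ sym (⊕-identityʳ x) ⟩
      x ⊕ o              ≡⟨ cong (x ⊕_) (sym (⊕-inverseʳ a)) ⟩
      x ⊕ (a ⊕ (⊖ a))    ≡⟨ sym (⊕-assoc x a _) ⟩
      (x ⊕ a) ⊕ (⊖ a)    ≡⟨ cong (_⊕ (⊖ a)) xa≡ya ⟩
      (y ⊕ a) ⊕ (⊖ a)    ≡⟨ ⊕-assoc y a _ ⟩
      y ⊕ (a ⊕ (⊖ a))    ≡⟨ cong (y ⊕_) (⊕-inverseʳ a) ⟩
      y ⊕ o              ≡⟨ ⊕-identityʳ y ⟩
      y                  ∎

    x⊖y≡o⇒x≡y : ∀ x y → x ⊕ (⊖ y) ≡ o → x ≡ y
    x⊖y≡o⇒x≡y x y x⊖y≡o = ⊕-cancelʳ (⊖ y) x y (trans x⊖y≡o (sym (⊕-inverseʳ y)))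

    x⊕y≡o⇒y≡⊖x : ∀ x y → x ⊕ y ≡ o → y ≡ ⊖ x
    x⊕y≡o⇒y≡⊖x x y x⊕y≡o = ⊕-cancelʳ x y (⊖ x) (trans (⊕-comm y x) (trans x⊕y≡o (sym (⊕-inverseˡ x))))

    ⊕-⊖-cancel : ∀ u w → (u ⊕ w) ⊕ (⊖ w) ≡ u
    ⊕-⊖-cancel u w = trans (⊕-assoc u w _) (trans (cong (u ⊕_) (⊕-inverseʳ w)) (⊕-identityʳ u))

    ⊖-⊕-cancel : ∀ u w → (u ⊕ (⊖ w)) ⊕ w ≡ u
    ⊖-⊕-cancel u w = trans (⊕-assoc u _ w) (trans (cong (u ⊕_) (⊕-inverseˡ w)) (⊕-identityʳ u))

    ·-zeroʳ : ∀ a → a · o ≡ o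
    ·-zeroʳ a = begin
      a · o          ≡⟨ cong (a ·_) (sym (·-zeroˡ o)) ⟩
      a · (0# · o)   ≡⟨ sym (·-assoc a 0# o) ⟩
      (a * 0#) · o   ≡⟨ cong (_· o) (zeroʳ a) ⟩
      0# · o         ≡⟨ ·-zeroˡ o ⟩
      o              ∎

    ⊖-· : ∀ a u → ⊖ (a · u) ≡ (- a) · u
    ⊖-· a u = trans (sym (·-assoc (- 1#) a u)) (cong (_· u) (-1*x≈-x a))

    ⊕-interchange : ∀ a b c d → (a ⊕ b) ⊕ (c ⊕ d) ≡ (a ⊕ c) ⊕ (b ⊕ d)
    ⊕-interchange a b c d = begin
      (a ⊕ b) ⊕ (c ⊕ d)   ≡⟨ ⊕-assoc a b _ ⟩
      a ⊕ (b ⊕ (c ⊕ d))   ≡⟨ cong (a ⊕_) (sym (⊕-assoc b c d)) ⟩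
      a ⊕ ((b ⊕ c) ⊕ d)   ≡⟨ cong (λ z → a ⊕ (z ⊕ d)) (⊕-comm b c) ⟩
      a ⊕ ((c ⊕ b) ⊕ d)   ≡⟨ cong (a ⊕_) (⊕-assoc c b d) ⟩
      a ⊕ (c ⊕ (b ⊕ d))   ≡⟨ sym (⊕-assoc a c _) ⟩
      (a ⊕ c) ⊕ (b ⊕ d)   ∎

    ·-cancel-nonZero : ∀ {a} u → a ≢ 0# → a · u ≡ o → u ≡ o
    ·-cancel-nonZero {a} u a≢0 au≡o = begin
      u                  ≡⟨ sym (·-identityˡ u) ⟩
      1# · u             ≡⟨ cong (_· u) (sym (x⁻¹*x≡1 a≢0)) ⟩
      (a ⁻¹ * a) · u     ≡⟨ ·-assoc _ _ u ⟩
      a ⁻¹ · (a · u)     ≡⟨ cong (a ⁻¹ ·_) au≡o ⟩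
      a ⁻¹ · o           ≡⟨ ·-zeroʳ _ ⟩
      o                  ∎

    ·-injectiveˡ : ∀ {u} → u ≢ o → ∀ a b → a · u ≡ b · u → a ≡ b
    ·-injectiveˡ {u} u≢o a b au≡bu with (a + - b) ≟ 0#
    ... | yes a-b≡0 = x∙y⁻¹≈ε⇒x≈y a b a-b≡0
    ... | no  a-b≢0 = contradiction (·-cancel-nonZero u a-b≢0 (begin
      (a + - b) · u            ≡⟨ ·-distribʳ a (- b) u ⟩
      (a · u) ⊕ ((- b) · u)    ≡⟨ cong (_⊕ ((- b) · u)) au≡bu ⟩
      (b · u) ⊕ ((- b) · u)    ≡⟨ sym (·-distribʳ b (- b) u) ⟩
      (b + - b) · u            ≡⟨ cong (_· u) (-‿inverseʳ b) ⟩
      0# · u                   ≡⟨ ·-zeroˡ u ⟩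
      o                        ∎)) u≢o

    ·-flip : ∀ {a} u y → a ≢ 0# → u ≡ a · y → y ≡ a ⁻¹ · u
    ·-flip {a} u y a≢0 u≡ay = sym (begin
      a ⁻¹ · u           ≡⟨ cong (a ⁻¹ ·_) u≡ay ⟩
      a ⁻¹ · (a · y)     ≡⟨ sym (·-assoc _ a y) ⟩
      (a ⁻¹ * a) · y     ≡⟨ cong (_· y) (x⁻¹*x≡1 a≢0) ⟩
      1# · y             ≡⟨ ·-identityˡ y ⟩
      y                  ∎)

module FiniteSubfieldSpan (K : Field) (_≟_ : Relation.Binary.DecidableEquality (Field.Carrier K))
  {E : VSpace K} (L : VectorSpaces.VSpaceLaws K _≟_ E)
  {S : Field.Carrier K → Set} (SF : FieldTheory.IsSubfield K S) {s : ℕ} (hS : HasCount S s) where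

  open import Data.Nat as ℕ using (zero; suc; _≤_)
  import Data.Nat.Properties as ℕ
  open import Data.Product using (_,_; proj₂)
  open import Data.Sum using (_⊎_; inj₁; inj₂)
  open import Data.List using ([]; _∷_)
  open import Data.List.Relation.Unary.Any using (here; there)
  open import Data.List.Relation.Unary.All using ([]; _∷_)
  open import Data.List.Relation.Unary.AllPairs using ([]; _∷_)
  open import Data.Vec using (Vec; []; _∷_)
  import Data.Vec.Properties as Vec
  open import Data.Vec.Relation.Unary.All using (All; []; _∷_)
  open import Relation.Binary.PropositionalEquality
  open import Relation.Nullary using (¬_; Dec; yes; no; contradiction)
  open import Function using (mk⇔)
  open FieldProperties K _≟_
  open VectorSpaces K _≟_ using (_⊕v_; _·v_; 0v; module VSpaceLaws; module VSpaceProperties)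
  open SubfieldClosure K SF
  open FieldTheory K using (module Lin)
  open Lin E
  open VSpace E
  open VSpaceLaws L
  open VSpaceProperties L
  open Counting
  open Counting.WithDecEq _≟V_
  open NatPowers
  open ≡-Reasoning

  ⁻¹-closed : ∀ {x} → S x → S (x ⁻¹)
  ⁻¹-closed {x} Sx with x ≟ 0#
  ... | yes _   = 0∈
  ... | no  x≢0 = inverse-closed Sx (proj₂ (inverse x x≢0))

  2≤s : 2 ≤ s
  2≤s = Counting.WithDecEq.count-mono _≟_ {P = λ x → x ≡ 0# ⊎ x ≡ 1#} zero-or-one hS
          λ { _ (inj₁ refl) → 0∈ ; _ (inj₂ refl) → 1∈ }
    where
      zero-or-one : HasCount (λ x → x ≡ 0# ⊎ x ≡ 1#) 2
      zero-or-one = 0# ∷ 1# ∷ [] , (0≢1 ∷ []) ∷ [] ∷ [] ,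
        (λ x → mk⇔ (λ { (here x≡0) → inj₁ x≡0 ; (there (here x≡1)) → inj₂ x≡1 ; (there (there ())) })
                   (λ { (inj₁ x≡0) → here x≡0 ; (inj₂ x≡1) → there (here x≡1) })) , refl

  combo-⊕v : ∀ {l} (c d : Vec Carrier l) (vs : Vec V l) → combo (c ⊕v d) vs ≡ combo c vs ⊕ combo d vs
  combo-⊕v []      []      []       = sym (⊕-identityˡ o)
  combo-⊕v (a ∷ c) (b ∷ d) (v ∷ vs) = begin
    ((a + b) · v) ⊕ combo (c ⊕v d) vs                ≡⟨ cong₂ _⊕_ (·-distribʳ a b v) (combo-⊕v c d vs) ⟩
    ((a · v) ⊕ (b · v)) ⊕ (combo c vs ⊕ combo d vs)  ≡⟨ ⊕-interchange _ _ _ _ ⟩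
    ((a · v) ⊕ combo c vs) ⊕ ((b · v) ⊕ combo d vs)  ∎

  combo-·v : ∀ {l} a (c : Vec Carrier l) (vs : Vec V l) → combo (a ·v c) vs ≡ a · combo c vs
  combo-·v a []      []       = sym (·-zeroʳ a)
  combo-·v a (b ∷ c) (v ∷ vs) = trans (cong₂ _⊕_ (·-assoc a b v) (combo-·v a c vs)) (sym (·-distribˡ a _ _))

  combo-0v : ∀ {l} (vs : Vec V l) → combo 0v vs ≡ o
  combo-0v []       = refl
  combo-0v (v ∷ vs) = trans (cong₂ _⊕_ (·-zeroˡ v) (combo-0v vs)) (⊕-identityˡ o)

  All-⊕v : ∀ {l} {c d : Vec Carrier l} → All S c → All S d → All S (c ⊕v d)
  All-⊕v []         []         = []
  All-⊕v (Sa ∷ Sc)  (Sb ∷ Sd)  = +-closed Sa Sb ∷ All-⊕v Sc Sd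

  All-·v : ∀ {l} {a} {c : Vec Carrier l} → S a → All S c → All S (a ·v c)
  All-·v Sa []        = []
  All-·v Sa (Sb ∷ Sc) = *-closed Sa Sb ∷ All-·v Sa Sc

  All-0v : ∀ {l} → All S (0v {l})
  All-0v {zero}  = []
  All-0v {suc l} = 0∈ ∷ All-0v

  combo-∈ : ∀ {W : V → Set} → IsSubspace S W → ∀ {l} {vs : Vec V l} → All W vs →
            ∀ {c} → All S c → W (combo c vs)
  combo-∈ (W0 , _ , _)       []          []        = W0
  combo-∈ W@(_ , W+ , W·)    (Wv ∷ Wvs)  (Sa ∷ Sc) = W+ _ _ (W· _ _ Sa Wv) (combo-∈ W Wvs Sc)

  span⊆ : ∀ {W : V → Set} → IsSubspace S W → ∀ {l} {vs : Vec V l} → All W vs → ∀ w → InSpan S vs w → W w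
  span⊆ W Wvs w (c , Sc , c·vs≡w) = subst _ c·vs≡w (combo-∈ W Wvs Sc)

  span-subspace : ∀ {l} (vs : Vec V l) → IsSubspace S (InSpan S vs)
  span-subspace vs =
    (0v , All-0v , combo-0v vs) ,
    (λ u v (c , Sc , c·vs≡u) (d , Sd , d·vs≡v) →
       c ⊕v d , All-⊕v Sc Sd , trans (combo-⊕v c d vs) (cong₂ _⊕_ c·vs≡u d·vs≡v)) ,
    (λ a u Sa (c , Sc , c·vs≡u) → a ·v c , All-·v Sa Sc , trans (combo-·v a c vs) (cong (a ·_) c·vs≡u))

  independent⇒combo-injective : ∀ {l} {vs : Vec V l} → Independent S vs →
                                ∀ {c d} → All S c → All S d → combo c vs ≡ combo d vs → c ≡ d
  independent⇒combo-injective {vs = vs} ind {c} {d} Sc Sd c·vs≡d·vs =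
    difference-zero c d (ind _ (All-⊕v Sc (All-·v (-‿closed 1∈) Sd)) (begin
      combo (c ⊕v ((- 1#) ·v d)) vs          ≡⟨ combo-⊕v c _ vs ⟩
      combo c vs ⊕ combo ((- 1#) ·v d) vs    ≡⟨ cong₂ _⊕_ c·vs≡d·vs (combo-·v (- 1#) d vs) ⟩
      combo d vs ⊕ (⊖ combo d vs)            ≡⟨ ⊕-inverseʳ _ ⟩
      o                                      ∎))
    where
      difference-zero : ∀ {l} (c d : Vec Carrier l) → c ⊕v ((- 1#) ·v d) ≡ 0v → c ≡ d
      difference-zero []      []      _   = refl
      difference-zero (a ∷ c) (b ∷ d) c-d≡0 = cong₂ _∷_
        (x∙y⁻¹≈ε⇒x≈y a b (trans (cong (a +_) (sym (-1*x≈-x b))) (Vec.∷-injectiveˡ c-d≡0)))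
        (difference-zero c d (Vec.∷-injectiveʳ c-d≡0))

  span-count : ∀ {l} {vs : Vec V l} → Independent S vs → HasCount (InSpan S vs) (s ℕ.^ l)
  span-count {l} {vs} ind =
    image-count (λ c → combo c vs) (Vec-count hS l) (λ c d Sc Sd → independent⇒combo-injective ind Sc Sd)

  dim⇒count : ∀ {W : V → Set} {d} → IsSubspace S W → HasDim S W d → HasCount W (s ℕ.^ d)
  dim⇒count W (vs , Wvs , ind , spans) = count-cong (span⊆ W Wvs) spans (span-count ind)

  dim-unique : ∀ {W : V → Set} {d d′} → IsSubspace S W → HasDim S W d → HasDim S W d′ → d ≡ d′
  dim-unique W dimW dimW′ =
    ^-injectiveʳ 2≤s (count-unique (dim⇒count W dimW) (dim⇒count W dimW′) (λ _ p → p) (λ _ p → p))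

  []-independent : Independent S []
  []-independent [] _ _ = refl

  ∷-independent : ∀ {l} {vs : Vec V l} {w} → Independent S vs → ¬ InSpan S vs w → Independent S (w ∷ vs)
  ∷-independent {vs = vs} {w} ind w∉span (a ∷ c) (Sa ∷ Sc) a·w⊕c·vs≡o with a ≟ 0#
  ... | yes refl = cong (0# ∷_) (ind c Sc (begin
    combo c vs               ≡⟨ sym (⊕-identityˡ _) ⟩
    o ⊕ combo c vs           ≡⟨ cong (_⊕ combo c vs) (sym (·-zeroˡ w)) ⟩
    (0# · w) ⊕ combo c vs    ≡⟨ a·w⊕c·vs≡o ⟩
    o                        ∎))
  ... | no a≢0 = contradiction (- a ⁻¹ ·v c , All-·v (-‿closed (⁻¹-closed Sa)) Sc , (begin
    combo (- a ⁻¹ ·v c) vs   ≡⟨ combo-·v _ c vs ⟩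
    (- a ⁻¹) · combo c vs    ≡⟨ sym (⊖-· (a ⁻¹) _) ⟩
    ⊖ (a ⁻¹ · combo c vs)    ≡⟨ ⊖-·-comm ⟩
    a ⁻¹ · (⊖ combo c vs)    ≡⟨ cong (a ⁻¹ ·_) (sym (x⊕y≡o⇒y≡⊖x (combo c vs) (a · w) (trans (⊕-comm _ _) a·w⊕c·vs≡o))) ⟩
    a ⁻¹ · (a · w)           ≡⟨ sym (·-flip (a · w) w a≢0 refl) ⟩
    w                        ∎)) w∉span
    where
      ⊖-·-comm : ⊖ (a ⁻¹ · combo c vs) ≡ a ⁻¹ · (⊖ combo c vs)
      ⊖-·-comm = trans (sym (·-assoc _ _ _)) (trans (cong (_· combo c vs) (*-comm (- 1#) (a ⁻¹))) (·-assoc _ _ _))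

  span-dec : ∀ {l} {vs : Vec V l} → Independent S vs → ∀ w → Dec (InSpan S vs w)
  span-dec ind = count-dec (span-count ind) _≟V_

  -- A basis of W is built greedily: an independent family that does not span W extends by any vector outside
  -- its span, and s^|family| ≤ |W| bounds the number of extensions.
  count⇒dim : ∀ {W : V → Set} {d} → IsSubspace S W → HasCount W (s ℕ.^ d) → HasDim S W d
  count⇒dim {W} {d} W-sub hW = extend d 0 refl [] [] []-independent
    where
      extend : (f l : ℕ) → l ℕ.+ f ≡ d → (vs : Vec V l) → All W vs → Independent S vs → HasDim S W d
      extend f l l+f≡d vs Wvs ind with partition-count hW (span-dec ind)
      ... | _ , zero , _ , hOutside , _ = subst (HasDim S W) l≡d (vs , Wvs , ind , spans)
        where
          spans : ∀ w → W w → InSpan S vs w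
          spans w Ww with span-dec ind w
          ... | yes w∈span = w∈span
          ... | no  w∉span = contradiction (Ww , w∉span) (count-zero-empty hOutside w)
          l≡d : l ≡ d
          l≡d = ^-injectiveʳ 2≤s (count-unique (count-cong (span⊆ W-sub Wvs) spans (span-count ind)) hW
                                                 (λ _ p → p) (λ _ p → p))
      ... | _ , suc _ , _ , hOutside , _ with count-nonempty hOutside
      ... | w , Ww , w∉span with f
      ...   | zero   = contradiction (count-mono (span-count ind′) hW (span⊆ W-sub (Ww ∷ Wvs)))
                                     (ℕ.<⇒≱ (ℕ.^-monoʳ-< s 2≤s (subst (ℕ._< suc l) (trans (sym (ℕ.+-identityʳ l)) l+f≡d) (ℕ.n<1+n l))))
        where
          ind′ : Independent S (w ∷ vs)
          ind′ = ∷-independent ind w∉span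
      ...   | suc f′ = extend f′ (suc l) (trans (sym (ℕ.+-suc l f′)) l+f≡d) (w ∷ vs) (Ww ∷ Wvs) (∷-independent ind w∉span)

module PrimeBinomial where

  open import Data.Nat
  open import Data.Nat.Properties
  open import Data.Nat.Divisibility
  open import Data.Nat.Primality
  open import Data.Nat.Combinatorics
  open import Data.Nat.DivMod using (m/n*n≡m)
  open import Data.Sum using ([_,_]′)
  open import Relation.Binary.PropositionalEquality
  open import Relation.Nullary using (¬_; contradiction)

  prime≥2 : ∀ {p} → Prime p → 2 ≤ p
  prime≥2 {p} p-prime = nonTrivial⇒n>1 p {{prime⇒nonTrivial p-prime}}

  prime∤factorial : ∀ {p} → Prime p → ∀ k → k < p → ¬ (p ∣ k !)
  prime∤factorial p-prime zero    _   p∣1 = <⇒≱ (prime≥2 p-prime) (∣⇒≤ p∣1)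
  prime∤factorial p-prime (suc k) k<p p∣k! =
    [ (λ p∣1+k → <⇒≱ k<p (∣⇒≤ p∣1+k)) , prime∤factorial p-prime k (<-trans (n<1+n k) k<p) ]′
      (euclidsLemma (suc k) (k !) p-prime p∣k!)

  -- p divides p! = (p C k) k! (p-k)!, but neither k! nor (p-k)!.
  prime∣binomial : ∀ {p} → Prime p → ∀ k → 0 < k → k < p → p ∣ p C k
  prime∣binomial {p} p-prime k 0<k k<p =
    [ (λ p∣pCk → p∣pCk) , (λ p∣k! → contradiction p∣k! (prime∤factorial p-prime k k<p)) ]′
      (euclidsLemma (p C k) (k !) p-prime
        ([ (λ p∣pCk*k! → p∣pCk*k!) , (λ p∣[p-k]! → contradiction p∣[p-k]! (prime∤factorial p-prime (p ∸ k) p-k<p)) ]′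
          (euclidsLemma ((p C k) * k !) ((p ∸ k) !) p-prime (subst (p ∣_) (sym factorisation) p∣p!))))
    where
      instance
        _ : NonZero (k ! * (p ∸ k) !)
        _ = m*n≢0 (k !) ((p ∸ k) !) {{k !≢0}} {{(p ∸ k) !≢0}}
      p-k<p : p ∸ k < p
      p-k<p = ∸-monoʳ-< {p} {k} {0} 0<k (<⇒≤ k<p)
      factorisation : ((p C k) * k !) * (p ∸ k) ! ≡ p !
      factorisation = trans (*-assoc (p C k) (k !) _)
        (trans (cong (_* (k ! * (p ∸ k) !)) (nCk≡n!/k![n-k]! (<⇒≤ k<p))) (m/n*n≡m (k![n∸k]!∣n! (<⇒≤ k<p))))
      n∣n! : ∀ n → 0 < n → n ∣ n !
      n∣n! (suc n) _ = divides (n !) (*-comm (suc n) (n !))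
      p∣p! : p ∣ p !
      p∣p! = n∣n! p (<-trans 0<k k<p)

module Polynomials (K : Field) (_≟_ : Relation.Binary.DecidableEquality (Field.Carrier K)) where

  open import Data.Nat as ℕ using (zero; suc; _≤_; _<_)
  open import Data.List using (List; []; _∷_; length)
  open import Data.List.Relation.Unary.Any using (here; there)
  open import Data.List.Relation.Unary.All as All using ()
  open import Data.List.Relation.Unary.AllPairs using (_∷_)
  open import Data.List.Relation.Unary.Unique.Propositional using (Unique)
  open import Data.List.Membership.Propositional using (_∈_)
  open import Data.Vec using (Vec; []; _∷_; replicate)
  open import Data.Maybe using (nothing)
  open import Relation.Binary.PropositionalEquality
  open import Relation.Nullary using (yes; no; contradiction)
  import Tactic.RingSolver.Core.AlmostCommutativeRing as ACR
  open import Tactic.RingSolver using (solve-∀)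
  open FieldProperties K _≟_
  open VectorSpaces K _≟_ using (_⊕v_; _·v_)
  open ≡-Reasoning

  -- c₀ + c₁ X + … + c_d X^d is represented by c₀ ∷ c₁ ∷ … ∷ c_d.
  eval : ∀ {n} → Vec Carrier n → Carrier → Carrier
  eval []       x = 0#
  eval (c ∷ cs) x = c + x * eval cs x

  leading : ∀ {d} → Vec Carrier (suc d) → Carrier
  leading (c ∷ [])      = c
  leading (_ ∷ c ∷ cs)  = leading (c ∷ cs)

  leading-∷ : ∀ {d} c (cs : Vec Carrier (suc d)) → leading (c ∷ cs) ≡ leading cs
  leading-∷ c (_ ∷ _) = refl

  divByRoot : ∀ {d} → Carrier → Vec Carrier (suc d) → Vec Carrier d
  divByRoot {zero}  a (c ∷ [])  = []
  divByRoot {suc d} a (c ∷ cs)  = eval cs a ∷ divByRoot a cs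

  private
    c+x*0≡c : ∀ c x → c + x * 0# ≡ c
    c+x*0≡c c x = trans (cong (c +_) (zeroʳ x)) (+-identityʳ c)

    x-a+a≡x : ∀ x a → (x + - a) + a ≡ x
    x-a+a≡x x a = trans (+-assoc x (- a) a) (trans (cong (x +_) (-‿inverseˡ a)) (+-identityʳ x))

    commRing : ACR.AlmostCommutativeRing _ _
    commRing = ACR.fromCommutativeRing commutativeRing (λ _ → nothing)

    module HornerStep where
      open ACR.AlmostCommutativeRing commRing using () renaming (_+_ to _⊞_; _*_ to _⊠_)
      horner-step : ∀ c D a Q r →
        c ⊞ ((D ⊞ a) ⊠ ((D ⊠ Q) ⊞ r)) ≡ (D ⊠ (r ⊞ ((D ⊞ a) ⊠ Q))) ⊞ (c ⊞ (a ⊠ r))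
      horner-step = solve-∀ commRing

    horner-step : ∀ c D a Q r → c + (D + a) * (D * Q + r) ≡ D * (r + (D + a) * Q) + (c + a * r)
    horner-step = HornerStep.horner-step

  eval-divByRoot : ∀ {d} a (cs : Vec Carrier (suc d)) x →
                   eval cs x ≡ (x + - a) * eval (divByRoot a cs) x + eval cs a
  eval-divByRoot {zero} a (c ∷ []) x = begin
    c + x * 0#                        ≡⟨ c+x*0≡c c x ⟩
    c                                 ≡⟨ sym (c+x*0≡c c a) ⟩
    c + a * 0#                        ≡⟨ sym (+-identityˡ _) ⟩
    0# + (c + a * 0#)                 ≡⟨ cong (_+ (c + a * 0#)) (sym (zeroʳ _)) ⟩
    (x + - a) * 0# + (c + a * 0#)     ∎
  eval-divByRoot {suc d} a (c ∷ cs) x = begin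
    c + x * eval cs x                              ≡⟨ cong (λ z → c + x * z) (eval-divByRoot a cs x) ⟩
    c + x * (D * Q + r)                            ≡⟨ cong (λ z → c + z * (D * Q + r)) (sym (x-a+a≡x x a)) ⟩
    c + (D + a) * (D * Q + r)                      ≡⟨ horner-step c D a Q r ⟩
    D * (r + (D + a) * Q) + (c + a * r)            ≡⟨ cong (λ z → D * (r + z * Q) + (c + a * r)) (x-a+a≡x x a) ⟩
    D * (r + x * Q) + (c + a * r)                  ∎
    where
      D Q r : Carrier
      D = x + - a
      Q = eval (divByRoot a cs) x
      r = eval cs a

  leading-divByRoot : ∀ {d} a (cs : Vec Carrier (suc (suc d))) → leading (divByRoot a cs) ≡ leading cs
  leading-divByRoot {zero}  a (c ∷ c₁ ∷ [])  = c+x*0≡c c₁ a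
  leading-divByRoot {suc d} a (c ∷ c₁ ∷ cs)  =
    trans (leading-∷ (eval (c₁ ∷ cs) a) (divByRoot a (c₁ ∷ cs))) (leading-divByRoot a (c₁ ∷ cs))

  roots≤degree : ∀ d (cs : Vec Carrier (suc d)) → leading cs ≢ 0# → (rs : List Carrier) → Unique rs →
                 (∀ r → r ∈ rs → eval cs r ≡ 0#) → length rs ≤ d
  roots≤degree d       cs       _  []       _  _     = ℕ.z≤n
  roots≤degree zero    (c ∷ []) c≢0 (r ∷ _)  _  roots = contradiction (trans (sym (c+x*0≡c c r)) (roots r (here refl))) c≢0
  roots≤degree (suc d) cs       lc≢0 (a ∷ rs) (a∉rs ∷ rs!) roots =
    ℕ.s≤s (roots≤degree d (divByRoot a cs) (λ lq≡0 → lc≢0 (trans (sym (leading-divByRoot a cs)) lq≡0)) rs rs! roots′)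
    where
      roots′ : ∀ r → r ∈ rs → eval (divByRoot a cs) r ≡ 0#
      roots′ r r∈rs with (r + - a) ≟ 0#
      ... | yes r-a≡0 = contradiction (sym (x∙y⁻¹≈ε⇒x≈y r a r-a≡0)) (All.lookup a∉rs r∈rs)
      ... | no  r-a≢0 = *-cancelˡ-nonZero _ 0# r-a≢0 (begin
        (r + - a) * eval (divByRoot a cs) r                  ≡⟨ sym (+-identityʳ _) ⟩
        (r + - a) * eval (divByRoot a cs) r + 0#             ≡⟨ cong ((r + - a) * eval (divByRoot a cs) r +_) (sym (roots a (here refl))) ⟩
        (r + - a) * eval (divByRoot a cs) r + eval cs a      ≡⟨ sym (eval-divByRoot a cs r) ⟩
        eval cs r                                            ≡⟨ roots r (there r∈rs) ⟩
        0#                                                   ≡⟨ sym (zeroʳ _) ⟩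
        (r + - a) * 0#                                       ∎)

  monomial : (d n : ℕ) → Vec Carrier (suc d)
  monomial d       zero    = 1# ∷ replicate d 0#
  monomial zero    (suc n) = 0# ∷ []
  monomial (suc d) (suc n) = 0# ∷ monomial d n

  eval-0s : ∀ d x → eval (replicate d 0#) x ≡ 0#
  eval-0s zero    x = refl
  eval-0s (suc d) x = trans (cong (λ z → 0# + x * z) (eval-0s d x)) (trans (+-identityˡ _) (zeroʳ x))

  leading-0s : ∀ d → leading (replicate (suc d) 0#) ≡ 0#
  leading-0s zero    = refl
  leading-0s (suc d) = leading-0s d

  eval-monomial : ∀ d n x → n ≤ d → eval (monomial d n) x ≡ x ^ n
  eval-monomial d       zero    x _           = trans (cong (λ z → 1# + x * z) (eval-0s d x)) (c+x*0≡c 1# x)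
  eval-monomial (suc d) (suc n) x (ℕ.s≤s n≤d) = trans (+-identityˡ _) (cong (x *_) (eval-monomial d n x n≤d))

  leading-monomial-< : ∀ d n → n < d → leading (monomial d n) ≡ 0#
  leading-monomial-< (suc d) zero    _             = leading-0s d
  leading-monomial-< (suc d) (suc n) (ℕ.s≤s n<d)   = trans (leading-∷ 0# (monomial d n)) (leading-monomial-< d n n<d)

  leading-monomial-≡ : ∀ d → leading (monomial d d) ≡ 1#
  leading-monomial-≡ zero    = refl
  leading-monomial-≡ (suc d) = trans (leading-∷ 0# (monomial d d)) (leading-monomial-≡ d)

  eval-⊕v : ∀ {n} (u v : Vec Carrier n) x → eval (u ⊕v v) x ≡ eval u x + eval v x
  eval-⊕v []      []      x = sym (+-identityˡ 0#)
  eval-⊕v (a ∷ u) (b ∷ v) x = begin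
    (a + b) + x * eval (u ⊕v v) x                ≡⟨ cong (λ z → (a + b) + x * z) (eval-⊕v u v x) ⟩
    (a + b) + x * (eval u x + eval v x)          ≡⟨ cong ((a + b) +_) (distribˡ x _ _) ⟩
    (a + b) + (x * eval u x + x * eval v x)      ≡⟨ +-interchange a b _ _ ⟩
    (a + x * eval u x) + (b + x * eval v x)      ∎

  leading-⊕v : ∀ {d} (u v : Vec Carrier (suc d)) → leading (u ⊕v v) ≡ leading u + leading v
  leading-⊕v (a ∷ [])     (b ∷ [])     = refl
  leading-⊕v (_ ∷ a ∷ u)  (_ ∷ b ∷ v)  = leading-⊕v (a ∷ u) (b ∷ v)

  eval-·v : ∀ {n} c (u : Vec Carrier n) x → eval (c ·v u) x ≡ c * eval u x
  eval-·v c []      x = sym (zeroʳ c)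
  eval-·v c (a ∷ u) x = begin
    c * a + x * eval (c ·v u) x      ≡⟨ cong (λ z → c * a + x * z) (eval-·v c u x) ⟩
    c * a + x * (c * eval u x)       ≡⟨ cong (c * a +_) (x*[c*y]≡c*[x*y]) ⟩
    c * a + c * (x * eval u x)       ≡⟨ sym (distribˡ c a _) ⟩
    c * (a + x * eval u x)           ∎
    where
      x*[c*y]≡c*[x*y] : x * (c * eval u x) ≡ c * (x * eval u x)
      x*[c*y]≡c*[x*y] = trans (sym (*-assoc x c _)) (trans (cong (_* eval u x) (*-comm x c)) (*-assoc c x _))

  leading-·v : ∀ {d} c (u : Vec Carrier (suc d)) → leading (c ·v u) ≡ c * leading u
  leading-·v c (a ∷ [])     = refl
  leading-·v c (_ ∷ a ∷ u)  = leading-·v c (a ∷ u)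

module FiniteSubfieldPowers (K : Field) (_≟_ : Relation.Binary.DecidableEquality (Field.Carrier K))
  {S : Field.Carrier K → Set} (SF : FieldTheory.IsSubfield K S) {s : ℕ} (hS : HasCount S s) where

  import Data.Nat as ℕ
  open import Data.Nat using (suc)
  import Data.Nat.Properties as ℕ
  open import Data.Product as Product using (_,_; proj₂)
  open import Data.List using (List; []; _∷_; map; length; foldr)
  open import Data.List.Relation.Unary.Any using (here; there)
  open import Data.List.Membership.Propositional using (_∈_)
  open import Relation.Binary.PropositionalEquality
  open import Relation.Nullary using (yes; no)
  open FieldProperties K _≟_
  open import Algebra.Properties.Semiring.Mult semiring using (_×_)
  open import Algebra.Bundles using (CommutativeRing)
  open CommutativeRing commutativeRing using (+-isCommutativeMonoid; *-isCommutativeMonoid)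
  open SubfieldClosure K SF
  open FiniteSubfieldSpan K _≟_ (VectorSpaces.scalars-laws K _≟_) SF hS using (⁻¹-closed; 2≤s)
  open Counting
  open ≡-Reasoning

  private
    sum product : List Carrier → Carrier
    sum     = foldr _+_ 0#
    product = foldr _*_ 1#

    sum-map-+1 : ∀ xs → sum (map (_+ 1#) xs) ≡ sum xs + (length xs × 1#)
    sum-map-+1 []       = sym (+-identityʳ 0#)
    sum-map-+1 (x ∷ xs) = trans (cong ((x + 1#) +_) (sum-map-+1 xs)) (+-interchange x 1# _ _)

    product-map-* : ∀ a xs → product (map (a *_) xs) ≡ a ^ length xs * product xs
    product-map-* a []       = sym (*-identityˡ 1#)
    product-map-* a (x ∷ xs) = trans (cong ((a * x) *_) (product-map-* a xs)) (*-interchange a x _ _)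

    product-nonZero : ∀ xs → (∀ z → z ∈ xs → z ≢ 0#) → product xs ≢ 0#
    product-nonZero []       _       = 1≢0
    product-nonZero (x ∷ xs) nonZero = *-nonZero (nonZero x (here refl)) (product-nonZero xs (λ z z∈ → nonZero z (there z∈)))

  -- Translation by 1 permutes S, so it does not change the sum of S.
  size×1≡0 : s × 1# ≡ 0#
  size×1≡0 = +-cancelˡ (sum xs) _ _ (begin
    sum xs + s × 1#                  ≡⟨ cong (λ n → sum xs + n × 1#) (sym (length-members hS)) ⟩
    sum xs + length xs × 1#          ≡⟨ sym (sum-map-+1 xs) ⟩
    sum (map (_+ 1#) xs)             ≡⟨ fold-map-bijection +-isCommutativeMonoid hS (_+ 1#) (_+ - 1#)
                                          (λ _ Sx → +-closed Sx 1∈) (λ _ Sx → +-closed Sx (-‿closed 1∈))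
                                          (λ x → x-1+1≡x x) (λ x → x+1-1≡x x) ⟩
    sum xs                           ≡⟨ sym (+-identityʳ _) ⟩
    sum xs + 0#                      ∎)
    where
      xs : List Carrier
      xs = members hS
      x-1+1≡x : ∀ x → (x + - 1#) + 1# ≡ x
      x-1+1≡x x = trans (+-assoc x _ _) (trans (cong (x +_) (-‿inverseˡ 1#)) (+-identityʳ x))
      x+1-1≡x : ∀ x → (x + 1#) + - 1# ≡ x
      x+1-1≡x x = trans (+-assoc x _ _) (trans (cong (x +_) (-‿inverseʳ 1#)) (+-identityʳ x))

  -- Multiplication by a ≠ 0 permutes S ∖ {0}, so a^(s-1) times their product is their product.
  x^size≡x : ∀ a → S a → a ^ s ≡ a
  x^size≡x a Sa = subst (λ n → a ^ n ≡ a) (ℕ.m+[n∸m]≡n (ℕ.≤-trans (ℕ.s≤s ℕ.z≤n) 2≤s)) a^1+[s-1]≡a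
    where
      hNonZero : HasCount (λ x → S x Product.× x ≢ 0#) (s ℕ.∸ 1)
      hNonZero = delete-count _≟_ hS 0∈
      ys : List Carrier
      ys = members hNonZero
      P≢0 : product ys ≢ 0#
      P≢0 = product-nonZero ys (λ z z∈ → proj₂ (members⇒ hNonZero z z∈))
      a^1+[s-1]≡a : a ^ suc (s ℕ.∸ 1) ≡ a
      a^1+[s-1]≡a with a ≟ 0#
      ... | yes refl = zeroˡ _
      ... | no  a≢0  = trans (cong (a *_) a^[s-1]≡1) (*-identityʳ a)
        where
          a⁻¹a≡1 : a ⁻¹ * a ≡ 1#
          a⁻¹a≡1 = x⁻¹*x≡1 a≢0
          a^[s-1]≡1 : a ^ (s ℕ.∸ 1) ≡ 1#
          a^[s-1]≡1 = *-cancelˡ-nonZero _ _ P≢0 (begin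
            product ys * a ^ (s ℕ.∸ 1)          ≡⟨ *-comm _ _ ⟩
            a ^ (s ℕ.∸ 1) * product ys          ≡⟨ cong (λ n → a ^ n * product ys) (sym (length-members hNonZero)) ⟩
            a ^ length ys * product ys          ≡⟨ sym (product-map-* a ys) ⟩
            product (map (a *_) ys)             ≡⟨ fold-map-bijection *-isCommutativeMonoid hNonZero (a *_) (a ⁻¹ *_)
                                                     (λ _ (Sx , x≢0) → *-closed Sa Sx , *-nonZero a≢0 x≢0)
                                                     (λ _ (Sx , x≢0) → *-closed (⁻¹-closed Sa) Sx , *-nonZero (⁻¹-nonZero a≢0) x≢0)
                                                     (λ x → trans (sym (*-assoc a _ x)) (trans (cong (_* x) (x*x⁻¹≡1 a≢0)) (*-identityˡ x)))
                                                     (λ x → trans (sym (*-assoc _ a x)) (trans (cong (_* x) a⁻¹a≡1) (*-identityˡ x))) ⟩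
            product ys                          ≡⟨ sym (*-identityʳ _) ⟩
            product ys * 1#                     ∎)

module Frobenius (K : Field) (_≟_ : Relation.Binary.DecidableEquality (Field.Carrier K)) where

  open import Data.Nat as ℕ using (zero; suc; _<_; s≤s)
  import Data.Nat.Properties as ℕ
  open import Data.Nat.Primality using (Prime)
  open import Data.Nat.Combinatorics using (nCn≡1; _C_)
  open import Data.Nat.Divisibility using (divides)
  open import Data.Fin using (Fin; toℕ; fromℕ; inject₁)
  import Data.Fin.Properties as Fin
  import Algebra.Properties.CommutativeSemiring.Binomial as Binomial
  import Algebra.Properties.Monoid.Sum as MonoidSum
  open import Relation.Binary.PropositionalEquality
  open FieldProperties K _≟_
  open import Algebra.Properties.Semiring.Mult semiring using (_×_; ×-homo-1; ×-assoc-*; ×1-homo-*)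
  open Binomial commutativeSemiring using (theorem; binomialTerm)
  open import Algebra.Bundles using (CommutativeSemiring)
  open MonoidSum (CommutativeSemiring.+-monoid commutativeSemiring) using (sum; sum-init-last; sum-cong-≗; sum-replicate-zero)
  open PrimeBinomial
  open ≡-Reasoning

  freshman's-dream : ∀ x y r → (∀ k → 0 < k → k < suc r → (suc r C k) × 1# ≡ 0#) →
                     (x + y) ^ suc r ≡ x ^ suc r + y ^ suc r
  freshman's-dream x y r binomial≡0 = begin
    (x + y) ^ n                                                          ≡⟨ ^≗^′ (x + y) n ⟩
    (x + y) ^′ n                                                         ≡⟨ theorem n x y ⟩
    t Fin.zero + sum (λ i → t (Fin.suc i))                               ≡⟨ cong (t Fin.zero +_) (sum-init-last (λ i → t (Fin.suc i))) ⟩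
    t Fin.zero + (sum (λ i → t (Fin.suc (inject₁ i))) + t (fromℕ n))     ≡⟨ cong (λ z → t Fin.zero + (z + t (fromℕ n)))
                                                                              (trans (sum-cong-≗ middle≡0) (sum-replicate-zero r)) ⟩
    t Fin.zero + (0# + t (fromℕ n))                                      ≡⟨ cong₂ _+_ first (trans (+-identityˡ _) last) ⟩
    y ^ n + x ^ n                                                        ≡⟨ +-comm _ _ ⟩
    x ^ n + y ^ n                                                        ∎
    where
      n : ℕ
      n = suc r
      t : Fin (suc n) → Carrier
      t = binomialTerm x y n
      first : t Fin.zero ≡ y ^ n
      first = trans (×-homo-1 _) (trans (*-identityˡ _) (sym (^≗^′ y n)))
      last : t (fromℕ n) ≡ x ^ n
      last = begin
        (n C toℕ (fromℕ n)) × (x ^′ toℕ (fromℕ n) * y ^′ (n ℕ.∸ toℕ (fromℕ n)))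
          ≡⟨ cong (λ k → (n C k) × (x ^′ k * y ^′ (n ℕ.∸ k))) (Fin.toℕ-fromℕ n) ⟩
        (n C n) × (x ^′ n * y ^′ (n ℕ.∸ n))  ≡⟨ cong₂ (λ c d → c × (x ^′ n * y ^′ d)) (nCn≡1 n) (ℕ.n∸n≡0 n) ⟩
        1 × (x ^′ n * 1#)                    ≡⟨ ×-homo-1 _ ⟩
        x ^′ n * 1#                          ≡⟨ *-identityʳ _ ⟩
        x ^′ n                               ≡⟨ sym (^≗^′ x n) ⟩
        x ^ n                                ∎
      middle≡0 : ∀ i → t (Fin.suc (inject₁ i)) ≡ 0#
      middle≡0 i = begin
        (n C k) × z            ≡⟨ cong ((n C k) ×_) (sym (*-identityˡ z)) ⟩
        (n C k) × (1# * z)     ≡⟨ sym (×-assoc-* (n C k) 1# z) ⟩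
        ((n C k) × 1#) * z     ≡⟨ cong (_* z) (binomial≡0 k (s≤s ℕ.z≤n) k<n) ⟩
        0# * z                 ≡⟨ zeroˡ z ⟩
        0#                     ∎
        where
          k : ℕ
          k = suc (toℕ (inject₁ i))
          k<n : k < n
          k<n = s≤s (subst (_< r) (sym (Fin.toℕ-inject₁ i)) (Fin.toℕ<n i))
          z : Carrier
          z = x ^′ k * y ^′ (n ℕ.∸ k)

  frobenius : ∀ {p} → Prime p → p × 1# ≡ 0# → ∀ x y → (x + y) ^ p ≡ x ^ p + y ^ p
  frobenius {zero}  p-prime with () ← prime≥2 p-prime
  frobenius {suc r} p-prime p×1≡0 x y = freshman's-dream x y r binomial≡0
    where
      binomial≡0 : ∀ k → 0 < k → k < suc r → (suc r C k) × 1# ≡ 0#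
      binomial≡0 k 0<k k<p with divides c p∣pCk ← prime∣binomial p-prime k 0<k k<p = begin
        (suc r C k) × 1#               ≡⟨ cong (_× 1#) p∣pCk ⟩
        (c ℕ.* suc r) × 1#             ≡⟨ ×1-homo-* c (suc r) ⟩
        (c × 1#) * (suc r × 1#)        ≡⟨ cong ((c × 1#) *_) p×1≡0 ⟩
        (c × 1#) * 0#                  ≡⟨ zeroʳ _ ⟩
        0#                             ∎

  frobenius-^ : ∀ {p} → Prime p → p × 1# ≡ 0# → ∀ j x y → (x + y) ^ (p ℕ.^ j) ≡ x ^ (p ℕ.^ j) + y ^ (p ℕ.^ j)
  frobenius-^ p-prime p×1≡0 zero    x y = trans (*-identityʳ _) (cong₂ _+_ (sym (*-identityʳ x)) (sym (*-identityʳ y)))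
  frobenius-^ {p} p-prime p×1≡0 (suc j) x y = begin
    (x + y) ^ (p ℕ.* p ℕ.^ j)                   ≡⟨ sym (^-assocʳ (x + y) p (p ℕ.^ j)) ⟩
    ((x + y) ^ p) ^ (p ℕ.^ j)                   ≡⟨ cong (_^ (p ℕ.^ j)) (frobenius p-prime p×1≡0 x y) ⟩
    (x ^ p + y ^ p) ^ (p ℕ.^ j)                 ≡⟨ frobenius-^ p-prime p×1≡0 j (x ^ p) (y ^ p) ⟩
    (x ^ p) ^ (p ℕ.^ j) + (y ^ p) ^ (p ℕ.^ j)   ≡⟨ cong₂ _+_ (^-assocʳ x p (p ℕ.^ j)) (^-assocʳ y p (p ℕ.^ j)) ⟩
    x ^ (p ℕ.* p ℕ.^ j) + y ^ (p ℕ.* p ℕ.^ j)   ∎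

record FieldExtension : Set₁ where
  field
    q p e m    : ℕ
    p-prime    : Prime p
    q≡p^e      : q ≡ p Nat.^ e
    1≤m        : 1 Nat.≤ m
    K          : Field
    |K|        : HasCount (λ (_ : Field.Carrier K) → ⊤) (q Nat.^ m)
    F          : Field.Carrier K → Set
    F-subfield : FieldTheory.IsSubfield K F
    |F|        : HasCount F q

module FiniteExtension (X : FieldExtension) where

  open FieldExtension X
  open import Data.Nat as ℕ using (zero; suc; _≤_; z≤n; s≤s)
  import Data.Nat.Properties as ℕ
  open import Data.Product using (Σ; _,_)
  open import Data.Unit using (tt)
  open import Data.List using (_∷_)
  open import Data.List.Relation.Unary.Any using (here; there)
  open import Data.List.Relation.Unary.All as All using ()
  open import Data.List.Relation.Unary.AllPairs using (_∷_)
  open import Data.List.Membership.Propositional using (_∈_)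
  open import Data.Vec using (Vec; replicate)
  open import Relation.Binary.PropositionalEquality
  open import Relation.Nullary using (yes; no; contradiction)
  open Counting

  _≟_ : Relation.Binary.DecidableEquality (Field.Carrier K)
  _≟_ = universe-decEq |K|

  open FieldProperties K _≟_ public
  open import Algebra.Properties.Semiring.Mult semiring using (_×_; ×1-homo-*)
  open SubfieldClosure K F-subfield public
  open FieldTheory K public using (Tr)
  open FiniteSubfieldSpan K _≟_ (VectorSpaces.scalars-laws K _≟_) F-subfield |F| public using (2≤s)
  open Polynomials K _≟_
  open VectorSpaces K _≟_ using (_⊕v_; _·v_)
  open ≡-Reasoning

  2≤q : 2 ≤ q
  2≤q = 2≤s

  p×1≡0 : p × 1# ≡ 0#
  p×1≡0 with (p × 1#) ≟ 0#
  ... | yes p×1≡0 = p×1≡0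
  ... | no  p×1≢0 = contradiction (begin
      (p × 1#) ^ e  ≡⟨ sym (power×1 e) ⟩
      (p ℕ.^ e) × 1# ≡⟨ cong (_× 1#) (sym q≡p^e) ⟩
      q × 1#        ≡⟨ FiniteSubfieldPowers.size×1≡0 K _≟_ F-subfield |F| ⟩
      0#            ∎) (^-nonZero e p×1≢0)
    where
      power×1 : ∀ j → (p ℕ.^ j) × 1# ≡ (p × 1#) ^ j
      power×1 zero    = +-identityʳ 1#
      power×1 (suc j) = trans (×1-homo-* p (p ℕ.^ j)) (cong ((p × 1#) *_) (power×1 j))

  frobenius-q^ : ∀ j x y → (x + y) ^ (q ℕ.^ j) ≡ x ^ (q ℕ.^ j) + y ^ (q ℕ.^ j)
  frobenius-q^ j x y rewrite q≡p^e | ℕ.^-*-assoc p e j = Frobenius.frobenius-^ K _≟_ p-prime p×1≡0 (e ℕ.* j) x y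

  x^q≡x : ∀ a → F a → a ^ q ≡ a
  x^q≡x = FiniteSubfieldPowers.x^size≡x K _≟_ F-subfield |F|

  K-subfield : FieldTheory.IsSubfield K (λ _ → ⊤)
  K-subfield = tt , tt , (λ _ _ _ _ → tt) , (λ _ _ _ _ → tt) , (λ _ _ → tt) , (λ _ _ _ _ → tt)

  x^q^m≡x : ∀ a → a ^ (q ℕ.^ m) ≡ a
  x^q^m≡x a = FiniteSubfieldPowers.x^size≡x K _≟_ K-subfield |K| a tt

  x^q^j≡x : ∀ j a → F a → a ^ (q ℕ.^ j) ≡ a
  x^q^j≡x zero    a Fa = *-identityʳ a
  x^q^j≡x (suc j) a Fa = begin
    a ^ (q ℕ.* q ℕ.^ j)    ≡⟨ sym (^-assocʳ a q (q ℕ.^ j)) ⟩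
    (a ^ q) ^ (q ℕ.^ j)    ≡⟨ cong (_^ (q ℕ.^ j)) (x^q≡x a Fa) ⟩
    a ^ (q ℕ.^ j)          ≡⟨ x^q^j≡x j a Fa ⟩
    a                      ∎

  -- F supplies q roots of X^q - X, which has no others.
  x^q≡x⇒∈F : ∀ y → y ^ q ≡ y → F y
  x^q≡x⇒∈F y y^q≡y with count-dec |F| _≟_ y
  ... | yes Fy = Fy
  ... | no ¬Fy = contradiction (roots≤degree q Xq-X leading≢0 (y ∷ members |F|) (y∉F ∷ members-unique |F|) roots)
                               (ℕ.<⇒≱ (s≤s (ℕ.≤-reflexive (sym (length-members |F|)))))
    where
      Xq-X : Vec Carrier (suc q)
      Xq-X = monomial q q ⊕v ((- 1#) ·v monomial q 1)
      1≤q : 1 ≤ q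
      1≤q = ℕ.≤-trans (s≤s z≤n) 2≤q
      root : ∀ x → x ^ q ≡ x → eval Xq-X x ≡ 0#
      root x x^q≡x′ = begin
        eval Xq-X x                                                 ≡⟨ eval-⊕v (monomial q q) _ x ⟩
        eval (monomial q q) x + eval ((- 1#) ·v monomial q 1) x     ≡⟨ cong₂ _+_ (eval-monomial q q x ℕ.≤-refl)
                                                                        (eval-·v (- 1#) (monomial q 1) x) ⟩
        x ^ q + (- 1#) * eval (monomial q 1) x                      ≡⟨ cong₂ (λ a b → a + (- 1#) * b) x^q≡x′ (eval-monomial q 1 x 1≤q) ⟩
        x + (- 1#) * (x * 1#)                                       ≡⟨ cong (λ z → x + (- 1#) * z) (*-identityʳ x) ⟩
        x + (- 1#) * x                                              ≡⟨ cong (x +_) (-1*x≈-x x) ⟩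
        x + - x                                                     ≡⟨ -‿inverseʳ x ⟩
        0#                                                          ∎
      leading≢0 : leading Xq-X ≢ 0#
      leading≢0 leading≡0 = 1≢0 (begin
        1#                                                          ≡⟨ sym (+-identityʳ 1#) ⟩
        1# + 0#                                                     ≡⟨ cong (1# +_) (sym (zeroʳ (- 1#))) ⟩
        1# + (- 1#) * 0#                                            ≡⟨ sym (cong₂ (λ a b → a + (- 1#) * b) (leading-monomial-≡ q) (leading-monomial-< q 1 2≤q)) ⟩
        leading (monomial q q) + (- 1#) * leading (monomial q 1)    ≡⟨ cong (leading (monomial q q) +_) (sym (leading-·v (- 1#) (monomial q 1))) ⟩
        leading (monomial q q) + leading ((- 1#) ·v monomial q 1)   ≡⟨ sym (leading-⊕v (monomial q q) _) ⟩
        leading Xq-X                                                ≡⟨ leading≡0 ⟩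
        0#                                                          ∎)
      y∉F : All.All (y ≢_) (members |F|)
      y∉F = All.tabulate (λ {z} z∈F y≡z → ¬Fy (subst F (sym y≡z) (members⇒ |F| z z∈F)))
      roots : ∀ r → r ∈ y ∷ members |F| → eval Xq-X r ≡ 0#
      roots r (here refl)  = root r y^q≡y
      roots r (there r∈F)  = root r (x^q≡x r (members⇒ |F| r r∈F))

  Tr-homo-+ : ∀ j x y → Tr q j (x + y) ≡ Tr q j x + Tr q j y
  Tr-homo-+ zero    x y = sym (+-identityˡ 0#)
  Tr-homo-+ (suc j) x y = trans (cong₂ _+_ (Tr-homo-+ j x y) (frobenius-q^ j x y)) (+-interchange _ _ _ _)

  Tr-0 : ∀ j → Tr q j 0# ≡ 0#
  Tr-0 j = x+x≈x⇒x≈0 _ (trans (sym (Tr-homo-+ j 0# 0#)) (cong (Tr q j) (+-identityˡ 0#)))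

  Tr-homo-* : ∀ j {a} x → F a → Tr q j (a * x) ≡ a * Tr q j x
  Tr-homo-* zero    {a} x Fa = sym (zeroʳ a)
  Tr-homo-* (suc j) {a} x Fa = begin
    Tr q j (a * x) + (a * x) ^ (q ℕ.^ j)          ≡⟨ cong₂ _+_ (Tr-homo-* j x Fa) (^-distrib-* a x (q ℕ.^ j)) ⟩
    a * Tr q j x + a ^ (q ℕ.^ j) * x ^ (q ℕ.^ j)  ≡⟨ cong (λ b → a * Tr q j x + b * x ^ (q ℕ.^ j)) (x^q^j≡x j a Fa) ⟩
    a * Tr q j x + a * x ^ (q ℕ.^ j)              ≡⟨ sym (distribˡ a _ _) ⟩
    a * (Tr q j x + x ^ (q ℕ.^ j))                ∎

  private
    m-1 : ℕ
    m-1 = ℕ.pred m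

    1+[m-1]≡m : suc m-1 ≡ m
    1+[m-1]≡m = ℕ.suc-pred m {{ℕ.>-nonZero 1≤m}}

    -- Tr′ j x = x^q + … + x^(q^j), so that (Tr j x)^q = Tr′ j x.
    Tr′ : ℕ → Carrier → Carrier
    Tr′ zero    x = 0#
    Tr′ (suc j) x = Tr′ j x + x ^ (q ℕ.^ suc j)

    Tr^q : ∀ j x → (Tr q j x) ^ q ≡ Tr′ j x
    Tr^q zero    x = subst (λ n → 0# ^ n ≡ 0#) (ℕ.suc-pred q {{ℕ.>-nonZero (ℕ.≤-trans (s≤s z≤n) 2≤q)}}) (zeroˡ _)
    Tr^q (suc j) x = begin
      (Tr q j x + x ^ (q ℕ.^ j)) ^ q              ≡⟨ trans (cong (λ n → (Tr q j x + x ^ (q ℕ.^ j)) ^ n) (sym (ℕ.*-identityʳ q)))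
                                                          (frobenius-q^ 1 _ _) ⟩
      (Tr q j x) ^ (q ℕ.* 1) + (x ^ (q ℕ.^ j)) ^ (q ℕ.* 1)
                                                  ≡⟨ cong₂ (λ n k → (Tr q j x) ^ n + (x ^ (q ℕ.^ j)) ^ k) (ℕ.*-identityʳ q) (ℕ.*-identityʳ q) ⟩
      (Tr q j x) ^ q + (x ^ (q ℕ.^ j)) ^ q        ≡⟨ cong₂ _+_ (Tr^q j x) (^-assocʳ x (q ℕ.^ j) q) ⟩
      Tr′ j x + x ^ (q ℕ.^ j ℕ.* q)               ≡⟨ cong (λ n → Tr′ j x + x ^ n) (ℕ.*-comm (q ℕ.^ j) q) ⟩
      Tr′ j x + x ^ (q ℕ.^ suc j)                 ∎

    Tr-suc : ∀ j x → Tr q (suc j) x ≡ x + Tr′ j x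
    Tr-suc zero    x = trans (+-identityˡ _) (trans (*-identityʳ x) (sym (+-identityʳ x)))
    Tr-suc (suc j) x = trans (cong (_+ x ^ (q ℕ.^ suc j)) (Tr-suc j x)) (+-assoc _ _ _)

  -- (Tr x)^q = Tr (x^q) = Tr x because x^(q^m) = x.
  Tr∈F : ∀ x → F (Tr q m x)
  Tr∈F x = x^q≡x⇒∈F (Tr q m x) (subst (λ n → (Tr q n x) ^ q ≡ Tr q n x) 1+[m-1]≡m (begin
    (Tr q (suc m-1) x) ^ q             ≡⟨ Tr^q (suc m-1) x ⟩
    Tr′ m-1 x + x ^ (q ℕ.^ suc m-1)    ≡⟨ cong (λ n → Tr′ m-1 x + x ^ (q ℕ.^ n)) 1+[m-1]≡m ⟩
    Tr′ m-1 x + x ^ (q ℕ.^ m)          ≡⟨ cong (Tr′ m-1 x +_) (x^q^m≡x x) ⟩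
    Tr′ m-1 x + x                      ≡⟨ +-comm _ _ ⟩
    x + Tr′ m-1 x                      ≡⟨ sym (Tr-suc m-1 x) ⟩
    Tr q (suc m-1) x                   ∎))

  -- Tr is a polynomial of degree q^(m-1) < q^m = |K|.
  Tr-nonZero : Σ Carrier λ t → Tr q m t ≢ 0#
  Tr-nonZero with partition-count |K| (λ t → Tr q m t ≟ 0#)
  ... | _ , suc _ , _ , hNonZero , _ with (t , _ , Tr≢0) ← count-nonempty hNonZero = t , Tr≢0
  ... | _ , zero  , _ , hNonZero , _ =
    contradiction (roots≤degree D (TrPoly (suc m-1)) leading≢0 (members |K|) (members-unique |K|) roots)
                  (ℕ.<⇒≱ (subst (D ℕ.<_) (sym (length-members |K|))
                     (subst (λ n → D ℕ.< q ℕ.^ n) 1+[m-1]≡m (ℕ.^-monoʳ-< q 2≤q (ℕ.n<1+n m-1)))))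
    where
      D : ℕ
      D = q ℕ.^ m-1
      TrPoly : ℕ → Vec Carrier (suc D)
      TrPoly zero    = replicate (suc D) 0#
      TrPoly (suc j) = TrPoly j ⊕v monomial D (q ℕ.^ j)
      eval-TrPoly : ∀ j x → j ≤ suc m-1 → eval (TrPoly j) x ≡ Tr q j x
      eval-TrPoly zero    x _         = eval-0s (suc D) x
      eval-TrPoly (suc j) x (s≤s j≤m) =
        trans (eval-⊕v (TrPoly j) _ x)
              (cong₂ _+_ (eval-TrPoly j x (ℕ.m≤n⇒m≤1+n j≤m))
                         (eval-monomial D (q ℕ.^ j) x (ℕ.^-monoʳ-≤ q {{ℕ.>-nonZero (ℕ.≤-trans (s≤s z≤n) 2≤q)}} j≤m)))
      leading-TrPoly : ∀ j → j ≤ m-1 → leading (TrPoly j) ≡ 0#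
      leading-TrPoly zero    _   = leading-0s D
      leading-TrPoly (suc j) j<m = trans (leading-⊕v (TrPoly j) _)
        (trans (cong₂ _+_ (leading-TrPoly j (ℕ.≤-trans (ℕ.n≤1+n j) j<m)) (leading-monomial-< D _ (ℕ.^-monoʳ-< q 2≤q j<m)))
               (+-identityˡ 0#))
      leading≢0 : leading (TrPoly (suc m-1)) ≢ 0#
      leading≢0 leading≡0 = 1≢0 (begin
        1#                                                    ≡⟨ sym (+-identityˡ 1#) ⟩
        0# + 1#                                               ≡⟨ sym (cong₂ _+_ (leading-TrPoly m-1 ℕ.≤-refl) (leading-monomial-≡ D)) ⟩
        leading (TrPoly m-1) + leading (monomial D D)         ≡⟨ sym (leading-⊕v (TrPoly m-1) _) ⟩
        leading (TrPoly (suc m-1))                            ≡⟨ leading≡0 ⟩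
        0#                                                    ∎)
      roots : ∀ r → r ∈ members |K| → eval (TrPoly (suc m-1)) r ≡ 0#
      roots r _ with Tr q m r ≟ 0#
      ... | yes Tr≡0 = trans (eval-TrPoly (suc m-1) r ℕ.≤-refl) (subst (λ n → Tr q n r ≡ 0#) (sym 1+[m-1]≡m) Tr≡0)
      ... | no  Tr≢0 = contradiction (tt , Tr≢0) (count-zero-empty hNonZero r)

module LinearFunctionals (X : FieldExtension) (k : ℕ) where

  open FieldExtension X
  open FiniteExtension X
  open import Data.Nat as ℕ using (zero; suc)
  import Data.Nat.Properties as ℕ
  open import Data.Product using (Σ; _×_; _,_; proj₁)
  open import Data.Unit using (tt)
  open import Data.Vec using (Vec; []; _∷_; replicate)
  import Data.Vec.Properties as Vec
  open import Data.Vec.Relation.Unary.All using (All; []; _∷_)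
  open import Relation.Binary.PropositionalEquality
  open import Relation.Nullary using (yes; no; contradiction)
  open VectorSpaces K _≟_ using (_⊕v_; _·v_; 0v; vecs-laws; module VSpaceLaws; module VSpaceProperties)
  open VSpaceLaws (vecs-laws k)
  open VSpaceProperties (vecs-laws k)
  open FiniteSubfieldSpan K _≟_ (vecs-laws k) F-subfield |F| using (⁻¹-closed)
  open Counting
  open ≡-Reasoning

  V : Set
  V = Vec Carrier k

  Subspace : (V → Set) → Set
  Subspace = FieldTheory.IsSubspace K (FieldTheory.vecs K k) F

  record FLinear : Set where
    field
      fn     : V → Carrier
      homo-⊕ : ∀ u v → fn (u ⊕v v) ≡ fn u + fn v
      homo-· : ∀ a v → F a → fn (a ·v v) ≡ a * fn v
      ∈F     : ∀ v → F (fn v)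

    fn-0v : fn 0v ≡ 0#
    fn-0v = trans (cong fn (sym (·-zeroˡ 0v))) (trans (homo-· 0# 0v 0∈) (zeroˡ _))

    fn-⊖ : ∀ v → fn (⊖ v) ≡ - fn v
    fn-⊖ v = trans (homo-· (- 1#) v (-‿closed 1∈)) (-1*x≈-x _)

  open FLinear public

  linear-combination : ∀ {d} (c : Vec Carrier d) → All F c → Vec FLinear d → FLinear
  linear-combination c Fc fs = record { fn = comb c fs ; homo-⊕ = comb-⊕ c fs ; homo-· = comb-· c Fc fs ; ∈F = comb-∈F c Fc fs }
    where
      comb : ∀ {d} → Vec Carrier d → Vec FLinear d → V → Carrier
      comb []       []       v = 0#
      comb (a ∷ c)  (f ∷ fs) v = a * fn f v + comb c fs v
      comb-⊕ : ∀ {d} (c : Vec Carrier d) fs u v → comb c fs (u ⊕v v) ≡ comb c fs u + comb c fs v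
      comb-⊕ []      []       u v = sym (+-identityˡ 0#)
      comb-⊕ (a ∷ c) (f ∷ fs) u v =
        trans (cong₂ _+_ (trans (cong (a *_) (homo-⊕ f u v)) (distribˡ a _ _)) (comb-⊕ c fs u v)) (+-interchange _ _ _ _)
      comb-· : ∀ {d} (c : Vec Carrier d) → All F c → ∀ fs b v → F b → comb c fs (b ·v v) ≡ b * comb c fs v
      comb-· []      []        []       b v Fb = sym (zeroʳ b)
      comb-· (a ∷ c) (Fa ∷ Fc) (f ∷ fs) b v Fb = begin
        a * fn f (b ·v v) + comb c fs (b ·v v)   ≡⟨ cong₂ _+_ (cong (a *_) (homo-· f b v Fb)) (comb-· c Fc fs b v Fb) ⟩
        a * (b * fn f v) + b * comb c fs v       ≡⟨ cong (_+ b * comb c fs v) (trans (sym (*-assoc a b _))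
                                                      (trans (cong (_* fn f v) (*-comm a b)) (*-assoc b a _))) ⟩
        b * (a * fn f v) + b * comb c fs v       ≡⟨ sym (distribˡ b _ _) ⟩
        b * (a * fn f v + comb c fs v)           ∎
      comb-∈F : ∀ {d} (c : Vec Carrier d) → All F c → ∀ fs v → F (comb c fs v)
      comb-∈F []      []        []       v = 0∈
      comb-∈F (a ∷ c) (Fa ∷ Fc) (f ∷ fs) v = +-closed (*-closed Fa (∈F f v)) (comb-∈F c Fc fs v)

  AllVanish : ∀ {d} → Vec FLinear d → V → Set
  AllVanish []       v = ⊤
  AllVanish (f ∷ fs) v = fn f v ≡ 0# × AllVanish fs v

  IndependentOn : ∀ {d} → (V → Set) → Vec FLinear d → Set
  IndependentOn {d} P fs = ∀ c Fc → (∀ v → P v → fn (linear-combination c Fc fs) v ≡ 0#) → c ≡ replicate d 0#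

  data VanishesOrHitsOne (P : V → Set) (f : FLinear) : Set where
    vanishes : (∀ v → P v → fn f v ≡ 0#) → VanishesOrHitsOne P f
    hitsOne  : ∀ w → P w → fn f w ≡ 1# → VanishesOrHitsOne P f

  vanishesOrHitsOne : ∀ {P a} → Subspace P → HasCount P a → ∀ f → VanishesOrHitsOne P f
  vanishesOrHitsOne {P} (_ , _ , P·) hP f with partition-count hP (λ v → fn f v ≟ 0#)
  ... | _ , zero , _ , hNonZero , _ = vanishes λ v Pv → case fn f v ≟ 0# of λ where
          (yes fv≡0) → fv≡0
          (no  fv≢0) → contradiction (Pv , fv≢0) (count-zero-empty hNonZero v)
    where open import Function using (case_of_)
  ... | _ , suc _ , _ , hNonZero , _ with (w , Pw , fw≢0) ← count-nonempty hNonZero =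
    hitsOne (fn f w ⁻¹ ·v w) (P· _ w (⁻¹-closed (∈F f w)) Pw)
            (trans (homo-· f _ w (⁻¹-closed (∈F f w))) (x⁻¹*x≡1 fw≢0))

  ker⊆ker⇒proportional : ∀ {P a} → Subspace P → HasCount P a → (f g : FLinear) →
                         (∀ v → P v → fn f v ≡ 0# → fn g v ≡ 0#) →
                         Σ Carrier λ c → F c × (∀ v → P v → fn g v ≡ c * fn f v)
  ker⊆ker⇒proportional {P} P-sub@(_ , P⊕ , P·) hP f g ker⊆ker with vanishesOrHitsOne P-sub hP f
  ... | vanishes f≡0 = 0# , 0∈ , λ v Pv → trans (ker⊆ker v Pv (f≡0 v Pv)) (sym (zeroˡ _))
  ... | hitsOne w Pw fw≡1 = fn g w , ∈F g w , λ v Pv → trans (x∙y⁻¹≈ε⇒x≈y _ _ (g-v-fv·w≡0 v Pv)) (*-comm _ _)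
    where
      g-v-fv·w≡0 : ∀ v → P v → fn g v + - (fn f v * fn g w) ≡ 0#
      g-v-fv·w≡0 v Pv = begin
        fn g v + - (fn f v * fn g w)         ≡⟨ cong (λ z → fn g v + - z) (sym (homo-· g _ w (∈F f v))) ⟩
        fn g v + - fn g (fn f v ·v w)        ≡⟨ cong (fn g v +_) (sym (fn-⊖ g _)) ⟩
        fn g v + fn g (⊖ (fn f v ·v w))      ≡⟨ sym (homo-⊕ g _ _) ⟩
        fn g (v ⊕v ⊖ (fn f v ·v w))          ≡⟨ ker⊆ker _ (P⊕ _ _ Pv (P· _ _ (-‿closed 1∈) (P· _ _ (∈F f v) Pw))) f-t≡0 ⟩
        0#                                   ∎
        where
          f-t≡0 : fn f (v ⊕v ⊖ (fn f v ·v w)) ≡ 0#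
          f-t≡0 = begin
            fn f (v ⊕v ⊖ (fn f v ·v w))      ≡⟨ homo-⊕ f _ _ ⟩
            fn f v + fn f (⊖ (fn f v ·v w))  ≡⟨ cong (fn f v +_) (fn-⊖ f _) ⟩
            fn f v + - fn f (fn f v ·v w)    ≡⟨ cong (λ z → fn f v + - z) (homo-· f _ w (∈F f v)) ⟩
            fn f v + - (fn f v * fn f w)     ≡⟨ cong (λ z → fn f v + - z) (trans (cong (fn f v *_) fw≡1) (*-identityʳ _)) ⟩
            fn f v + - fn f v                ≡⟨ -‿inverseʳ _ ⟩
            0#                               ∎

  -- Translation by a w maps the kernel of f onto its fibre over a.
  fibre≅kernel : ∀ {P} → Subspace P → (f : FLinear) → ∀ w → P w → fn f w ≡ 1# →
                 ∀ {b} → HasCount (λ v → P v × fn f v ≡ 0#) b → ∀ a → F a → HasCount (λ v → P v × fn f v ≡ a) b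
  fibre≅kernel {P} (_ , P⊕ , P·) f w Pw fw≡1 hKer a Fa =
    count-cong (λ { v (t , (Pt , ft≡0) , refl) → P⊕ _ _ Pt Paw , (begin
                    fn f (t ⊕v a ·v w)         ≡⟨ homo-⊕ f t _ ⟩
                    fn f t + fn f (a ·v w)     ≡⟨ cong₂ _+_ ft≡0 f-aw≡a ⟩
                    0# + a                     ≡⟨ +-identityˡ a ⟩
                    a                          ∎) })
               (λ v (Pv , fv≡a) → (v ⊕v ⊖ (a ·v w)) ,
                    (P⊕ _ _ Pv (P· _ _ (-‿closed 1∈) Paw) , (begin
                      fn f (v ⊕v ⊖ (a ·v w))       ≡⟨ homo-⊕ f _ _ ⟩
                      fn f v + fn f (⊖ (a ·v w))   ≡⟨ cong₂ _+_ fv≡a (trans (fn-⊖ f _) (cong -_ f-aw≡a)) ⟩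
                      a + - a                      ≡⟨ -‿inverseʳ a ⟩
                      0#                           ∎)) ,
                    ⊖-⊕-cancel v (a ·v w))
               (image-count (_⊕v a ·v w) hKer (λ x y _ _ → ⊕-cancelʳ _ x y))
    where
      Paw : P (a ·v w)
      Paw = P· a w Fa Pw
      f-aw≡a : fn f (a ·v w) ≡ a
      f-aw≡a = trans (homo-· f a w Fa) (trans (cong (a *_) fw≡1) (*-identityʳ a))

  count-commonKernel : ∀ {d} (fs : Vec FLinear d) {P} → Subspace P → ∀ {a b} → HasCount P a →
                       HasCount (λ v → P v × AllVanish fs v) b → IndependentOn P fs → a ≡ q ℕ.^ d ℕ.* b
  count-commonKernel [] _ hP hKer _ =
    trans (count-unique hP hKer (λ _ Pv → Pv , tt) (λ _ → proj₁)) (sym (ℕ.+-identityʳ _))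
  count-commonKernel {suc d} (f ∷ fs) {P} P-sub@(P0 , P⊕ , P·) {a} {b} hP hKer ind
    with partition-count hP (λ v → fn f v ≟ 0#)
  ... | b′ , _ , hKer-f , _ , _ with vanishesOrHitsOne P-sub hP f
  ...   | vanishes f≡0 = contradiction (Vec.∷-injectiveˡ (ind (1# ∷ replicate d 0#) (1∈ ∷ all-0∈ d) e₁-vanishes)) 1≢0
    where
      all-0∈ : ∀ n → All F (replicate n 0#)
      all-0∈ zero    = []
      all-0∈ (suc n) = 0∈ ∷ all-0∈ n
      comb-0 : ∀ {n} (gs : Vec FLinear n) v → fn (linear-combination (replicate n 0#) (all-0∈ n) gs) v ≡ 0#
      comb-0 []       v = refl
      comb-0 (g ∷ gs) v = trans (cong₂ _+_ (zeroˡ _) (comb-0 gs v)) (+-identityˡ 0#)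
      e₁-vanishes : ∀ v → P v → 1# * fn f v + _ ≡ 0#
      e₁-vanishes v Pv = trans (cong₂ _+_ (trans (*-identityˡ _) (f≡0 v Pv)) (comb-0 fs v)) (+-identityˡ 0#)
  ...   | hitsOne w Pw fw≡1 = begin
    a                          ≡⟨ fibre-count _≟_ (fn f) hP |F| (λ v _ → ∈F f v) (λ a Fa → fibre≅kernel P-sub f w Pw fw≡1 hKer-f a Fa) ⟩
    b′ ℕ.* q                   ≡⟨ cong (ℕ._* q) (count-commonKernel fs Ker-f-sub hKer-f hKer′ ind′) ⟩
    q ℕ.^ d ℕ.* b ℕ.* q        ≡⟨ ℕ.*-comm _ q ⟩
    q ℕ.* (q ℕ.^ d ℕ.* b)      ≡⟨ sym (ℕ.*-assoc q _ b) ⟩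
    q ℕ.^ suc d ℕ.* b          ∎
    where
      Ker-f : V → Set
      Ker-f v = P v × fn f v ≡ 0#
      Ker-f-sub : Subspace Ker-f
      Ker-f-sub = (P0 , fn-0v f)
        , (λ u v (Pu , fu≡0) (Pv , fv≡0) → P⊕ u v Pu Pv , trans (homo-⊕ f u v) (trans (cong₂ _+_ fu≡0 fv≡0) (+-identityˡ 0#)))
        , (λ c u Fc (Pu , fu≡0) → P· c u Fc Pu , trans (homo-· f c u Fc) (trans (cong (c *_) fu≡0) (zeroʳ c)))
      hKer′ : HasCount (λ v → Ker-f v × AllVanish fs v) b
      hKer′ = count-cong (λ v (Pv , fv≡0 , fs≡0) → (Pv , fv≡0) , fs≡0) (λ v ((Pv , fv≡0) , fs≡0) → Pv , fv≡0 , fs≡0) hKer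
      ind′ : IndependentOn Ker-f fs
      ind′ c Fc comb≡0 with (c₀ , Fc₀ , comb≡c₀f) ← ker⊆ker⇒proportional P-sub hP f (linear-combination c Fc fs)
                                                     (λ v Pv fv≡0 → comb≡0 v (Pv , fv≡0)) =
        Vec.∷-injectiveʳ (ind (- c₀ ∷ c) (-‿closed Fc₀ ∷ Fc) λ v Pv → begin
          - c₀ * fn f v + fn (linear-combination c Fc fs) v   ≡⟨ cong₂ _+_ (sym (-‿distribˡ-* c₀ _)) (comb≡c₀f v Pv) ⟩
          - (c₀ * fn f v) + c₀ * fn f v                        ≡⟨ -‿inverseˡ _ ⟩
          0#                                                   ∎)

record SesquilinearForm (X : FieldExtension) : Set where
  open FieldExtension X
  field
    k               : ℕ
    θ               : Field.Carrier K → Field.Carrier K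
    θ-automorphism  : FieldTheory.IsAutomorphism K θ
    σ               : Vec (Field.Carrier K) k → Vec (Field.Carrier K) k → Field.Carrier K
    σ-sesquilinear  : FieldTheory.IsSesquilinear K θ σ
    σ-nondegenerate : FieldTheory.IsNonDegenerate K σ

module TraceDuality (X : FieldExtension) (B : SesquilinearForm X) where

  open FieldExtension X
  open SesquilinearForm B
  open FiniteExtension X
  open LinearFunctionals X k public
  open import Data.Nat as ℕ using (zero; suc)
  open import Data.Product using (_×_; _,_; proj₁; proj₂)
  open import Data.Unit using (tt)
  open import Data.Vec as Vec using ([]; _∷_; replicate)
  import Data.Vec.Properties as Vec
  open import Data.Vec.Relation.Unary.All using (All; []; _∷_)
  import Data.Vec.Relation.Unary.All as All
  open import Relation.Binary.PropositionalEquality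
  open import Relation.Nullary using (yes; no; contradiction)
  open VectorSpaces K _≟_ using (_⊕v_; _·v_; 0v; vecs-laws; module VSpaceLaws; module VSpaceProperties)
  open VSpaceLaws (vecs-laws k)
  open VSpaceProperties (vecs-laws k)
  open FieldTheory K using (vecs; combo; HasDim; Perp')
  open Counting
  open ≡-Reasoning

  θ-homo-+ : ∀ x y → θ (x + y) ≡ θ x + θ y
  θ-homo-+ = proj₁ θ-automorphism

  θ-homo-* : ∀ x y → θ (x * y) ≡ θ x * θ y
  θ-homo-* = proj₁ (proj₂ θ-automorphism)

  θ-1 : θ 1# ≡ 1#
  θ-1 = proj₁ (proj₂ (proj₂ θ-automorphism))

  θ-injective : ∀ x y → θ x ≡ θ y → x ≡ y
  θ-injective = proj₁ (proj₂ (proj₂ (proj₂ θ-automorphism)))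

  θ⁻¹ : Carrier → Carrier
  θ⁻¹ y = proj₁ (proj₂ (proj₂ (proj₂ (proj₂ θ-automorphism))) y)

  θ∘θ⁻¹ : ∀ y → θ (θ⁻¹ y) ≡ y
  θ∘θ⁻¹ y = proj₂ (proj₂ (proj₂ (proj₂ (proj₂ θ-automorphism))) y)

  θ⁻¹∘θ : ∀ x → θ⁻¹ (θ x) ≡ x
  θ⁻¹∘θ x = θ-injective _ _ (θ∘θ⁻¹ (θ x))

  θ-0 : θ 0# ≡ 0#
  θ-0 = x+x≈x⇒x≈0 _ (trans (sym (θ-homo-+ 0# 0#)) (cong θ (+-identityˡ 0#)))

  θ-^ : ∀ x n → θ (x ^ n) ≡ θ x ^ n
  θ-^ x zero    = θ-1
  θ-^ x (suc n) = trans (θ-homo-* x _) (cong (θ x *_) (θ-^ x n))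

  θ-≡0 : ∀ {x} → θ x ≡ 0# → x ≡ 0#
  θ-≡0 θx≡0 = θ-injective _ _ (trans θx≡0 (sym θ-0))

  θ-∈F : ∀ {a} → F a → F (θ a)
  θ-∈F {a} Fa = x^q≡x⇒∈F (θ a) (trans (sym (θ-^ a q)) (cong θ (x^q≡x a Fa)))

  θ⁻¹-homo-+ : ∀ x y → θ⁻¹ (x + y) ≡ θ⁻¹ x + θ⁻¹ y
  θ⁻¹-homo-+ x y = θ-injective _ _ (trans (θ∘θ⁻¹ _) (sym (trans (θ-homo-+ _ _) (cong₂ _+_ (θ∘θ⁻¹ x) (θ∘θ⁻¹ y)))))

  θ⁻¹-homo-* : ∀ x y → θ⁻¹ (x * y) ≡ θ⁻¹ x * θ⁻¹ y
  θ⁻¹-homo-* x y = θ-injective _ _ (trans (θ∘θ⁻¹ _) (sym (trans (θ-homo-* _ _) (cong₂ _*_ (θ∘θ⁻¹ x) (θ∘θ⁻¹ y)))))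

  θ⁻¹-0 : θ⁻¹ 0# ≡ 0#
  θ⁻¹-0 = θ-injective _ _ (trans (θ∘θ⁻¹ 0#) (sym θ-0))

  θ⁻¹-≡0 : ∀ {x} → θ⁻¹ x ≡ 0# → x ≡ 0#
  θ⁻¹-≡0 {x} θ⁻¹x≡0 = trans (sym (θ∘θ⁻¹ x)) (trans (cong θ θ⁻¹x≡0) θ-0)

  θ⁻¹-∈F : ∀ {a} → F a → F (θ⁻¹ a)
  θ⁻¹-∈F {a} Fa = x^q≡x⇒∈F (θ⁻¹ a) (θ-injective _ _ (begin
    θ (θ⁻¹ a ^ q)     ≡⟨ θ-^ (θ⁻¹ a) q ⟩
    θ (θ⁻¹ a) ^ q     ≡⟨ cong (_^ q) (θ∘θ⁻¹ a) ⟩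
    a ^ q             ≡⟨ x^q≡x a Fa ⟩
    a                 ≡⟨ sym (θ∘θ⁻¹ a) ⟩
    θ (θ⁻¹ a)         ∎))

  θ⁻¹-θ-* : ∀ a b → θ⁻¹ (θ a * b) ≡ a * θ⁻¹ b
  θ⁻¹-θ-* a b = trans (θ⁻¹-homo-* _ _) (cong (_* θ⁻¹ b) (θ⁻¹∘θ a))

  σ-homo-⊕ˡ : ∀ u u′ v → σ (u ⊕v u′) v ≡ σ u v + σ u′ v
  σ-homo-⊕ˡ = proj₁ σ-sesquilinear

  σ-homo-⊕ʳ : ∀ u v v′ → σ u (v ⊕v v′) ≡ σ u v + σ u v′
  σ-homo-⊕ʳ = proj₁ (proj₂ σ-sesquilinear)

  σ-homo-·ˡ : ∀ a u v → σ (a ·v u) v ≡ a * σ u v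
  σ-homo-·ˡ = proj₁ (proj₂ (proj₂ σ-sesquilinear))

  σ-homo-·ʳ : ∀ a u v → σ u (a ·v v) ≡ θ a * σ u v
  σ-homo-·ʳ = proj₂ (proj₂ (proj₂ σ-sesquilinear))

  σ-0ˡ : ∀ v → σ 0v v ≡ 0#
  σ-0ˡ v = trans (cong (λ w → σ w v) (sym (·-zeroˡ 0v))) (trans (σ-homo-·ˡ 0# 0v v) (zeroˡ _))

  σ-0ʳ : ∀ u → σ u 0v ≡ 0#
  σ-0ʳ u = trans (cong (σ u) (sym (·-zeroˡ 0v))) (trans (σ-homo-·ʳ 0# u 0v) (trans (cong (_* σ u 0v) θ-0) (zeroˡ _)))

  σ-⊖ˡ : ∀ u v → σ (⊖ u) v ≡ - σ u v
  σ-⊖ˡ u v = trans (σ-homo-·ˡ (- 1#) u v) (-1*x≈-x _)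

  |V| : HasCount (λ (_ : V) → ⊤) ((q ℕ.^ m) ℕ.^ k)
  |V| = count-cong (λ _ _ → tt) (λ v _ → All.universal (λ _ → tt) v) (Vec-count |K| k)

  Tr-form : V → V → Carrier
  Tr-form u v = Tr q m (σ u v)

  -- Tr (a · σ(x, v)) = 0 for all a forces σ(x, v) = 0, since Tr is not identically zero.
  Tr-form-line⇒σ≡0 : ∀ x v → (∀ a → Tr-form (a ·v x) v ≡ 0#) → σ x v ≡ 0#
  Tr-form-line⇒σ≡0 x v Tr≡0 with σ x v ≟ 0#
  ... | yes σ≡0 = σ≡0
  ... | no  σ≢0 with (t , Tr-t≢0) ← Tr-nonZero = contradiction (begin
    Tr q m t                          ≡⟨ cong (Tr q m) (sym (trans (*-assoc t _ _) (trans (cong (t *_) (x⁻¹*x≡1 σ≢0)) (*-identityʳ t)))) ⟩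
    Tr q m ((t * σ x v ⁻¹) * σ x v)   ≡⟨ cong (Tr q m) (sym (σ-homo-·ˡ _ x v)) ⟩
    Tr-form ((t * σ x v ⁻¹) ·v x) v   ≡⟨ Tr≡0 _ ⟩
    0#                                ∎) Tr-t≢0

  Tr-form-nondegenerate : ∀ z → (∀ v → Tr-form z v ≡ 0#) → z ≡ 0v
  Tr-form-nondegenerate z Tr≡0 = σ-nondegenerate z λ v → Tr-form-line⇒σ≡0 z v λ a →
    trans (cong (Tr q m) (trans (σ-homo-·ˡ a z v) (sym (trans (σ-homo-·ʳ (θ⁻¹ a) z v) (cong (_* σ z v) (θ∘θ⁻¹ a)))))) (Tr≡0 _)

  Tr-form-combo : ∀ {d} (zs : Vec V d) (c : Vec Carrier d) → All F c → ∀ v →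
                  All (λ z → Tr-form z v ≡ 0#) zs → Tr-form (combo (vecs k) c zs) v ≡ 0#
  Tr-form-combo []       []       []        v []              = trans (cong (Tr q m) (σ-0ˡ v)) (Tr-0 m)
  Tr-form-combo (z ∷ zs) (a ∷ c)  (Fa ∷ Fc) v (Tr≡0 ∷ Trs≡0) = begin
    Tr q m (σ (a ·v z ⊕v combo (vecs k) c zs) v)               ≡⟨ cong (Tr q m) (σ-homo-⊕ˡ _ _ v) ⟩
    Tr q m (σ (a ·v z) v + σ (combo (vecs k) c zs) v)         ≡⟨ Tr-homo-+ m _ _ ⟩
    Tr-form (a ·v z) v + Tr-form (combo (vecs k) c zs) v      ≡⟨ cong₂ _+_ Tr-az≡0 (Tr-form-combo zs c Fc v Trs≡0) ⟩
    0# + 0#                                                   ≡⟨ +-identityˡ 0# ⟩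
    0#                                                        ∎
    where
      Tr-az≡0 : Tr-form (a ·v z) v ≡ 0#
      Tr-az≡0 = trans (cong (Tr q m) (σ-homo-·ˡ a z v)) (trans (Tr-homo-* m _ Fa) (trans (cong (a *_) Tr≡0) (zeroʳ a)))

  Perp′ : (V → Set) → V → Set
  Perp′ = Perp' q m σ

  Perp′-subspace : ∀ Z → Subspace (Perp′ Z)
  Perp′-subspace Z =
    (λ u _ → trans (cong (Tr q m) (σ-0ʳ u)) (Tr-0 m)) ,
    (λ v v′ v⊥ v′⊥ u Zu → trans (cong (Tr q m) (σ-homo-⊕ʳ u v v′))
                            (trans (Tr-homo-+ m _ _) (trans (cong₂ _+_ (v⊥ u Zu) (v′⊥ u Zu)) (+-identityˡ 0#)))) ,
    (λ a v Fa v⊥ u Zu → trans (cong (Tr q m) (σ-homo-·ʳ a u v))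
                          (trans (Tr-homo-* m _ (θ-∈F Fa)) (trans (cong (θ a *_) (v⊥ u Zu)) (zeroʳ _))))

  -- θ⁻¹ makes the θ-semilinear Tr-form F-linear.
  Tr-functional : V → FLinear
  Tr-functional z = record
    { fn     = λ v → θ⁻¹ (Tr-form z v)
    ; homo-⊕ = λ u v → trans (cong θ⁻¹ (trans (cong (Tr q m) (σ-homo-⊕ʳ z u v)) (Tr-homo-+ m _ _))) (θ⁻¹-homo-+ _ _)
    ; homo-· = λ a v Fa → trans (cong θ⁻¹ (trans (cong (Tr q m) (σ-homo-·ʳ a z v)) (Tr-homo-* m _ (θ-∈F Fa)))) (θ⁻¹-θ-* a _)
    ; ∈F     = λ v → θ⁻¹-∈F (Tr∈F _) }

  Tr-functional-combination : ∀ {d} (c : Vec Carrier d) (Fc : All F c) (zs : Vec V d) v →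
    fn (linear-combination c Fc (Vec.map Tr-functional zs)) v ≡ θ⁻¹ (Tr-form (combo (vecs k) (Vec.map θ c) zs) v)
  Tr-functional-combination []      []        []       v = sym (trans (cong θ⁻¹ (trans (cong (Tr q m) (σ-0ˡ v)) (Tr-0 m))) θ⁻¹-0)
  Tr-functional-combination (a ∷ c) (Fa ∷ Fc) (z ∷ zs) v = begin
    a * θ⁻¹ (Tr-form z v) + fn (linear-combination c Fc (Vec.map Tr-functional zs)) v
                                                  ≡⟨ cong₂ _+_ (sym (θ⁻¹-θ-* a _)) (Tr-functional-combination c Fc zs v) ⟩
    θ⁻¹ (θ a * Tr-form z v) + θ⁻¹ (Tr-form cz v)  ≡⟨ sym (θ⁻¹-homo-+ _ _) ⟩
    θ⁻¹ (θ a * Tr-form z v + Tr-form cz v)        ≡⟨ cong (λ t → θ⁻¹ (t + Tr-form cz v))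
                                                       (sym (trans (cong (Tr q m) (σ-homo-·ˡ (θ a) z v)) (Tr-homo-* m _ (θ-∈F Fa)))) ⟩
    θ⁻¹ (Tr-form (θ a ·v z) v + Tr-form cz v)     ≡⟨ cong θ⁻¹ (sym (trans (cong (Tr q m) (σ-homo-⊕ˡ _ _ v)) (Tr-homo-+ m _ _))) ⟩
    θ⁻¹ (Tr-form (θ a ·v z ⊕v cz) v)              ∎
    where
      cz : V
      cz = combo (vecs k) (Vec.map θ c) zs

  perp-count : ∀ {Z} → Subspace Z → ∀ {d b} → HasDim (vecs k) F Z d → HasCount (Perp′ Z) b →
               (q ℕ.^ m) ℕ.^ k ≡ q ℕ.^ d ℕ.* b
  perp-count {Z} Z-sub {d} {b} (zs , Zzs , zs-independent , zs-span) hPerp =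
    count-commonKernel (Vec.map Tr-functional zs) (tt , (λ _ _ _ _ → tt) , (λ _ _ _ _ → tt)) |V| hKernel independent
    where
      ⊥⇒vanish : ∀ {l} (ws : Vec V l) → All Z ws → ∀ v → Perp′ Z v → AllVanish (Vec.map Tr-functional ws) v
      ⊥⇒vanish []       []         v v⊥ = tt
      ⊥⇒vanish (w ∷ ws) (Zw ∷ Zws) v v⊥ = trans (cong θ⁻¹ (v⊥ w Zw)) θ⁻¹-0 , ⊥⇒vanish ws Zws v v⊥
      vanish⇒⊥ : ∀ {l} (ws : Vec V l) → ∀ v → AllVanish (Vec.map Tr-functional ws) v → All (λ z → Tr-form z v ≡ 0#) ws
      vanish⇒⊥ []       v _               = []
      vanish⇒⊥ (w ∷ ws) v (fw≡0 , fws≡0)  = θ⁻¹-≡0 fw≡0 ∷ vanish⇒⊥ ws v fws≡0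
      hKernel : HasCount (λ v → ⊤ × AllVanish (Vec.map Tr-functional zs) v) b
      hKernel = count-cong (λ v v⊥ → tt , ⊥⇒vanish zs Zzs v v⊥)
                           (λ v (_ , vanish) u Zu → let (c , Fc , c·zs≡u) = zs-span u Zu in
                              subst (λ w → Tr-form w v ≡ 0#) c·zs≡u (Tr-form-combo zs c Fc v (vanish⇒⊥ zs v vanish)))
                           hPerp
      θ-All-∈F : ∀ {l} {c : Vec Carrier l} → All F c → All F (Vec.map θ c)
      θ-All-∈F []        = []
      θ-All-∈F (Fa ∷ Fc) = θ-∈F Fa ∷ θ-All-∈F Fc
      map-θ≡0 : ∀ {l} (c : Vec Carrier l) → Vec.map θ c ≡ replicate l 0# → c ≡ replicate l 0#
      map-θ≡0 []      _       = refl
      map-θ≡0 (a ∷ c) θac≡0   = cong₂ _∷_ (θ-≡0 (Vec.∷-injectiveˡ θac≡0)) (map-θ≡0 c (Vec.∷-injectiveʳ θac≡0))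
      independent : IndependentOn (λ _ → ⊤) (Vec.map Tr-functional zs)
      independent c Fc comb≡0 = map-θ≡0 c (zs-independent (Vec.map θ c) (θ-All-∈F Fc)
        (Tr-form-nondegenerate _ λ v → θ⁻¹-≡0 (trans (sym (Tr-functional-combination c Fc zs v)) (comb≡0 v tt))))

module DotProduct (K : Field) (_≟_ : Relation.Binary.DecidableEquality (Field.Carrier K)) where

  open import Data.Nat using (zero; suc)
  open import Data.Vec as Vec using ([]; _∷_)
  import Data.Vec.Properties as Vec
  open import Relation.Binary.PropositionalEquality
  open FieldProperties K _≟_
  open VectorSpaces K _≟_ using (_⊕v_; _·v_; 0v; vecs-laws; module VSpaceProperties)
  open FieldTheory K using (dot; codeword; combo; vecs; scalars)
  open ≡-Reasoning

  dot-homo-⊕ˡ : ∀ {t} (x y v : Vec Carrier t) → dot (x ⊕v y) v ≡ dot x v + dot y v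
  dot-homo-⊕ˡ []      []      []      = sym (+-identityˡ 0#)
  dot-homo-⊕ˡ (a ∷ x) (b ∷ y) (c ∷ v) = trans (cong₂ _+_ (distribʳ c a b) (dot-homo-⊕ˡ x y v)) (+-interchange _ _ _ _)

  dot-homo-⊕ʳ : ∀ {t} (x u v : Vec Carrier t) → dot x (u ⊕v v) ≡ dot x u + dot x v
  dot-homo-⊕ʳ []      []      []      = sym (+-identityˡ 0#)
  dot-homo-⊕ʳ (a ∷ x) (b ∷ u) (c ∷ v) = trans (cong₂ _+_ (distribˡ a b c) (dot-homo-⊕ʳ x u v)) (+-interchange _ _ _ _)

  dot-homo-·ˡ : ∀ {t} a (x v : Vec Carrier t) → dot (a ·v x) v ≡ a * dot x v
  dot-homo-·ˡ a []      []      = sym (zeroʳ a)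
  dot-homo-·ˡ a (b ∷ x) (c ∷ v) = trans (cong₂ _+_ (*-assoc a b c) (dot-homo-·ˡ a x v)) (sym (distribˡ a _ _))

  dot-homo-·ʳ : ∀ {t} (x : Vec Carrier t) a u → dot x (a ·v u) ≡ a * dot x u
  dot-homo-·ʳ []      a []      = sym (zeroʳ a)
  dot-homo-·ʳ (b ∷ x) a (c ∷ u) = trans (cong₂ _+_ b*[a*c]≡a*[b*c] (dot-homo-·ʳ x a u)) (sym (distribˡ a _ _))
    where
      b*[a*c]≡a*[b*c] : b * (a * c) ≡ a * (b * c)
      b*[a*c]≡a*[b*c] = trans (sym (*-assoc b a c)) (trans (cong (_* c) (*-comm b a)) (*-assoc a b c))

  dot-0ˡ : ∀ {t} (v : Vec Carrier t) → dot 0v v ≡ 0#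
  dot-0ˡ []      = refl
  dot-0ˡ (a ∷ v) = trans (cong₂ _+_ (zeroˡ a) (dot-0ˡ v)) (+-identityˡ 0#)

  dot-0ʳ : ∀ {t} (x : Vec Carrier t) → dot x 0v ≡ 0#
  dot-0ʳ []      = refl
  dot-0ʳ (a ∷ x) = trans (cong₂ _+_ (zeroʳ a) (dot-0ʳ x)) (+-identityˡ 0#)

  dot-combo : ∀ {t l} (x : Vec Carrier t) (c : Vec Carrier l) ws →
              combo scalars c (Vec.map (dot x) ws) ≡ dot x (combo (vecs t) c ws)
  dot-combo x []      []       = sym (dot-0ʳ x)
  dot-combo x (a ∷ c) (w ∷ ws) = trans (cong₂ _+_ (sym (dot-homo-·ʳ x a w)) (dot-combo x c ws)) (sym (dot-homo-⊕ʳ x _ _))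

  standardBasis : ∀ t → Vec (Vec Carrier t) t
  standardBasis zero    = []
  standardBasis (suc t) = (1# ∷ 0v) ∷ Vec.map (0# ∷_) (standardBasis t)

  combo-standardBasis : ∀ t (v : Vec Carrier t) → combo (vecs t) v (standardBasis t) ≡ v
  combo-standardBasis zero    []      = refl
  combo-standardBasis (suc t) (a ∷ v) = begin
    (a * 1# ∷ a ·v 0v) ⊕v combo (vecs (suc t)) v (Vec.map (0# ∷_) (standardBasis t))
                                                ≡⟨ cong ((a * 1# ∷ a ·v 0v) ⊕v_) (combo-0∷ v (standardBasis t)) ⟩
    (a * 1# + 0#) ∷ (a ·v 0v ⊕v combo (vecs t) v (standardBasis t))
                                                ≡⟨ cong₂ _∷_ (trans (+-identityʳ _) (*-identityʳ a))
                                                     (cong₂ _⊕v_ (·-zeroʳ a) (combo-standardBasis t v)) ⟩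
    a ∷ (0v ⊕v v)                               ≡⟨ cong (a ∷_) (⊕-identityˡ v) ⟩
    a ∷ v                                       ∎
    where
      open VSpaceProperties (vecs-laws t) using (·-zeroʳ)
      open VectorSpaces.VSpaceLaws (vecs-laws t) using (⊕-identityˡ)
      combo-0∷ : ∀ {l} (c : Vec Carrier l) ws →
                 combo (vecs (suc t)) c (Vec.map (0# ∷_) ws) ≡ 0# ∷ combo (vecs t) c ws
      combo-0∷ []      []       = refl
      combo-0∷ (b ∷ c) (w ∷ ws) = trans (cong ((b * 0# ∷ b ·v w) ⊕v_) (combo-0∷ c ws))
                                        (cong (_∷ (b ·v w ⊕v combo (vecs t) c ws)) (trans (+-identityʳ _) (zeroʳ b)))

  module _ {k N} (G : Vec (Vec Carrier k) N) where

    codeword-homo-⊕ : ∀ x y → codeword G (x ⊕v y) ≡ codeword G x ⊕v codeword G y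
    codeword-homo-⊕ x y = trans (Vec.map-cong (dot-homo-⊕ˡ x y) G) (map-+ G)
      where
        map-+ : ∀ {l} (ws : Vec (Vec Carrier k) l) → Vec.map (λ w → dot x w + dot y w) ws ≡ Vec.map (dot x) ws ⊕v Vec.map (dot y) ws
        map-+ []       = refl
        map-+ (w ∷ ws) = cong (_ ∷_) (map-+ ws)

    codeword-homo-· : ∀ a x → codeword G (a ·v x) ≡ a ·v codeword G x
    codeword-homo-· a x = trans (Vec.map-cong (dot-homo-·ˡ a x) G) (Vec.map-∘ (a *_) (dot x) G)

    codeword-0 : codeword G 0v ≡ 0v
    codeword-0 = trans (Vec.map-cong dot-0ˡ G) (Vec.map-const G 0#)

module RieszMap (X : FieldExtension) (B : SesquilinearForm X) where

  open FieldExtension X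
  open SesquilinearForm B
  open TraceDuality X B
  open FiniteExtension X using (_≟_)
  open import Data.Product using (Σ; _,_; proj₁; proj₂)
  open import Data.Unit using (tt)
  open import Data.Vec as Vec using ([]; _∷_)
  import Data.Vec.Properties as Vec
  import Data.Nat.Properties as ℕ
  open import Relation.Binary.PropositionalEquality
  open FieldProperties K _≟_
  open VectorSpaces K _≟_ using (_⊕v_; _·v_; 0v; vecs-laws; module VSpaceLaws; module VSpaceProperties)
  open VSpaceLaws (vecs-laws k)
  open VSpaceProperties (vecs-laws k)
  open DotProduct K _≟_
  open FieldTheory K using (dot; combo; vecs)
  open Counting
  open Counting.WithDecEq _≟V_
  open ≡-Reasoning

  R : V → V
  R y = Vec.map (λ e → θ⁻¹ (σ y e)) (standardBasis k)

  dot-R : ∀ y v → dot (R y) v ≡ θ⁻¹ (σ y v)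
  dot-R y v = trans (dot-map y v (standardBasis k)) (cong (λ z → θ⁻¹ (σ y z)) (combo-standardBasis k v))
    where
      dot-map : ∀ {l} y (c : Vec Carrier l) ws → dot (Vec.map (λ w → θ⁻¹ (σ y w)) ws) c ≡ θ⁻¹ (σ y (combo (vecs k) c ws))
      dot-map y []      []       = sym (trans (cong θ⁻¹ (σ-0ʳ y)) θ⁻¹-0)
      dot-map y (a ∷ c) (w ∷ ws) = begin
        θ⁻¹ (σ y w) * a + dot (Vec.map (λ w → θ⁻¹ (σ y w)) ws) c
                                                ≡⟨ cong₂ _+_ (trans (*-comm _ a) (sym (θ⁻¹-θ-* a _))) (dot-map y c ws) ⟩
        θ⁻¹ (θ a * σ y w) + θ⁻¹ (σ y cws)       ≡⟨ sym (θ⁻¹-homo-+ _ _) ⟩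
        θ⁻¹ (θ a * σ y w + σ y cws)             ≡⟨ cong θ⁻¹ (sym (trans (σ-homo-⊕ʳ y _ _) (cong (_+ σ y cws) (σ-homo-·ʳ a y w)))) ⟩
        θ⁻¹ (σ y (a ·v w ⊕v cws))               ∎
        where
          cws : V
          cws = combo (vecs k) c ws

  R-injective : ∀ y y′ → R y ≡ R y′ → y ≡ y′
  R-injective y y′ Ry≡Ry′ = x⊖y≡o⇒x≡y y y′ (σ-nondegenerate _ λ v → begin
    σ (y ⊕v ⊖ y′) v     ≡⟨ σ-homo-⊕ˡ y _ v ⟩
    σ y v + σ (⊖ y′) v  ≡⟨ cong₂ _+_ (σ≡ v) (σ-⊖ˡ y′ v) ⟩
    σ y′ v + - σ y′ v   ≡⟨ -‿inverseʳ _ ⟩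
    0#                  ∎)
    where
      σ≡ : ∀ v → σ y v ≡ σ y′ v
      σ≡ v = begin
        σ y v                ≡⟨ sym (θ∘θ⁻¹ _) ⟩
        θ (θ⁻¹ (σ y v))      ≡⟨ cong θ (trans (sym (dot-R y v)) (trans (cong (λ z → dot z v) Ry≡Ry′) (dot-R y′ v))) ⟩
        θ (θ⁻¹ (σ y′ v))     ≡⟨ θ∘θ⁻¹ _ ⟩
        σ y′ v               ∎

  -- R is an injection of the finite set K^k into itself.
  R-surjective : ∀ x → Σ V λ y → R y ≡ x
  R-surjective x with (y , _ , Ry≡x) ← count-full (image-count R |V| (λ y y′ _ _ → R-injective y y′)) |V|
                                                   (λ _ _ → tt) ℕ.≤-refl x tt = y , Ry≡x

  R⁻¹ : V → V
  R⁻¹ x = proj₁ (R-surjective x)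

  R∘R⁻¹ : ∀ x → R (R⁻¹ x) ≡ x
  R∘R⁻¹ x = proj₂ (R-surjective x)

  R⁻¹∘R : ∀ y → R⁻¹ (R y) ≡ y
  R⁻¹∘R y = R-injective _ _ (R∘R⁻¹ (R y))

  dot≡θ⁻¹σ : ∀ x v → dot x v ≡ θ⁻¹ (σ (R⁻¹ x) v)
  dot≡θ⁻¹σ x v = trans (cong (λ z → dot z v) (sym (R∘R⁻¹ x))) (dot-R (R⁻¹ x) v)

  R-0 : R 0v ≡ 0v
  R-0 = trans (Vec.map-cong (λ w → trans (cong θ⁻¹ (σ-0ˡ w)) θ⁻¹-0) (standardBasis k)) (Vec.map-const (standardBasis k) 0#)

  R⁻¹-0 : R⁻¹ 0v ≡ 0v
  R⁻¹-0 = R-injective _ _ (trans (R∘R⁻¹ 0v) (sym R-0))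

  R⁻¹-nonZero : ∀ {x} → x ≢ 0v → R⁻¹ x ≢ 0v
  R⁻¹-nonZero {x} x≢0 R⁻¹x≡0 = x≢0 (trans (sym (R∘R⁻¹ x)) (trans (cong R R⁻¹x≡0) R-0))

  R-nonZero : ∀ {y} → y ≢ 0v → R y ≢ 0v
  R-nonZero {y} y≢0 Ry≡0 = y≢0 (trans (sym (R⁻¹∘R y)) (trans (cong R⁻¹ Ry≡0) R⁻¹-0))

module PowerArithmetic where

  open import Data.Nat
  open import Data.Nat.Properties
  open import Relation.Binary.PropositionalEquality
  open ≡-Reasoning

  q^-nonZero : ∀ {q} → 2 ≤ q → ∀ a → NonZero (q ^ a)
  q^-nonZero {q} 2≤q a = m^n≢0 q a {{>-nonZero (≤-trans (s≤s z≤n) 2≤q)}}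

  q^*-cancelˡ : ∀ {q} → 2 ≤ q → ∀ a {z b} → q ^ a * z ≡ q ^ (a + b) → z ≡ q ^ b
  q^*-cancelˡ {q} 2≤q a {z} {b} eq = *-cancelˡ-≡ z (q ^ b) (q ^ a) {{q^-nonZero 2≤q a}}
    (trans eq (^-distribˡ-+-* q a b))

  -- |U| |K| = |U ∩ Ky| |U + Ky|
  sum-size : ∀ {q} → 2 ≤ q → ∀ n m w {z} → w ≤ m → q ^ n * q ^ m ≡ q ^ w * z → z ≡ q ^ (n + (m ∸ w))
  sum-size {q} 2≤q n m w {z} w≤m eq = q^*-cancelˡ 2≤q w (begin
    q ^ w * z                ≡⟨ sym eq ⟩
    q ^ n * q ^ m            ≡⟨ sym (^-distribˡ-+-* q n m) ⟩
    q ^ (n + m)              ≡⟨ cong (λ e → q ^ (n + e)) (sym (m+[n∸m]≡n w≤m)) ⟩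
    q ^ (n + (w + (m ∸ w)))  ≡⟨ cong (q ^_) (trans (sym (+-assoc n w _)) (trans (cong (_+ (m ∸ w)) (+-comm n w)) (+-assoc w n _))) ⟩
    q ^ (w + (n + (m ∸ w)))  ∎)

  -- From |V| = q^n q^N = q^(n+m-w) |ker| and q^N = |ker| |image|.
  image-size : ∀ {q} → 2 ≤ q → ∀ n N e {V ker im} → V ≡ q ^ n * q ^ N → V ≡ q ^ (n + e) * ker →
                q ^ N ≡ ker * im → im ≡ q ^ e
  image-size {q} 2≤q n N e {V} {ker} {im} V≡ V≡′ q^N≡ = *-cancelˡ-≡ im (q ^ e) ker {{ker≢0}} (begin
    ker * im           ≡⟨ sym q^N≡ ⟩
    q ^ N              ≡⟨ q^N≡q^e*ker ⟩
    q ^ e * ker        ≡⟨ *-comm _ ker ⟩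
    ker * q ^ e        ∎)
    where
      q^N≡q^e*ker : q ^ N ≡ q ^ e * ker
      q^N≡q^e*ker = *-cancelˡ-≡ _ _ (q ^ n) {{q^-nonZero 2≤q n}} (begin
        q ^ n * q ^ N           ≡⟨ trans (sym V≡) V≡′ ⟩
        q ^ (n + e) * ker       ≡⟨ cong (_* ker) (^-distribˡ-+-* q n e) ⟩
        q ^ n * q ^ e * ker     ≡⟨ *-assoc (q ^ n) _ ker ⟩
        q ^ n * (q ^ e * ker)   ∎)
      ker≢0 : NonZero ker
      ker≢0 = ≢-nonZero λ ker≡0 → ≢-nonZero⁻¹ (q ^ N) {{q^-nonZero 2≤q N}} (trans q^N≡ (cong (_* im) ker≡0))

record DualCodeData (X : FieldExtension) (B : SesquilinearForm X) : Set₁ where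
  open FieldExtension X
  open SesquilinearForm B
  field
    U          : Vec (Field.Carrier K) k → Set
    U-subspace : FieldTheory.IsSubspace K (FieldTheory.vecs K k) F U
    n          : ℕ
    U-dim      : FieldTheory.HasDim K (FieldTheory.vecs K k) F U n
    N          : ℕ
    G          : Vec (Vec (Field.Carrier K) k) N
    G-basis    : FieldTheory.IsBasis K (FieldTheory.vecs K k) F (FieldTheory.Perp' K q m σ U) G

module DualCode (X : FieldExtension) (B : SesquilinearForm X) (D : DualCodeData X B) where

  open FieldExtension X
  open SesquilinearForm B
  open DualCodeData D
  open TraceDuality X B public
  open RieszMap X B public
  open FiniteExtension X using (_≟_; 2≤q; 1∈; -‿closed; Tr; Tr-homo-+; Tr-0)
  open import Data.Nat as ℕ using (_≤_; _∸_)
  import Data.Nat.Properties as ℕ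
  open import Data.Product using (Σ; ∃; _×_; _,_; proj₁; proj₂)
  import Data.Product.Properties as Product
  open import Data.Unit using (tt)
  open import Relation.Binary.PropositionalEquality
  open import Relation.Nullary using (Dec; _×-dec_)
  import Relation.Nullary.Decidable as Dec
  open import Relation.Unary using (Decidable)
  open FieldProperties K _≟_
  open VectorSpaces K _≟_ using (_⊕v_; _·v_; 0v; vecs-laws; scalars-laws; module VSpaceLaws; module VSpaceProperties)
  open VSpaceLaws (vecs-laws k)
  open VSpaceProperties (vecs-laws k)
  open DotProduct K _≟_
  open FieldTheory K using (dot; codeword; vecs; scalars; InSpan; RankWeight; combo)
  open NatPowers
  open Counting
  open ≡-Reasoning
  module Span-V = FiniteSubfieldSpan K _≟_ (vecs-laws k) F-subfield |F|
  module Span-K = FiniteSubfieldSpan K _≟_ scalars-laws F-subfield |F|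

  private
    U0 : U 0v
    U0 = proj₁ U-subspace

    U⊕ : ∀ u v → U u → U v → U (u ⊕v v)
    U⊕ = proj₁ (proj₂ U-subspace)

    U· : ∀ a u → F a → U u → U (a ·v u)
    U· = proj₂ (proj₂ U-subspace)

  |U| : HasCount U (q ℕ.^ n)
  |U| = Span-V.dim⇒count U-subspace U-dim

  U? : Decidable U
  U? = count-dec |U| _≟V_

  Y : V → Set
  Y = Perp′ U

  Y-subspace : Subspace Y
  Y-subspace = Perp′-subspace U

  |Y| : HasCount Y (q ℕ.^ N)
  |Y| = Span-V.dim⇒count Y-subspace (G , G-basis)

  |V|≡|U||Y| : (q ℕ.^ m) ℕ.^ k ≡ q ℕ.^ n ℕ.* q ℕ.^ N
  |V|≡|U||Y| = perp-count U-subspace U-dim |Y|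

  length≡km-n : N ≡ k ℕ.* m ∸ n
  length≡km-n = begin
    N                    ≡⟨ sym (ℕ.m+n∸m≡n n N) ⟩
    n ℕ.+ N ∸ n          ≡⟨ cong (_∸ n) (sym km≡n+N) ⟩
    k ℕ.* m ∸ n          ∎
    where
      km≡n+N : k ℕ.* m ≡ n ℕ.+ N
      km≡n+N = ^-injectiveʳ 2≤q (begin
        q ℕ.^ (k ℕ.* m)             ≡⟨ cong (q ℕ.^_) (ℕ.*-comm k m) ⟩
        q ℕ.^ (m ℕ.* k)             ≡⟨ sym (ℕ.^-*-assoc q m k) ⟩
        (q ℕ.^ m) ℕ.^ k             ≡⟨ |V|≡|U||Y| ⟩
        q ℕ.^ n ℕ.* q ℕ.^ N         ≡⟨ sym (ℕ.^-distribˡ-+-* q n N) ⟩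
        q ℕ.^ (n ℕ.+ N)             ∎)

  -- An F-space isomorphic to U ∩ ⟨y⟩, so of size q^(weight of the point ⟨y⟩).
  ScalarsIntoU : V → Carrier → Set
  ScalarsIntoU y b = U (b ·v y)

  -- The entries of xG span the image of Y under dot x = θ⁻¹ σ(y, -); its kernel in Y is (U + Ky)^⊥',
  -- and |U + Ky| = q^(n + m - w), so the image has q^(m - w) elements.
  module CodewordOfWeight (x : V) (x≢0 : x ≢ 0v) (w : ℕ) (w≤m : w ≤ m)
                          (|Λ| : HasCount (ScalarsIntoU (R⁻¹ x)) (q ℕ.^ w)) where

    y : V
    y = R⁻¹ x

    U+Ky : V → Set
    U+Ky v = Σ Carrier λ a → Σ V λ u → U u × v ≡ u ⊕v a ·v y

    U+Ky-subspace : Subspace U+Ky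
    U+Ky-subspace =
      (0# , 0v , U0 , sym (trans (cong (0v ⊕v_) (·-zeroˡ y)) (⊕-identityˡ 0v))) ,
      (λ v v′ (a , u , Uu , v≡) (a′ , u′ , Uu′ , v′≡) → a + a′ , u ⊕v u′ , U⊕ _ _ Uu Uu′ ,
         trans (cong₂ _⊕v_ v≡ v′≡) (trans (⊕-interchange u _ u′ _) (cong ((u ⊕v u′) ⊕v_) (sym (·-distribʳ a a′ y))))) ,
      (λ c v Fc (a , u , Uu , v≡) → c * a , c ·v u , U· _ _ Fc Uu ,
         trans (cong (c ·v_) v≡) (trans (·-distribˡ c u _) (cong ((c ·v u) ⊕v_) (sym (·-assoc c a y)))))

    U+Ky? : Decidable U+Ky
    U+Ky? v = Dec.map′ (λ (a , Uv-ay) → a , _ , Uv-ay , sym (⊖-⊕-cancel v (a ·v y)))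
                       (λ (a , u , Uu , v≡) → a , subst U (sym (trans (cong (_⊕v ⊖ (a ·v y)) v≡) (⊕-⊖-cancel u _))) Uu)
                       (search |K| (λ a → U? (v ⊕v ⊖ (a ·v y))))

    -- Each vector of U + Ky is u + a y in |U ∩ Ky| = q^w ways.
    sum-fibre : ∀ z → U+Ky z → HasCount (λ (p : V × Carrier) → (U (proj₁ p) × ⊤) × proj₁ p ⊕v proj₂ p ·v y ≡ z) (q ℕ.^ w)
    sum-fibre z (a₀ , u₀ , Uu₀ , z≡) = count-cong into onto (image-count shift |Λ| shift-injective)
      where
        shift : Carrier → V × Carrier
        shift b = u₀ ⊕v b ·v y , a₀ + - b
        shift-injective : ∀ b b′ → _ → _ → shift b ≡ shift b′ → b ≡ b′
        shift-injective b b′ _ _ eq = -‿injective (+-cancelˡ a₀ _ _ (cong proj₂ eq))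
        into : ∀ p → (∃ λ b → ScalarsIntoU y b × shift b ≡ p) → (U (proj₁ p) × ⊤) × proj₁ p ⊕v proj₂ p ·v y ≡ z
        into _ (b , Uby , refl) = (U⊕ _ _ Uu₀ Uby , tt) , (begin
          (u₀ ⊕v b ·v y) ⊕v (a₀ + - b) ·v y     ≡⟨ ⊕-assoc u₀ _ _ ⟩
          u₀ ⊕v (b ·v y ⊕v (a₀ + - b) ·v y)     ≡⟨ cong (u₀ ⊕v_) (sym (·-distribʳ b _ y)) ⟩
          u₀ ⊕v (b + (a₀ + - b)) ·v y           ≡⟨ cong (λ c → u₀ ⊕v c ·v y) b+[a₀-b]≡a₀ ⟩
          u₀ ⊕v a₀ ·v y                         ≡⟨ sym z≡ ⟩
          z                                     ∎)
          where
            b+[a₀-b]≡a₀ : b + (a₀ + - b) ≡ a₀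
            b+[a₀-b]≡a₀ = trans (+-comm b _) (trans (+-assoc a₀ (- b) b) (trans (cong (a₀ +_) (-‿inverseˡ b)) (+-identityʳ a₀)))
        onto : ∀ p → (U (proj₁ p) × ⊤) × proj₁ p ⊕v proj₂ p ·v y ≡ z → ∃ λ b → ScalarsIntoU y b × shift b ≡ p
        onto (u , a) ((Uu , _) , u+ay≡z) = a₀ + - a , U[b·y] , cong₂ _,_ (sym u≡) a₀-b≡a
          where
            u≡ : u ≡ u₀ ⊕v (a₀ + - a) ·v y
            u≡ = begin
              u                                   ≡⟨ sym (⊕-⊖-cancel u (a ·v y)) ⟩
              (u ⊕v a ·v y) ⊕v ⊖ (a ·v y)         ≡⟨ cong₂ _⊕v_ (trans u+ay≡z z≡) (⊖-· a y) ⟩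
              (u₀ ⊕v a₀ ·v y) ⊕v (- a) ·v y       ≡⟨ ⊕-assoc u₀ _ _ ⟩
              u₀ ⊕v (a₀ ·v y ⊕v (- a) ·v y)       ≡⟨ cong (u₀ ⊕v_) (sym (·-distribʳ a₀ (- a) y)) ⟩
              u₀ ⊕v (a₀ + - a) ·v y               ∎
            U[b·y] : U ((a₀ + - a) ·v y)
            U[b·y] = subst U (trans (cong (_⊕v ⊖ u₀) (trans u≡ (⊕-comm u₀ _))) (⊕-⊖-cancel _ u₀))
                           (U⊕ _ _ Uu (U· _ _ (-‿closed 1∈) Uu₀))
            a₀-b≡a : a₀ + - (a₀ + - a) ≡ a
            a₀-b≡a = begin
              a₀ + - (a₀ + - a)       ≡⟨ cong (a₀ +_) (sym (-‿+-comm a₀ (- a))) ⟩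
              a₀ + (- a₀ + - - a)     ≡⟨ cong (λ t → a₀ + (- a₀ + t)) (-‿involutive a) ⟩
              a₀ + (- a₀ + a)         ≡⟨ sym (+-assoc a₀ _ a) ⟩
              (a₀ + - a₀) + a         ≡⟨ cong (_+ a) (-‿inverseʳ a₀) ⟩
              0# + a                  ≡⟨ +-identityˡ a ⟩
              a                       ∎

    |U+Ky| : HasCount U+Ky (q ℕ.^ (n ℕ.+ (m ∸ w)))
    |U+Ky| = subst (HasCount U+Ky) (PowerArithmetic.sum-size 2≤q n m w w≤m |U|×|K|≡) hZ
      where
        z : ℕ
        z = proj₁ (subset-count |V| U+Ky?)
        hZ : HasCount U+Ky z
        hZ = proj₂ (subset-count |V| U+Ky?)
        |U|×|K|≡ : q ℕ.^ n ℕ.* q ℕ.^ m ≡ q ℕ.^ w ℕ.* z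
        |U|×|K|≡ = fibre-count _≟V_ (λ (p : V × Carrier) → proj₁ p ⊕v proj₂ p ·v y) (×-count |U| |K|) hZ
                               (λ (u , a) (Uu , _) → a , u , Uu , refl) sum-fibre

    Kernel : V → Set
    Kernel v = Y v × dot x v ≡ 0#

    Kernel? : Decidable Kernel
    Kernel? v = count-dec |Y| _≟V_ v ×-dec (dot x v ≟ 0#)

    kernel-size : ℕ
    kernel-size = proj₁ (subset-count |V| Kernel?)

    |Kernel| : HasCount Kernel kernel-size
    |Kernel| = proj₂ (subset-count |V| Kernel?)

    Kernel⇒Perp : ∀ v → Kernel v → Perp′ U+Ky v
    Kernel⇒Perp v (v⊥U , xv≡0) _ (a , u , Uu , refl) = begin
      Tr q m (σ (u ⊕v a ·v y) v)                 ≡⟨ cong (Tr q m) (σ-homo-⊕ˡ u _ v) ⟩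
      Tr q m (σ u v + σ (a ·v y) v)              ≡⟨ Tr-homo-+ m _ _ ⟩
      Tr-form u v + Tr q m (σ (a ·v y) v)        ≡⟨ cong₂ _+_ (v⊥U u Uu) (cong (Tr q m) (trans (σ-homo-·ˡ a y v) (trans (cong (a *_) σyv≡0) (zeroʳ a)))) ⟩
      0# + Tr q m 0#                             ≡⟨ trans (+-identityˡ _) (Tr-0 m) ⟩
      0#                                         ∎
      where
        σyv≡0 : σ y v ≡ 0#
        σyv≡0 = θ⁻¹-≡0 (trans (sym (dot≡θ⁻¹σ x v)) xv≡0)

    Perp⇒Kernel : ∀ v → Perp′ U+Ky v → Kernel v
    Perp⇒Kernel v v⊥ =
      (λ u Uu → subst (λ t → Tr-form t v ≡ 0#) (trans (cong (u ⊕v_) (·-zeroˡ y)) (⊕-identityʳ u)) (v⊥ _ (0# , u , Uu , refl))) ,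
      (begin
        dot x v              ≡⟨ dot≡θ⁻¹σ x v ⟩
        θ⁻¹ (σ y v)          ≡⟨ cong θ⁻¹ (Tr-form-line⇒σ≡0 y v λ a → subst (λ t → Tr-form t v ≡ 0#) (⊕-identityˡ (a ·v y)) (v⊥ _ (a , 0v , U0 , refl))) ⟩
        θ⁻¹ 0#               ≡⟨ θ⁻¹-0 ⟩
        0#                   ∎)

    Image : Carrier → Set
    Image s = Σ V λ v → Y v × dot x v ≡ s

    Image? : Decidable Image
    Image? s = search |V| (λ v → count-dec |Y| _≟V_ v ×-dec (dot x v ≟ s))

    image-size : ℕ
    image-size = proj₁ (subset-count |K| Image?)

    |Image| : HasCount Image image-size
    |Image| = proj₂ (subset-count |K| Image?)

    |Y|≡|Kernel||Image| : q ℕ.^ N ≡ kernel-size ℕ.* image-size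
    |Y|≡|Kernel||Image| = fibre-count _≟_ (dot x) |Y| |Image| (λ v Yv → v , Yv , refl) fibres
      where
        Y⊕ : ∀ u v → Y u → Y v → Y (u ⊕v v)
        Y⊕ = proj₁ (proj₂ Y-subspace)
        Y· : ∀ a u → F a → Y u → Y (a ·v u)
        Y· = proj₂ (proj₂ Y-subspace)
        fibres : ∀ s → Image s → HasCount (λ v → Y v × dot x v ≡ s) (kernel-size)
        fibres s (v₀ , Yv₀ , xv₀≡s) = count-cong
          (λ { v (t , (Yt , xt≡0) , refl) → Y⊕ _ _ Yt Yv₀ , trans (dot-homo-⊕ʳ x t v₀) (trans (cong₂ _+_ xt≡0 xv₀≡s) (+-identityˡ s)) })
          (λ v (Yv , xv≡s) → v ⊕v ⊖ v₀ ,
             (Y⊕ _ _ Yv (Y· _ _ (-‿closed 1∈) Yv₀) ,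
              trans (dot-homo-⊕ʳ x v _) (trans (cong₂ _+_ xv≡s (trans (dot-homo-·ʳ x (- 1#) v₀) (trans (-1*x≈-x _) (cong -_ xv₀≡s)))) (-‿inverseʳ s))) ,
             ⊖-⊕-cancel v v₀)
          (image-count (_⊕v v₀) |Kernel| (λ a b _ _ → ⊕-cancelʳ v₀ a b))

    |Image|≡q^[m-w] : image-size ≡ q ℕ.^ (m ∸ w)
    |Image|≡q^[m-w] = PowerArithmetic.image-size 2≤q n N (m ∸ w) {ker = kernel-size} |V|≡|U||Y|
      (perp-count U+Ky-subspace {d = n ℕ.+ (m ∸ w)} (Span-V.count⇒dim U+Ky-subspace |U+Ky|) (count-cong Kernel⇒Perp Perp⇒Kernel |Kernel|))
      |Y|≡|Kernel||Image|

    span⇔Image : ∀ s → InSpan scalars F (codeword G x) s → Image s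
    span⇔Image s (c , Fc , c·xG≡s) =
      combo (vecs k) c G , Span-V.combo-∈ Y-subspace (proj₁ G-basis) Fc , trans (sym (dot-combo x c G)) c·xG≡s

    Image⇒span : ∀ s → Image s → InSpan scalars F (codeword G x) s
    Image⇒span s (v , Yv , xv≡s) with (c , Fc , c·G≡v) ← proj₂ (proj₂ G-basis) v Yv =
      c , Fc , trans (dot-combo x c G) (trans (cong (dot x) c·G≡v) xv≡s)

    rankWeight : RankWeight F (codeword G x) (m ∸ w)
    rankWeight = Span-K.count⇒dim (Span-K.span-subspace (codeword G x))
                   (count-cong Image⇒span span⇔Image (subst (HasCount Image) |Image|≡q^[m-w] |Image|))

module ClubArithmetic where

  open import Data.Nat
  open import Data.Nat.Properties
  open import Relation.Binary.PropositionalEquality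
  open import Relation.Nullary using (yes; no; contradiction)

  [q-1]*x+x≡q*x : ∀ {q} → 1 ≤ q → ∀ x → (q ∸ 1) * x + x ≡ q * x
  [q-1]*x+x≡q*x {suc q} _ x = +-comm (q * x) x

  geom-telescopes : ∀ {q} → 1 ≤ q → ∀ a l → (q ∸ 1) * geom q a l + q ^ a ≡ q ^ (a + l)
  geom-telescopes {q} _ a zero    = trans (cong (_+ q ^ a) (*-zeroʳ (q ∸ 1))) (cong (q ^_) (sym (+-identityʳ a)))
  geom-telescopes {q} 1≤q a (suc l) = begin-equality
    (q ∸ 1) * (q ^ a + geom q (suc a) l) + q ^ a           ≡⟨ cong (_+ q ^ a) (*-distribˡ-+ (q ∸ 1) (q ^ a) _) ⟩
    ((q ∸ 1) * q ^ a + (q ∸ 1) * geom q (suc a) l) + q ^ a ≡⟨ +-assoc ((q ∸ 1) * q ^ a) _ _ ⟩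
    (q ∸ 1) * q ^ a + ((q ∸ 1) * geom q (suc a) l + q ^ a) ≡⟨ cong ((q ∸ 1) * q ^ a +_) (+-comm _ (q ^ a)) ⟩
    (q ∸ 1) * q ^ a + (q ^ a + (q ∸ 1) * geom q (suc a) l) ≡⟨ sym (+-assoc ((q ∸ 1) * q ^ a) _ _) ⟩
    ((q ∸ 1) * q ^ a + q ^ a) + (q ∸ 1) * geom q (suc a) l ≡⟨ cong (_+ (q ∸ 1) * geom q (suc a) l) ([q-1]*x+x≡q*x 1≤q (q ^ a)) ⟩
    q ^ suc a + (q ∸ 1) * geom q (suc a) l                 ≡⟨ +-comm (q ^ suc a) _ ⟩
    (q ∸ 1) * geom q (suc a) l + q ^ suc a                 ≡⟨ geom-telescopes 1≤q (suc a) l ⟩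
    q ^ (suc a + l)                                        ≡⟨ cong (q ^_) (sym (+-suc a l)) ⟩
    q ^ (a + suc l)                                        ∎
    where open ≤-Reasoning

  exponent-≤ : ∀ {q} → 2 ≤ q → ∀ {a b} → q ^ a ≤ q ^ b → a ≤ b
  exponent-≤ {q} 2≤q {a} {b} q^a≤q^b with a ≤? b
  ... | yes a≤b = a≤b
  ... | no  a≰b = contradiction q^a≤q^b (<⇒≱ (^-monoʳ-< q 2≤q (≰⇒> a≰b)))

  divide-by-q-1 : ∀ {q} → 2 ≤ q → ∀ {i n} → i ≤ n → ∀ Q c → Q * (q ^ n ∸ q ^ i) ≡ (q ∸ 1) * c → c ≡ Q * geom q i (n ∸ i)
  divide-by-q-1 {q} 2≤q {i} {n} i≤n Q c Q[q^n-q^i]≡[q-1]c = *-cancelˡ-≡ c _ (q ∸ 1) {{q-1≢0}} (begin-equality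
    (q ∸ 1) * c             ≡⟨ sym Q[q^n-q^i]≡[q-1]c ⟩
    Q * (q ^ n ∸ q ^ i)     ≡⟨ cong (Q *_) q^n-q^i≡ ⟩
    Q * ((q ∸ 1) * g)       ≡⟨ sym (*-assoc Q _ g) ⟩
    (Q * (q ∸ 1)) * g       ≡⟨ cong (_* g) (*-comm Q _) ⟩
    ((q ∸ 1) * Q) * g       ≡⟨ *-assoc (q ∸ 1) Q g ⟩
    (q ∸ 1) * (Q * g)       ∎)
    where
      open ≤-Reasoning
      g : ℕ
      g = geom q i (n ∸ i)
      q-1≢0 : NonZero (q ∸ 1)
      q-1≢0 = >-nonZero (m<n⇒0<n∸m 2≤q)
      q^n-q^i≡ : q ^ n ∸ q ^ i ≡ (q ∸ 1) * g
      q^n-q^i≡ = begin-equality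
        q ^ n ∸ q ^ i                    ≡⟨ cong (λ e → q ^ e ∸ q ^ i) (sym (m+[n∸m]≡n i≤n)) ⟩
        q ^ (i + (n ∸ i)) ∸ q ^ i        ≡⟨ cong (_∸ q ^ i) (sym (geom-telescopes (≤-trans (s≤s z≤n) 2≤q) i (n ∸ i))) ⟩
        (q ∸ 1) * g + q ^ i ∸ q ^ i      ≡⟨ m+n∸n≡m _ (q ^ i) ⟩
        (q ∸ 1) * g                      ∎

  1+[a+[b+c]]∸1∸b∸a≡c : ∀ a b c → suc (a + (b + c)) ∸ 1 ∸ b ∸ a ≡ c
  1+[a+[b+c]]∸1∸b∸a≡c a b c = begin-equality
    a + (b + c) ∸ b ∸ a   ≡⟨ cong (λ z → z ∸ b ∸ a) (trans (sym (+-assoc a b c)) (trans (cong (_+ c) (+-comm a b)) (+-assoc b a c))) ⟩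
    b + (a + c) ∸ b ∸ a   ≡⟨ cong (_∸ a) (m+n∸m≡n b (a + c)) ⟩
    a + c ∸ a             ≡⟨ m+n∸m≡n a c ⟩
    c                     ∎
    where open ≤-Reasoning

  1+[a+[b+c]]∸1∸[a+b]≡c : ∀ a b c → suc (a + (b + c)) ∸ 1 ∸ (a + b) ≡ c
  1+[a+[b+c]]∸1∸[a+b]≡c a b c = trans (cong (_∸ (a + b)) (sym (+-assoc a b c))) (m+n∸m≡n (a + b) c)

  Q+Q*geom≡Q*geom : ∀ Q q n → 1 ≤ n → Q + Q * geom q 1 (n ∸ 1) ≡ Q * geom q 0 n
  Q+Q*geom≡Q*geom Q q (suc n) _ = sym (*-suc Q (geom q 1 n))

module ClubCode (X : FieldExtension) (B : SesquilinearForm X) (D : DualCodeData X B)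
  {i : ℕ} (1≤i : 1 Nat.≤ i) (i<m : i Nat.< FieldExtension.m X)
  (club : FieldTheory.IsClub (FieldExtension.K X) (FieldExtension.F X) (DualCodeData.U D) i) where

  open FieldExtension X
  open SesquilinearForm B
  open DualCodeData D
  open DualCode X B D public
  open FiniteExtension X using (_≟_; 2≤q)
  open import Data.Nat as ℕ using (_≤_; _<_; _∸_; z≤n; s≤s)
  import Data.Nat.Properties as ℕ
  open import Data.Product using (Σ; ∃; _×_; _,_; proj₁; proj₂)
  open import Data.Sum using (_⊎_; inj₁; inj₂)
  open import Data.Unit using (tt)
  open import Data.Vec as Vec using ([]; _∷_; replicate)
  import Data.Vec.Relation.Unary.All as All
  open import Relation.Binary.PropositionalEquality
  open import Relation.Nullary using (¬_; Dec; yes; no; _×-dec_; ¬?; contradiction)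
  open import Relation.Unary using (Decidable)
  import Relation.Nullary.Decidable as Dec
  open FieldProperties K _≟_
  open VectorSpaces K _≟_ using (_⊕v_; _·v_; 0v; vecs-laws; module VSpaceLaws; module VSpaceProperties)
  open VSpaceLaws (vecs-laws k)
  open VSpaceProperties (vecs-laws k)
  open FieldTheory K using (codeword; vecs; scalars; RankWeight; PointWeight)
  open Counting
  open ≡-Reasoning

  u₀ : V
  u₀ = proj₁ club

  u₀≢0 : u₀ ≢ 0v
  u₀≢0 = proj₁ (proj₂ (proj₂ club))

  weight-u₀ : PointWeight F U u₀ i
  weight-u₀ = proj₁ (proj₂ (proj₂ (proj₂ club)))

  weight-others : ∀ u → U u → u ≢ 0v → (∃ λ a → u ≡ a ·v u₀) ⊎ PointWeight F U u 1
  weight-others = proj₂ (proj₂ (proj₂ (proj₂ club)))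

  OnClubLine : V → Set
  OnClubLine y = Σ Carrier λ a → y ≡ a ·v u₀

  MeetsU : V → Set
  MeetsU y = Σ Carrier λ a → a ≢ 0# × U (a ·v y)

  OnClubLine? : Decidable OnClubLine
  OnClubLine? y = search |K| (λ a → y ≟V (a ·v u₀))

  MeetsU? : Decidable MeetsU
  MeetsU? y = search |K| (λ a → ¬? (a ≟ 0#) ×-dec U? (a ·v y))

  OnClubLine-scale : ∀ {y} a → OnClubLine y → OnClubLine (a ·v y)
  OnClubLine-scale {y} a (b , y≡bu₀) = a * b , trans (cong (a ·v_) y≡bu₀) (sym (·-assoc a b u₀))

  OnClubLine-nonZero : ∀ {y} → y ≢ 0v → OnClubLine y → Σ Carrier λ a → a ≢ 0# × y ≡ a ·v u₀
  OnClubLine-nonZero {y} y≢0 (a , y≡au₀) with a ≟ 0#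
  ... | yes refl = contradiction (trans y≡au₀ (·-zeroˡ u₀)) y≢0
  ... | no  a≢0  = a , a≢0 , y≡au₀

  ·v-nonZero : ∀ {a y} → a ≢ 0# → y ≢ 0v → a ·v y ≢ 0v
  ·v-nonZero a≢0 y≢0 ay≡0 = y≢0 (·-cancel-nonZero _ a≢0 ay≡0)

  -- b ↦ b y maps ScalarsIntoU y bijectively onto U ∩ ⟨y⟩.
  pointWeight⇒count : ∀ {y} → y ≢ 0v → ∀ {w} → PointWeight F U y w → HasCount (ScalarsIntoU y) (q ℕ.^ w)
  pointWeight⇒count {y} y≢0 {w} weight = subst (HasCount _) (sym |Λ|≡) (proj₂ (subset-count |K| (λ b → U? (b ·v y))))
    where
      U∩Ky-subspace : Subspace (λ v → U v × ∃ λ a → v ≡ a ·v y)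
      U∩Ky-subspace =
        (proj₁ U-subspace , 0# , sym (·-zeroˡ y)) ,
        (λ u v (Uu , a , u≡) (Uv , b , v≡) → proj₁ (proj₂ U-subspace) u v Uu Uv , a + b ,
           trans (cong₂ _⊕v_ u≡ v≡) (sym (·-distribʳ a b y))) ,
        (λ c u Fc (Uu , a , u≡) → proj₂ (proj₂ U-subspace) c u Fc Uu , c * a , trans (cong (c ·v_) u≡) (sym (·-assoc c a y)))
      |Λ|≡ : q ℕ.^ w ≡ proj₁ (subset-count |K| (λ b → U? (b ·v y)))
      |Λ|≡ = count-unique (Span-V.dim⇒count U∩Ky-subspace weight)
               (image-count (_·v y) (proj₂ (subset-count |K| (λ b → U? (b ·v y)))) (λ a b _ _ → ·-injectiveˡ y≢0 a b))
               (λ v (Uv , b , v≡by) → b , subst U v≡by Uv , sym v≡by) (λ v (b , Uby , by≡v) → subst U by≡v Uby , b , sym by≡v)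

  ScalarsIntoU-rescale : ∀ {u y a} → a ≢ 0# → u ≡ a ·v y → ∀ {t} → HasCount (ScalarsIntoU u) t → HasCount (ScalarsIntoU y) t
  ScalarsIntoU-rescale {u} {y} {a} a≢0 u≡ay h =
    count-cong (λ c (b , Ubu , ba≡c) → subst U (trans (cong (b ·v_) u≡ay) (trans (sym (·-assoc b a y)) (cong (_·v y) ba≡c))) Ubu)
               (λ c Ucy → c * a ⁻¹ , subst U (sym (trans (cong ((c * a ⁻¹) ·v_) u≡ay) (trans (sym (·-assoc _ a y)) (cong (_·v y) (ca⁻¹a≡c c))))) Ucy , ca⁻¹a≡c c)
               (image-count (_* a) h (λ b b′ _ _ ba≡b′a → *-cancelˡ-nonZero b b′ a≢0 (trans (*-comm a b) (trans ba≡b′a (*-comm b′ a)))))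
    where
      ca⁻¹a≡c : ∀ c → (c * a ⁻¹) * a ≡ c
      ca⁻¹a≡c c = trans (*-assoc c _ a) (trans (cong (c *_) (x⁻¹*x≡1 a≢0)) (*-identityʳ c))

  ScalarsIntoU-onClubLine : ∀ {y} → y ≢ 0v → OnClubLine y → HasCount (ScalarsIntoU y) (q ℕ.^ i)
  ScalarsIntoU-onClubLine {y} y≢0 onLine with (a , a≢0 , y≡au₀) ← OnClubLine-nonZero y≢0 onLine =
    ScalarsIntoU-rescale (⁻¹-nonZero a≢0) (·-flip y u₀ a≢0 y≡au₀) (pointWeight⇒count u₀≢0 weight-u₀)

  ScalarsIntoU-meetsU : ∀ {y} → y ≢ 0v → ¬ OnClubLine y → MeetsU y → HasCount (ScalarsIntoU y) (q ℕ.^ 1)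
  ScalarsIntoU-meetsU {y} y≢0 ¬onLine (a , a≢0 , U-ay) with weight-others (a ·v y) U-ay (·v-nonZero a≢0 y≢0)
  ... | inj₁ ay-onLine = contradiction (subst OnClubLine (sym (·-flip (a ·v y) y a≢0 refl)) (OnClubLine-scale (a ⁻¹) ay-onLine)) ¬onLine
  ... | inj₂ weight-1  = ScalarsIntoU-rescale a≢0 refl (pointWeight⇒count (·v-nonZero a≢0 y≢0) weight-1)

  ScalarsIntoU-missesU : ∀ {y} → ¬ MeetsU y → HasCount (ScalarsIntoU y) (q ℕ.^ 0)
  ScalarsIntoU-missesU {y} ¬meets =
    count-cong (λ b b≡0 → subst U (sym (trans (cong (_·v y) b≡0) (·-zeroˡ y))) (proj₁ U-subspace))
               (λ b U-by → Dec.decidable-stable (b ≟ 0#) λ b≢0 → ¬meets (b , b≢0 , U-by))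
               (singleton-count 0#)

  data Class : Set where
    zeroVector clubPoint weightOnePoint outsidePoint : Class

  -- The class of x is the kind of the point ⟨R⁻¹ x⟩ relative to L_U.
  InClass : Class → V → Set
  InClass zeroVector     x = x ≡ 0v
  InClass clubPoint      x = x ≢ 0v × OnClubLine (R⁻¹ x)
  InClass weightOnePoint x = x ≢ 0v × ¬ OnClubLine (R⁻¹ x) × MeetsU (R⁻¹ x)
  InClass outsidePoint   x = x ≢ 0v × ¬ OnClubLine (R⁻¹ x) × ¬ MeetsU (R⁻¹ x)

  classify : ∀ x → Σ Class λ c → InClass c x
  classify x = decide (x ≟V 0v) (OnClubLine? (R⁻¹ x)) (MeetsU? (R⁻¹ x))
    where
      decide : Dec (x ≡ 0v) → Dec (OnClubLine (R⁻¹ x)) → Dec (MeetsU (R⁻¹ x)) → Σ Class λ c → InClass c x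
      decide (yes x≡0) _         _           = zeroVector , x≡0
      decide (no  x≢0) (yes on)  _           = clubPoint , x≢0 , on
      decide (no  x≢0) (no  ¬on) (yes meets) = weightOnePoint , x≢0 , ¬on , meets
      decide (no  x≢0) (no  ¬on) (no ¬meets) = outsidePoint , x≢0 , ¬on , ¬meets

  class : V → Class
  class x = proj₁ (classify x)

  InClass-unique : ∀ {c c′ x} → InClass c x → InClass c′ x → c ≡ c′
  InClass-unique {zeroVector}     {zeroVector}     _ _ = refl
  InClass-unique {clubPoint}      {clubPoint}      _ _ = refl
  InClass-unique {weightOnePoint} {weightOnePoint} _ _ = refl
  InClass-unique {outsidePoint}   {outsidePoint}   _ _ = refl
  InClass-unique {zeroVector}     {clubPoint}      x≡0 (x≢0 , _)          = contradiction x≡0 x≢0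
  InClass-unique {zeroVector}     {weightOnePoint} x≡0 (x≢0 , _)          = contradiction x≡0 x≢0
  InClass-unique {zeroVector}     {outsidePoint}   x≡0 (x≢0 , _)          = contradiction x≡0 x≢0
  InClass-unique {clubPoint}      {zeroVector}     (x≢0 , _) x≡0          = contradiction x≡0 x≢0
  InClass-unique {weightOnePoint} {zeroVector}     (x≢0 , _) x≡0          = contradiction x≡0 x≢0
  InClass-unique {outsidePoint}   {zeroVector}     (x≢0 , _) x≡0          = contradiction x≡0 x≢0
  InClass-unique {clubPoint}      {weightOnePoint} (_ , on) (_ , ¬on , _) = contradiction on ¬on
  InClass-unique {clubPoint}      {outsidePoint}   (_ , on) (_ , ¬on , _) = contradiction on ¬on
  InClass-unique {weightOnePoint} {clubPoint}      (_ , ¬on , _) (_ , on) = contradiction on ¬on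
  InClass-unique {outsidePoint}   {clubPoint}      (_ , ¬on , _) (_ , on) = contradiction on ¬on
  InClass-unique {weightOnePoint} {outsidePoint}   (_ , _ , meets) (_ , _ , ¬meets) = contradiction meets ¬meets
  InClass-unique {outsidePoint}   {weightOnePoint} (_ , _ , ¬meets) (_ , _ , meets) = contradiction meets ¬meets

  class⇔InClass : ∀ c {a} → HasCount (InClass c) a → HasCount (λ x → class x ≡ c) a
  class⇔InClass c = count-cong (λ x x∈c → InClass-unique (proj₂ (classify x)) x∈c)
                               (λ { x refl → proj₂ (classify x) })

  weightOf : Class → ℕ
  weightOf zeroVector     = 0
  weightOf clubPoint      = m ∸ i
  weightOf weightOnePoint = m ∸ 1
  weightOf outsidePoint   = m

  weight : V → ℕ
  weight x = weightOf (class x)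

  rankWeight-0 : RankWeight F (replicate N 0#) 0
  rankWeight-0 = [] , All.[] , Span-K.[]-independent , λ s (c , Fc , c·0≡s) → [] , All.[] , trans (sym (combo-0s c)) c·0≡s
    where
      open FieldTheory K using (combo)
      combo-0s : ∀ {l} (c : Vec Carrier l) → combo scalars c (replicate l 0#) ≡ 0#
      combo-0s []      = refl
      combo-0s (a ∷ c) = trans (cong₂ _+_ (zeroʳ a) (combo-0s c)) (+-identityˡ 0#)

  rankWeight-unique : ∀ {c : Vec Carrier N} {j j′} → RankWeight F c j → RankWeight F c j′ → j ≡ j′
  rankWeight-unique {c} = Span-K.dim-unique (Span-K.span-subspace c)

  InClass⇒rankWeight : ∀ c x → InClass c x → RankWeight F (codeword G x) (weightOf c)
  InClass⇒rankWeight zeroVector x refl = subst (λ c → RankWeight F c 0) (sym (codeword-0 G)) rankWeight-0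
    where open DotProduct K _≟_ using (codeword-0)
  InClass⇒rankWeight clubPoint x (x≢0 , on) =
    CodewordOfWeight.rankWeight x x≢0 i (ℕ.<⇒≤ i<m) (ScalarsIntoU-onClubLine (R⁻¹-nonZero x≢0) on)
  InClass⇒rankWeight weightOnePoint x (x≢0 , ¬on , meets) =
    CodewordOfWeight.rankWeight x x≢0 1 (ℕ.≤-trans 1≤i (ℕ.<⇒≤ i<m)) (ScalarsIntoU-meetsU (R⁻¹-nonZero x≢0) ¬on meets)
  InClass⇒rankWeight outsidePoint x (x≢0 , ¬on , ¬meets) =
    CodewordOfWeight.rankWeight x x≢0 0 z≤n (ScalarsIntoU-missesU ¬meets)

  codeword-rankWeight : ∀ x → RankWeight F (codeword G x) (weight x)
  codeword-rankWeight x = InClass⇒rankWeight (class x) x (proj₂ (classify x))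

  1≤m-i : 1 ≤ m ∸ i
  1≤m-i = ℕ.m<n⇒0<n∸m i<m

  m-i≤m-1 : m ∸ i ≤ m ∸ 1
  m-i≤m-1 = ℕ.∸-monoʳ-≤ m 1≤i

  m-1<m : m ∸ 1 < m
  m-1<m = ℕ.∸-monoʳ-< {m} {1} {0} (s≤s z≤n) (ℕ.≤-trans 1≤i (ℕ.<⇒≤ i<m))

  weightOf≡0 : ∀ c → weightOf c ≡ 0 → c ≡ zeroVector
  weightOf≡0 zeroVector     _   = refl
  weightOf≡0 clubPoint      w≡0 = contradiction w≡0 (ℕ.m<n⇒n≢0 1≤m-i)
  weightOf≡0 weightOnePoint w≡0 = contradiction w≡0 (ℕ.m<n⇒n≢0 (ℕ.≤-trans 1≤m-i m-i≤m-1))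
  weightOf≡0 outsidePoint   w≡0 = contradiction w≡0 (ℕ.m<n⇒n≢0 1≤m)

  weightOf≡m : ∀ c → weightOf c ≡ m → c ≡ outsidePoint
  weightOf≡m zeroVector     w≡m = contradiction (sym w≡m) (ℕ.m<n⇒n≢0 1≤m)
  weightOf≡m clubPoint      w≡m = contradiction w≡m (ℕ.<⇒≢ (ℕ.≤-<-trans m-i≤m-1 m-1<m))
  weightOf≡m weightOnePoint w≡m = contradiction w≡m (ℕ.<⇒≢ m-1<m)
  weightOf≡m outsidePoint   _   = refl

  weightOf-injective : 1 < i → ∀ c c′ → weightOf c ≡ weightOf c′ → c ≡ c′
  weightOf-injective _   c              zeroVector     w≡w′ = weightOf≡0 c w≡w′
  weightOf-injective _   c              outsidePoint   w≡w′ = weightOf≡m c w≡w′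
  weightOf-injective _   zeroVector     c′             w≡w′ = sym (weightOf≡0 c′ (sym w≡w′))
  weightOf-injective _   outsidePoint   c′             w≡w′ = sym (weightOf≡m c′ (sym w≡w′))
  weightOf-injective _   clubPoint      clubPoint      _    = refl
  weightOf-injective _   weightOnePoint weightOnePoint _    = refl
  weightOf-injective 1<i clubPoint      weightOnePoint w≡w′ = contradiction w≡w′ (ℕ.<⇒≢ (ℕ.∸-monoʳ-< 1<i (ℕ.<⇒≤ i<m)))
  weightOf-injective 1<i weightOnePoint clubPoint      w≡w′ = contradiction (sym w≡w′) (ℕ.<⇒≢ (ℕ.∸-monoʳ-< 1<i (ℕ.<⇒≤ i<m)))

  weightOf≡m-1 : i ≡ 1 → ∀ c → weightOf c ≡ m ∸ 1 → c ≡ clubPoint ⊎ c ≡ weightOnePoint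
  weightOf≡m-1 _ zeroVector     w≡m-1 = contradiction (weightOf≡0 weightOnePoint (sym w≡m-1)) λ ()
  weightOf≡m-1 _ clubPoint      _     = inj₁ refl
  weightOf≡m-1 _ weightOnePoint _     = inj₂ refl
  weightOf≡m-1 _ outsidePoint   w≡m-1 = contradiction (weightOf≡m weightOnePoint (sym w≡m-1)) λ ()

  codeword-injective : ∀ x x′ → codeword G x ≡ codeword G x′ → x ≡ x′
  codeword-injective x x′ xG≡x′G = x⊖y≡o⇒x≡y x x′ (subst (λ c → InClass c (x ⊕v ⊖ x′)) class≡0 (proj₂ (classify (x ⊕v ⊖ x′))))
    where
      open DotProduct K _≟_ using (codeword-homo-⊕; codeword-homo-·)
      open VSpaceProperties (vecs-laws N) using () renaming (⊕-inverseʳ to ⊕v-inverseʳ)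
      [x-x′]G≡0 : codeword G (x ⊕v ⊖ x′) ≡ replicate N 0#
      [x-x′]G≡0 = begin
        codeword G (x ⊕v ⊖ x′)                      ≡⟨ codeword-homo-⊕ G x _ ⟩
        codeword G x ⊕v codeword G (⊖ x′)           ≡⟨ cong (codeword G x ⊕v_) (codeword-homo-· G (- 1#) x′) ⟩
        codeword G x ⊕v (- 1#) ·v codeword G x′     ≡⟨ cong (λ c → c ⊕v (- 1#) ·v codeword G x′) xG≡x′G ⟩
        codeword G x′ ⊕v (- 1#) ·v codeword G x′    ≡⟨ ⊕v-inverseʳ _ ⟩
        replicate N 0#                              ∎
      class≡0 : class (x ⊕v ⊖ x′) ≡ zeroVector
      class≡0 = weightOf≡0 (class (x ⊕v ⊖ x′)) (rankWeight-unique {c = codeword G (x ⊕v ⊖ x′)} (codeword-rankWeight (x ⊕v ⊖ x′))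
                                                   (subst (λ c → RankWeight F c 0) (sym [x-x′]G≡0) rankWeight-0))

  numOfWeight : ∀ j {a} → HasCount (λ x → weight x ≡ j) a → FieldTheory.NumOfWeight K F G j a
  numOfWeight j h = count-cong
    (λ c (x , wx≡j , xG≡c) → (x , xG≡c) , subst (λ c → RankWeight F c j) xG≡c (subst (RankWeight F _) wx≡j (codeword-rankWeight x)))
    (λ c ((x , xG≡c) , rw) → x , rankWeight-unique (codeword-rankWeight x) (subst (λ c → RankWeight F c j) (sym xG≡c) rw) , xG≡c)
    (image-count (codeword G) h (λ x x′ _ _ → codeword-injective x x′))

  |K*| : HasCount (_≢ 0#) (q ℕ.^ m ∸ 1)
  |K*| = count-cong (λ _ → proj₂) (λ _ a≢0 → tt , a≢0) (delete-count _≟_ |K| tt)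

  via-R⁻¹ : (P : V → Set) → ∀ {c} → HasCount (λ y → y ≢ 0v × P y) c → HasCount (λ x → x ≢ 0v × P (R⁻¹ x)) c
  via-R⁻¹ P h = count-cong
    (λ { x (y , (y≢0 , Py) , refl) → R-nonZero y≢0 , subst P (sym (R⁻¹∘R y)) Py })
    (λ x (x≢0 , PR⁻¹x) → R⁻¹ x , (R⁻¹-nonZero x≢0 , PR⁻¹x) , R∘R⁻¹ x)
    (image-count R h (λ y y′ _ _ → R-injective y y′))

  |clubPoint| : HasCount (InClass clubPoint) (q ℕ.^ m ∸ 1)
  |clubPoint| = via-R⁻¹ OnClubLine (count-cong
    (λ { y (a , a≢0 , refl) → ·v-nonZero a≢0 u₀≢0 , a , refl })
    (λ y (y≢0 , onLine) → let (a , a≢0 , y≡au₀) = OnClubLine-nonZero y≢0 onLine in a , a≢0 , sym y≡au₀)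
    (image-count (_·v u₀) |K*| (λ a b _ _ → ·-injectiveˡ u₀≢0 a b)))

  -- The pairs (a, u) with a ≠ 0 and u ∈ U off the club line cover each weight-one point y exactly q - 1 times,
  -- once for every b ≠ 0 with b y ∈ U.
  module WeightOnePoints where

    WeightOne : V → Set
    WeightOne y = ¬ OnClubLine y × MeetsU y

    ¬OnClubLine⇒≢0 : ∀ {y} → ¬ OnClubLine y → y ≢ 0v
    ¬OnClubLine⇒≢0 ¬on y≡0 = ¬on (0# , trans y≡0 (sym (·-zeroˡ u₀)))

    U∩Ku₀-subspace : Subspace (λ v → U v × OnClubLine v)
    U∩Ku₀-subspace =
      (proj₁ U-subspace , 0# , sym (·-zeroˡ u₀)) ,
      (λ u v (Uu , a , u≡) (Uv , b , v≡) → proj₁ (proj₂ U-subspace) u v Uu Uv , a + b ,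
         trans (cong₂ _⊕v_ u≡ v≡) (sym (·-distribʳ a b u₀))) ,
      (λ c u Fc (Uu , a , u≡) → proj₂ (proj₂ U-subspace) c u Fc Uu , c * a , trans (cong (c ·v_) u≡) (sym (·-assoc c a u₀)))

    |U∩Ku₀| : HasCount (λ v → U v × OnClubLine v) (q ℕ.^ i)
    |U∩Ku₀| = Span-V.dim⇒count U∩Ku₀-subspace weight-u₀

    |U∖Ku₀| : HasCount (λ v → U v × ¬ OnClubLine v) (q ℕ.^ n ∸ q ℕ.^ i)
    |U∖Ku₀| = difference-count |U| |U∩Ku₀| OnClubLine?

    i≤n : i ≤ n
    i≤n = ClubArithmetic.exponent-≤ 2≤q (WithDecEq.count-mono _≟V_ |U∩Ku₀| |U| (λ _ → proj₁))

    weightOne? : Decidable (λ y → y ≢ 0v × WeightOne y)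
    weightOne? y = ¬? (y ≟V 0v) ×-dec (¬? (OnClubLine? y) ×-dec MeetsU? y)

    weightOne-size : ℕ
    weightOne-size = proj₁ (subset-count |V| weightOne?)

    |WeightOne| : HasCount (λ y → y ≢ 0v × WeightOne y) weightOne-size
    |WeightOne| = proj₂ (subset-count |V| weightOne?)

    fibre : ∀ y → y ≢ 0v × WeightOne y →
            HasCount (λ (p : Carrier × V) → (proj₁ p ≢ 0# × (U (proj₂ p) × ¬ OnClubLine (proj₂ p))) × proj₁ p ·v proj₂ p ≡ y) (q ∸ 1)
    fibre y (y≢0 , ¬on , meets) = count-cong into onto (image-count (λ b → b ⁻¹ , b ·v y) Λ* (λ b b′ _ _ eq → ·-injectiveˡ y≢0 b b′ (cong proj₂ eq)))
      where
        Λ* : HasCount (λ b → b ≢ 0# × U (b ·v y)) (q ∸ 1)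
        Λ* = count-cong (λ _ (Uby , b≢0) → b≢0 , Uby) (λ _ (b≢0 , Uby) → Uby , b≢0)
               (subst (λ s → HasCount (λ b → ScalarsIntoU y b × b ≢ 0#) (s ∸ 1)) (ℕ.*-identityʳ q)
                      (delete-count _≟_ (ScalarsIntoU-meetsU y≢0 ¬on meets) (subst U (sym (·-zeroˡ y)) (proj₁ U-subspace))))
        ¬on-scaled : ∀ {b} → b ≢ 0# → ¬ OnClubLine (b ·v y)
        ¬on-scaled b≢0 on = ¬on (subst OnClubLine (sym (·-flip _ y b≢0 refl)) (OnClubLine-scale _ on))
        into : ∀ p → _ → _
        into _ (b , (b≢0 , Uby) , refl) = (⁻¹-nonZero b≢0 , Uby , ¬on-scaled b≢0) , sym (·-flip _ y b≢0 refl)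
        onto : ∀ p → _ → _
        onto (a , u) ((a≢0 , Uu , ¬on-u) , au≡y) = a ⁻¹ , (⁻¹-nonZero a≢0 , subst U u≡ Uu) , cong₂ _,_ (⁻¹-involutive a≢0) (sym u≡)
          where
            u≡ : u ≡ a ⁻¹ ·v y
            u≡ = trans (·-flip _ u a≢0 refl) (cong (a ⁻¹ ·v_) au≡y)

    count-relation : (q ℕ.^ m ∸ 1) ℕ.* (q ℕ.^ n ∸ q ℕ.^ i) ≡ (q ∸ 1) ℕ.* weightOne-size
    count-relation = fibre-count _≟V_ (λ p → proj₁ p ·v proj₂ p)
      (×-count |K*| |U∖Ku₀|) |WeightOne|
      (λ (a , u) (a≢0 , Uu , ¬on) → ·v-nonZero a≢0 (¬OnClubLine⇒≢0 ¬on) ,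
          (λ on → ¬on (subst OnClubLine (sym (·-flip _ u a≢0 refl)) (OnClubLine-scale _ on))) ,
          a ⁻¹ , ⁻¹-nonZero a≢0 , subst U (·-flip _ u a≢0 refl) Uu)
      fibre

  |weightOnePoint| : HasCount (InClass weightOnePoint) ((q ℕ.^ m ∸ 1) ℕ.* geom q i (n ∸ i))
  |weightOnePoint| = via-R⁻¹ WeightOne
    (subst (HasCount _) (ClubArithmetic.divide-by-q-1 2≤q i≤n (q ℕ.^ m ∸ 1) _ count-relation) |WeightOne|)
    where open WeightOnePoints

  outsidePoint? : Decidable (InClass outsidePoint)
  outsidePoint? x = ¬? (x ≟V 0v) ×-dec (¬? (OnClubLine? (R⁻¹ x)) ×-dec ¬? (MeetsU? (R⁻¹ x)))

  outside-size : ℕ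
  outside-size = proj₁ (subset-count |V| outsidePoint?)

  |outsidePoint| : HasCount (InClass outsidePoint) outside-size
  |outsidePoint| = proj₂ (subset-count |V| outsidePoint?)

  InClass-disjoint : ∀ c c′ → c ≢ c′ → ∀ x → InClass c x → ¬ InClass c′ x
  InClass-disjoint c c′ c≢c′ x x∈c x∈c′ = c≢c′ (InClass-unique x∈c x∈c′)

  classes-partition : (q ℕ.^ m) ℕ.^ k ≡
    1 ℕ.+ ((q ℕ.^ m ∸ 1) ℕ.+ ((q ℕ.^ m ∸ 1) ℕ.* geom q i (n ∸ i) ℕ.+ outside-size))
  classes-partition = count-unique |V| all-classes (λ x _ → member (proj₂ (classify x))) (λ _ _ → tt)
    where
      member : ∀ {c x} → InClass c x → InClass zeroVector x ⊎ InClass clubPoint x ⊎ InClass weightOnePoint x ⊎ InClass outsidePoint x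
      member {zeroVector}     x∈c = inj₁ x∈c
      member {clubPoint}      x∈c = inj₂ (inj₁ x∈c)
      member {weightOnePoint} x∈c = inj₂ (inj₂ (inj₁ x∈c))
      member {outsidePoint}   x∈c = inj₂ (inj₂ (inj₂ x∈c))
      all-classes : HasCount (λ x → InClass zeroVector x ⊎ InClass clubPoint x ⊎ InClass weightOnePoint x ⊎ InClass outsidePoint x)
                             (1 ℕ.+ ((q ℕ.^ m ∸ 1) ℕ.+ ((q ℕ.^ m ∸ 1) ℕ.* geom q i (n ∸ i) ℕ.+ outside-size)))
      all-classes = disjoint-union-count (singleton-count 0v)
        (disjoint-union-count |clubPoint|
          (disjoint-union-count |weightOnePoint| |outsidePoint| (InClass-disjoint weightOnePoint outsidePoint λ ()))
          λ x x∈c → λ { (inj₁ x∈c′) → InClass-disjoint clubPoint weightOnePoint (λ ()) x x∈c x∈c′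
                      ; (inj₂ x∈c′) → InClass-disjoint clubPoint outsidePoint (λ ()) x x∈c x∈c′ })
        λ x x∈c → λ { (inj₁ x∈c′)        → InClass-disjoint zeroVector clubPoint (λ ()) x x∈c x∈c′
                    ; (inj₂ (inj₁ x∈c′)) → InClass-disjoint zeroVector weightOnePoint (λ ()) x x∈c x∈c′
                    ; (inj₂ (inj₂ x∈c′)) → InClass-disjoint zeroVector outsidePoint (λ ()) x x∈c x∈c′ }

  weight-count : ∀ c {a} → (∀ c′ → weightOf c′ ≡ weightOf c → c′ ≡ c) → HasCount (InClass c) a →
                 HasCount (λ x → weight x ≡ weightOf c) a
  weight-count c only-c h = count-cong (λ x class≡c → cong weightOf class≡c) (λ x w≡ → only-c (class x) w≡) (class⇔InClass c h)

  no-weight : ∀ j → (∀ c → weightOf c ≢ j) → HasCount (λ x → weight x ≡ j) 0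
  no-weight j ≢j = ∅-count (λ x → ≢j (class x))

  weightOf≥m-i : ∀ c → c ≢ zeroVector → m ∸ i ≤ weightOf c
  weightOf≥m-i zeroVector     c≢0 = contradiction refl c≢0
  weightOf≥m-i clubPoint      _   = ℕ.≤-refl
  weightOf≥m-i weightOnePoint _   = m-i≤m-1
  weightOf≥m-i outsidePoint   _   = ℕ.m∸n≤m m i

  |Code| : HasCount (FieldTheory.Code K G) ((q ℕ.^ m) ℕ.^ k)
  |Code| = count-cong (λ c (x , _ , xG≡c) → x , xG≡c) (λ c (x , xG≡c) → x , tt , xG≡c)
                      (image-count (codeword G) |V| (λ x x′ _ _ → codeword-injective x x′))

  isCode : FieldTheory.IsCode K F G k (m ∸ i)
  isCode =
    FiniteSubfieldSpan.count⇒dim K _≟_ (vecs-laws N) K-subfield |K| code-subspace |Code| ,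
    (codeword G x₀ , (x₀ , refl) , x₀G≢0 , InClass⇒rankWeight clubPoint x₀ x₀∈club) ,
    λ c j (x , xG≡c) c≢0 rw → subst (m ∸ i ≤_) (rankWeight-unique (codeword-rankWeight x) (subst (λ c → RankWeight F c j) (sym xG≡c) rw))
                                    (weightOf≥m-i (class x) λ class≡0 → c≢0 (trans (sym xG≡c)
                                      (trans (cong (codeword G) (subst (λ c → InClass c x) class≡0 (proj₂ (classify x)))) (codeword-0 G))))
    where
      open FiniteExtension X using (K-subfield)
      open DotProduct K _≟_ using (codeword-0; codeword-homo-⊕; codeword-homo-·)
      code-subspace : FieldTheory.IsSubspace K (vecs N) (λ _ → ⊤) (FieldTheory.Code K G)
      code-subspace = (0v , codeword-0 G) ,
        (λ c c′ (x , xG≡c) (x′ , x′G≡c′) → x ⊕v x′ , trans (codeword-homo-⊕ G x x′) (cong₂ _⊕v_ xG≡c x′G≡c′)) ,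
        (λ a c _ (x , xG≡c) → a ·v x , trans (codeword-homo-· G a x) (cong (a ·v_) xG≡c))
      x₀ : V
      x₀ = R u₀
      x₀∈club : InClass clubPoint x₀
      x₀∈club = R-nonZero u₀≢0 , subst OnClubLine (sym (R⁻¹∘R u₀)) (1# , sym (·-identityˡ u₀))
      x₀G≢0 : codeword G x₀ ≢ replicate N 0#
      x₀G≢0 x₀G≡0 = contradiction (rankWeight-unique (InClass⇒rankWeight clubPoint x₀ x₀∈club)
                                     (subst (λ c → RankWeight F c 0) (sym x₀G≡0) rankWeight-0))
                                   (ℕ.m<n⇒n≢0 1≤m-i)

  private
    Q cB cC : ℕ
    Q  = q ℕ.^ m ∸ 1
    cB = Q ℕ.* geom q i (n ∸ i)
    cC = outside-size

    q^mk≡ : q ℕ.^ (m ℕ.* k) ≡ 1 ℕ.+ (Q ℕ.+ (cB ℕ.+ cC))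
    q^mk≡ = trans (sym (ℕ.^-*-assoc q m k)) classes-partition

  weightDistribution-i>1 : 1 < i →
      FieldTheory.NumOfWeight K F G 0 1
    × FieldTheory.NumOfWeight K F G (m ∸ i) (q ℕ.^ m ∸ 1)
    × FieldTheory.NumOfWeight K F G (m ∸ 1) ((q ℕ.^ m ∸ 1) ℕ.* geom q i (n ∸ i))
    × FieldTheory.NumOfWeight K F G m (q ℕ.^ (m ℕ.* k) ∸ 1 ∸ (q ℕ.^ m ∸ 1) ℕ.* geom q i (n ∸ i) ∸ (q ℕ.^ m ∸ 1))
    × (∀ j → j ≢ 0 → j ≢ m ∸ i → j ≢ m ∸ 1 → j ≢ m → FieldTheory.NumOfWeight K F G j 0)
  weightDistribution-i>1 1<i =
    numOfWeight 0       (weight-count zeroVector     (only zeroVector)     (singleton-count 0v)) ,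
    numOfWeight (m ∸ i) (weight-count clubPoint      (only clubPoint)      |clubPoint|) ,
    numOfWeight (m ∸ 1) (weight-count weightOnePoint (only weightOnePoint) |weightOnePoint|) ,
    numOfWeight m       (weight-count outsidePoint   (only outsidePoint)
                          (subst (HasCount _) (sym (trans (cong (λ t → t ∸ 1 ∸ cB ∸ Q) q^mk≡) (ClubArithmetic.1+[a+[b+c]]∸1∸b∸a≡c Q cB cC)))
                                 |outsidePoint|)) ,
    λ j j≢0 j≢m-i j≢m-1 j≢m → numOfWeight j (no-weight j λ
      { zeroVector w≡j → j≢0 (sym w≡j) ; clubPoint w≡j → j≢m-i (sym w≡j)
      ; weightOnePoint w≡j → j≢m-1 (sym w≡j) ; outsidePoint w≡j → j≢m (sym w≡j) })
    where
      only : ∀ c c′ → weightOf c′ ≡ weightOf c → c′ ≡ c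
      only c c′ = weightOf-injective 1<i c′ c

  weightDistribution-i≡1 : i ≡ 1 →
      FieldTheory.NumOfWeight K F G 0 1
    × FieldTheory.NumOfWeight K F G (m ∸ 1) ((q ℕ.^ m ∸ 1) ℕ.* geom q 0 n)
    × FieldTheory.NumOfWeight K F G m (q ℕ.^ (m ℕ.* k) ∸ 1 ∸ (q ℕ.^ m ∸ 1) ℕ.* geom q 0 n)
    × (∀ j → j ≢ 0 → j ≢ m ∸ 1 → j ≢ m → FieldTheory.NumOfWeight K F G j 0)
  weightDistribution-i≡1 refl =
    numOfWeight 0 (weight-count zeroVector (λ c′ → weightOf≡0 c′) (singleton-count 0v)) ,
    numOfWeight (m ∸ 1) (subst (HasCount _) Q+cB≡ (count-cong
      (λ x → λ { (inj₁ x∈club) → cong weightOf (InClass-unique {c′ = clubPoint} (proj₂ (classify x)) x∈club)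
               ; (inj₂ x∈one)  → cong weightOf (InClass-unique {c′ = weightOnePoint} (proj₂ (classify x)) x∈one) })
      (λ x w≡m-1 → case weightOf≡m-1 refl (class x) w≡m-1 of λ
        { (inj₁ class≡club) → inj₁ (subst (λ c → InClass c x) class≡club (proj₂ (classify x)))
        ; (inj₂ class≡one)  → inj₂ (subst (λ c → InClass c x) class≡one (proj₂ (classify x))) })
      (disjoint-union-count |clubPoint| |weightOnePoint| (InClass-disjoint clubPoint weightOnePoint λ ())))) ,
    numOfWeight m (weight-count outsidePoint (λ c′ → weightOf≡m c′)
      (subst (HasCount _) (sym (trans (cong₂ (λ t s → t ∸ 1 ∸ s) q^mk≡ (sym Q+cB≡)) (ClubArithmetic.1+[a+[b+c]]∸1∸[a+b]≡c Q cB cC)))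
             |outsidePoint|)) ,
    λ j j≢0 j≢m-1 j≢m → numOfWeight j (no-weight j λ
      { zeroVector w≡j → j≢0 (sym w≡j) ; clubPoint w≡j → j≢m-1 (sym w≡j)
      ; weightOnePoint w≡j → j≢m-1 (sym w≡j) ; outsidePoint w≡j → j≢m (sym w≡j) })
    where
      open import Function using (case_of_)
      1≤n : 1 ≤ n
      1≤n = WeightOnePoints.i≤n
      Q+cB≡ : Q ℕ.+ cB ≡ Q ℕ.* geom q 0 n
      Q+cB≡ = ClubArithmetic.Q+Q*geom≡Q*geom Q q n 1≤n

open import Data.Nat using (ℕ; _≤_; _<_; _+_; _*_; _∸_; _^_)
open import Data.Product using (_×_; _,_)
open import Data.Unit using (⊤)
open import Data.Vec using (Vec)
open import Relation.Binary.PropositionalEquality using (_≡_; _≢_)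

proposition4p3 :
    (q : ℕ) → IsPrimePower q → (k m i : ℕ) → 1 ≤ k → 1 ≤ m → 1 ≤ i → i < m →
    (K : Field) → HasCount (λ (_ : Field.Carrier K) → ⊤) (q ^ m) →
    (Fq : Field.Carrier K → Set) → FieldTheory.IsSubfield K Fq → HasCount Fq q →
    (θ : Field.Carrier K → Field.Carrier K) → FieldTheory.IsAutomorphism K θ →
    (σ0 : Vec (Field.Carrier K) k → Vec (Field.Carrier K) k → Field.Carrier K) →
    FieldTheory.IsSesquilinear K θ σ0 → FieldTheory.IsReflexive K σ0 →
    FieldTheory.IsNonDegenerate K σ0 →
    (U : Vec (Field.Carrier K) k → Set) → FieldTheory.IsSubspace K (FieldTheory.vecs K k) Fq U →
    (n : ℕ) → FieldTheory.HasDim K (FieldTheory.vecs K k) Fq U n →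
    FieldTheory.IsClub K Fq U i →
    (N : ℕ) → (G : Vec (Vec (Field.Carrier K) k) N) →
    FieldTheory.IsBasis K (FieldTheory.vecs K k) Fq (FieldTheory.Perp' K q m σ0 U) G →
    N ≡ k * m ∸ n
    × FieldTheory.IsCode K Fq G k (m ∸ i)
    × (1 < i →
        FieldTheory.NumOfWeight K Fq G 0 1
        × FieldTheory.NumOfWeight K Fq G (m ∸ i) (q ^ m ∸ 1)
        × FieldTheory.NumOfWeight K Fq G (m ∸ 1) ((q ^ m ∸ 1) * geom q i (n ∸ i))
        × FieldTheory.NumOfWeight K Fq G m
            (q ^ (m * k) ∸ 1 ∸ (q ^ m ∸ 1) * geom q i (n ∸ i) ∸ (q ^ m ∸ 1))
        × (∀ j → j ≢ 0 → j ≢ m ∸ i → j ≢ m ∸ 1 → j ≢ m → FieldTheory.NumOfWeight K Fq G j 0))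
    × (i ≡ 1 →
        FieldTheory.NumOfWeight K Fq G 0 1
        × FieldTheory.NumOfWeight K Fq G (m ∸ 1) ((q ^ m ∸ 1) * geom q 0 n)
        × FieldTheory.NumOfWeight K Fq G m (q ^ (m * k) ∸ 1 ∸ (q ^ m ∸ 1) * geom q 0 n)
        × (∀ j → j ≢ 0 → j ≢ m ∸ 1 → j ≢ m → FieldTheory.NumOfWeight K Fq G j 0))
proposition4p3 q (p , e , p-prime , _ , q≡p^e) k m i _ 1≤m 1≤i i<m K |K| Fq Fq-subfield |Fq|
               θ θ-automorphism σ0 σ0-sesquilinear _ σ0-nondegenerate U U-subspace n U-dim club N G G-basis =
  length≡km-n , isCode , weightDistribution-i>1 , weightDistribution-i≡1
  where
    X : FieldExtension
    X = record { q = q ; p = p ; e = e ; m = m ; p-prime = p-prime ; q≡p^e = q≡p^e ; 1≤m = 1≤m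
               ; K = K ; |K| = |K| ; F = Fq ; F-subfield = Fq-subfield ; |F| = |Fq| }
    B : SesquilinearForm X
    B = record { k = k ; θ = θ ; θ-automorphism = θ-automorphism ; σ = σ0
               ; σ-sesquilinear = σ0-sesquilinear ; σ-nondegenerate = σ0-nondegenerate }
    D : DualCodeData X B
    D = record { U = U ; U-subspace = U-subspace ; n = n ; U-dim = U-dim ; N = N ; G = G ; G-basis = G-basis }
    open ClubCode X B D 1≤i i<m club
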